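{- Let $t$ and $t'$ be hereditarily defined $\lambda_C$-terms and $\Gamma$ a list of distinct variables containing all their free variables. If $[\![t]\!]_\Gamma=[\![t']\!]_\Gamma$ in every $\lambda_C$-model, then $t\equiv_{\lambda_C}t'$.
   Context: The lambda calculus with constructors ($\lambda_C$). Fix a finite set of constructors $\{c_1,\dots,c_n\}$ (constants, distinct from variables). Terms: $t,u::=x\mid t\,u\mid\lambda x.t\mid c\mid\{\theta\}\cdot t$, where a case-binding $\theta=\{d_1\mapsto u_1;\dots;d_k\mapsto u_k\}$ ($k\ge0$, $d_j$ pairwise distinct constructors) has domain $\mathrm{dom}(\theta)=\{d_1,\dots,d_k\}$. Terms are up to $\alpha$-conversion. $\theta\circ\{d_1\mapsto t_1;\dots;d_k\mapsto t_k\}=\{d_1\mapsto\{\theta\}\cdot t_1;\dots;d_k\mapsto\{\theta\}\cdot t_k\}$. One-step reduction $\to$ is the contextual closure (also inside case-bindings) of: (AppLam) $(\lambda x.t)u\to t[x:=u]$; (LamApp) $\lambda x.t\,x\to t$ if $x\notin FV(t)$; (CaseCons) $\{\theta\}\cdot c\to t$ if $(c\mapsto t)\in\theta$; (CaseApp) $\{\theta\}\cdot(tu)\to(\{\theta\}\cdot t)u$; (CaseLam) $\{\theta\}\cdot\lambda x.t\to\lambda x.\{\theta\}\cdot t$ if $x\notin FV(\theta)$; (CaseCase) $\{\theta\}\cdot\{\phi\}\cdot t\to\{\theta\circ\phi\}\cdot t$. $\equiv_{\lambda_C}$ is the reflexive symmetric transitive closure of $\to$. A match failure is a term $\{\theta\}\cdot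 c$ with $c\notin\mathrm{dom}(\theta)$; a term is defined if none of its subterms is a match failure, and hereditarily defined if all its reducts (in zero or more steps) are defined. Categorical notation: composition in diagrammatic order $f;g$; $\langle f,g\rangle$ pairing; $\pi^k_i$ projections ($\pi_i=\pi^2_i$); $!_A:A\to1$; $D^k$ $k$-fold product; $B^A$ exponential, $\mathrm{ev}$ evaluation, $\Lambda$ currying; $\alpha$ canonical associativity isomorphisms $(A\times B)\times C\to A\times(B\times C)$. A $\lambda_C$-model is $(\mathcal C,D,\mathtt{app},\mathtt{lam},(\bar c_i)_{i=1}^n,\mathtt{fail},\mathtt{case})$ with $\mathcal C$ cartesian closed, $\bar c_i,\mathtt{fail}:1\to D$, $\mathtt{app}:D\to D^D$, $\mathtt{lam}:D^D\to D$, $\mathtt{case}:D^n\times D\to D$ such that, with $\widehat{\mathtt{case}}=\Lambda(\alpha;(\mathrm{id}_{D^n}\times\mathrm{ev});\mathtt{case})$ and $\mathtt{comp}=\langle(\mathrm{id}_{D^n}\times\pi^n_1);\mathtt{case},\dots,(\mathrm{id}_{D^n}\times\pi^n_n);\mathtt{case}\rangle:D^n\times D^n\to D^n$: (D1) $\mathtt{lam};\mathtt{app}=\mathrm{id}_{D^D}$, $\mathtt{app};\mathtt{lam}=\mathrm{id}_D$; (D2) for all $i$, $\langle\mathrm{id}_{D^n},!_{D^n}\rangle;(\mathrm{id}_{D^n}\times\bar c_i);\mathtt{case}=\pi^n_i$; (D3) $(\mathtt{case}\times\mathrm{id}_D);(\mathtt{app}\times\mathrm{id}_D);\mathrm{ev}=\alpha;(\mathrm{id}_{D^n}\times(\mathtt{app}\times\mathrm{id}_D));(\mathrm{id}_{D^n}\times\mathrm{ev});\mathtt{case}$;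 (D4) $\widehat{\mathtt{case}};\mathtt{lam}=(\mathrm{id}_{D^n}\times\mathtt{lam});\mathtt{case}$; (D5) $(\mathtt{comp}\times\mathrm{id}_D);\mathtt{case}=\alpha;(\mathrm{id}_{D^n}\times\mathtt{case});\mathtt{case}$; (D6) $(\mathrm{id}_{D^n}\times\mathtt{fail});\mathtt{case}=\pi_2;\mathtt{fail}$ as maps $D^n\times1\to D$. Interpretation for $\Gamma=x_1,\dots,x_k$: $[\![x_i]\!]_\Gamma=\pi^k_i$; $[\![tu]\!]_\Gamma=\langle[\![t]\!]_\Gamma,[\![u]\!]_\Gamma\rangle;(\mathtt{app}\times\mathrm{id}_D);\mathrm{ev}$; $[\![\lambda x_{k+1}.t]\!]_\Gamma=\Lambda(f_t);\mathtt{lam}$ with $x_{k+1}\notin\Gamma$ and $f_t$ the iso $D^k\times D\cong D^{k+1}$ followed by $[\![t]\!]_{\Gamma,x_{k+1}}$; $[\![c_i]\!]_\Gamma=!_{D^k};\bar c_i$; $[\![\{\theta\}\cdot t]\!]_\Gamma=\langle[\![\theta]\!]_\Gamma,[\![t]\!]_\Gamma\rangle;\mathtt{case}$; $[\![\theta]\!]_\Gamma=\langle f_1,\dots,f_n\rangle$, $f_i=[\![u_i]\!]_\Gamma$ if $(c_i\mapsto u_i)\in\theta$, else $f_i=!_{D^k};\mathtt{fail}$. -}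

module Defs where

open import Level using (Level; _⊔_) renaming (suc to lsuc)
open import Data.Nat using (ℕ; zero; suc)
open import Data.Fin using (Fin; zero; suc)
open import Data.Maybe using (Maybe; just; nothing)
open import Data.Vec using (Vec; []; _∷_; lookup)
open import Data.Empty using (⊥)
open import Relation.Nullary using (¬_)
open import Relation.Binary using (Rel; IsEquivalence)
open import Relation.Binary.PropositionalEquality using (_≡_)
open import Relation.Binary.Construct.Closure.ReflexiveTransitive using (Star)
open import Relation.Binary.Construct.Closure.Equivalence using (EqClosure)

-- Terms are scoped de Bruijn
-- terms (this is α-conversion): a term of type Term nc k has its free
-- variables among a context Γ = x₁ , … , x_k of k distinct variables,
-- where  var zero  denotes the LAST variable x_k,  var (suc i)  the
-- variable before that, etc.  A λ extends the context at the end (x_{k+1}).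
--
-- A case-binding θ is a finite partial map from constructors to terms,
-- represented as a vector indexed by all constructors:
-- position c holds  just u  iff  (c ↦ u) ∈ θ, and  nothing  iff c ∉ dom θ.

Binding : ℕ → Set → Set
Binding nc A = Vec (Maybe A) nc

data Term (nc : ℕ) (k : ℕ) : Set where
  var  : Fin k → Term nc k
  _·_  : Term nc k → Term nc k → Term nc k
  lam  : Term nc (suc k) → Term nc k
  con  : Fin nc → Term nc k
  case : Binding nc (Term nc k) → Term nc k → Term nc k

Ren : ℕ → ℕ → Set
Ren k l = Fin k → Fin l

extR : ∀ {k l} → Ren k l → Ren (suc k) (suc l)
extR ρ zero    = zero
extR ρ (suc i) = suc (ρ i)

mutual
  rename : ∀ {nc k l} → Ren k l → Term nc k → Term nc l
  rename ρ (var i)    = var (ρ i)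
  rename ρ (t · u)    = rename ρ t · rename ρ u
  rename ρ (lam t)    = lam (rename (extR ρ) t)
  rename ρ (con c)    = con c
  rename ρ (case θ t) = case (renameB ρ θ) (rename ρ t)

  renameB : ∀ {nc k l m} → Ren k l → Vec (Maybe (Term nc k)) m → Vec (Maybe (Term nc l)) m
  renameB ρ []             = []
  renameB ρ (nothing ∷ θ)  = nothing ∷ renameB ρ θ
  renameB ρ (just u ∷ θ)   = just (rename ρ u) ∷ renameB ρ θ

weaken : ∀ {nc k} → Term nc k → Term nc (suc k)
weaken = rename suc

weakenB : ∀ {nc k m} → Vec (Maybe (Term nc k)) m → Vec (Maybe (Term nc (suc k))) m
weakenB = renameB suc

Sub : ℕ → ℕ → ℕ → Set
Sub nc k l = Fin k → Term nc l

extS : ∀ {nc k l} → Sub nc k l → Sub nc (suc k) (suc l)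
extS σ zero    = var zero
extS σ (suc i) = weaken (σ i)

mutual
  subst : ∀ {nc k l} → Sub nc k l → Term nc k → Term nc l
  subst σ (var i)    = σ i
  subst σ (t · u)    = subst σ t · subst σ u
  subst σ (lam t)    = lam (subst (extS σ) t)
  subst σ (con c)    = con c
  subst σ (case θ t) = case (substB σ θ) (subst σ t)

  substB : ∀ {nc k l m} → Sub nc k l → Vec (Maybe (Term nc k)) m → Vec (Maybe (Term nc l)) m
  substB σ []             = []
  substB σ (nothing ∷ θ)  = nothing ∷ substB σ θ
  substB σ (just u ∷ θ)   = just (subst σ u) ∷ substB σ θ

sub0 : ∀ {nc k} → Term nc k → Sub nc (suc k) k
sub0 u zero    = u
sub0 u (suc i) = var i

_[0:=_] : ∀ {nc k} → Term nc (suc k) → Term nc k → Term nc k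
t [0:= u ] = subst (sub0 u) t

_∘B_ : ∀ {nc k m} → Binding nc (Term nc k) → Vec (Maybe (Term nc k)) m → Vec (Maybe (Term nc k)) m
θ ∘B []            = []
θ ∘B (nothing ∷ φ) = nothing ∷ (θ ∘B φ)
θ ∘B (just t ∷ φ)  = just (case θ t) ∷ (θ ∘B φ)

infix 4 _⟶_ _⟶B_ _⟶*_ _≡λC_

mutual
  data _⟶_ {nc k : ℕ} : Term nc k → Term nc k → Set where
    AppLam   : ∀ {t u} → (lam t · u) ⟶ (t [0:= u ])
    -- λx. t x → t  if x ∉ FV(t)   (t is a weakened term)
    LamApp   : ∀ {t} → lam (weaken t · var zero) ⟶ t
    CaseCons : ∀ {θ c u} → lookup θ c ≡ just u → case θ (con c) ⟶ u
    CaseApp  : ∀ {θ t u} → case θ (t · u) ⟶ (case θ t · u)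
    -- {θ}·λx.t → λx.{θ}·t  if x ∉ FV(θ)
    CaseLam  : ∀ {θ t} → case θ (lam t) ⟶ lam (case (weakenB θ) t)
    CaseCase : ∀ {θ φ t} → case θ (case φ t) ⟶ case (θ ∘B φ) t
    appL     : ∀ {t t' u} → t ⟶ t' → (t · u) ⟶ (t' · u)
    appR     : ∀ {t u u'} → u ⟶ u' → (t · u) ⟶ (t · u')
    lamC     : ∀ {t t'} → t ⟶ t' → lam t ⟶ lam t'
    caseB    : ∀ {θ θ' t} → θ ⟶B θ' → case θ t ⟶ case θ' t
    caseT    : ∀ {θ t t'} → t ⟶ t' → case θ t ⟶ case θ t'

  data _⟶B_ {nc k : ℕ} : ∀ {m} → Vec (Maybe (Term nc k)) m → Vec (Maybe (Term nc k)) m → Set where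
    here  : ∀ {m u u'} {θ : Vec (Maybe (Term nc k)) m} → u ⟶ u' → (just u ∷ θ) ⟶B (just u' ∷ θ)
    there : ∀ {m x} {θ θ' : Vec (Maybe (Term nc k)) m} → θ ⟶B θ' → (x ∷ θ) ⟶B (x ∷ θ')

_⟶*_ : ∀ {nc k} → Term nc k → Term nc k → Set
_⟶*_ = Star _⟶_

_≡λC_ : ∀ {nc k} → Term nc k → Term nc k → Set
_≡λC_ = EqClosure _⟶_

mutual
  data HasFailure {nc k : ℕ} : Term nc k → Set where
    failure : ∀ {θ c} → lookup θ c ≡ nothing → HasFailure (case θ (con c))
    inAppL  : ∀ {t u} → HasFailure t → HasFailure (t · u)
    inAppR  : ∀ {t u} → HasFailure u → HasFailure (t · u)
    inLam   : ∀ {t} → HasFailure t → HasFailure (lam t)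
    inCaseB : ∀ {θ t} → HasFailureB θ → HasFailure (case θ t)
    inCaseT : ∀ {θ t} → HasFailure t → HasFailure (case θ t)

  data HasFailureB {nc k : ℕ} : ∀ {m} → Vec (Maybe (Term nc k)) m → Set where
    here  : ∀ {m u} {θ : Vec (Maybe (Term nc k)) m} → HasFailure u → HasFailureB (just u ∷ θ)
    there : ∀ {m x} {θ : Vec (Maybe (Term nc k)) m} → HasFailureB θ → HasFailureB (x ∷ θ)

Defined : ∀ {nc k} → Term nc k → Set
Defined t = ¬ HasFailure t

HereditarilyDefined : ∀ {nc k} → Term nc k → Set
HereditarilyDefined t = ∀ t' → t ⟶* t' → Defined t'

record CCC (o ℓ e : Level) : Set (lsuc (o ⊔ ℓ ⊔ e)) where
  infixr 9 _⨾_
  infixr 7 _×_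
  infix 4 _≈_ _⇒_
  field
    Obj     : Set o
    _⇒_     : Obj → Obj → Set ℓ
    _≈_     : ∀ {A B} → Rel (A ⇒ B) e
    ≈-equiv : ∀ {A B} → IsEquivalence (_≈_ {A} {B})
    id      : ∀ {A} → A ⇒ A
    _⨾_     : ∀ {A B C} → A ⇒ B → B ⇒ C → A ⇒ C
    ⨾-cong  : ∀ {A B C} {f f' : A ⇒ B} {g g' : B ⇒ C} → f ≈ f' → g ≈ g' → f ⨾ g ≈ f' ⨾ g'
    assoc   : ∀ {A B C E} {f : A ⇒ B} {g : B ⇒ C} {h : C ⇒ E} → (f ⨾ g) ⨾ h ≈ f ⨾ (g ⨾ h)
    idˡ     : ∀ {A B} {f : A ⇒ B} → id ⨾ f ≈ f
    idʳ     : ∀ {A B} {f : A ⇒ B} → f ⨾ id ≈ f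
    𝟙        : Obj
    !        : ∀ {A} → A ⇒ 𝟙
    !-unique : ∀ {A} (f : A ⇒ 𝟙) → f ≈ !
    _×_      : Obj → Obj → Obj
    π₁       : ∀ {A B} → A × B ⇒ A
    π₂       : ∀ {A B} → A × B ⇒ B
    ⟨_,_⟩    : ∀ {C A B} → C ⇒ A → C ⇒ B → C ⇒ A × B
    π₁-β     : ∀ {C A B} {f : C ⇒ A} {g : C ⇒ B} → ⟨ f , g ⟩ ⨾ π₁ ≈ f
    π₂-β     : ∀ {C A B} {f : C ⇒ A} {g : C ⇒ B} → ⟨ f , g ⟩ ⨾ π₂ ≈ g
    ⟨⟩-unique : ∀ {C A B} {f : C ⇒ A} {g : C ⇒ B} {h : C ⇒ A × B} →
                h ⨾ π₁ ≈ f → h ⨾ π₂ ≈ g → h ≈ ⟨ f , g ⟩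
    _^_      : Obj → Obj → Obj
    ev       : ∀ {A B} → (B ^ A) × A ⇒ B
    Λ        : ∀ {C A B} → C × A ⇒ B → C ⇒ B ^ A
    Λ-β      : ∀ {C A B} {f : C × A ⇒ B} → ⟨ π₁ ⨾ Λ f , π₂ ⨾ id ⟩ ⨾ ev ≈ f
    Λ-unique : ∀ {C A B} {f : C × A ⇒ B} {h : C ⇒ B ^ A} →
               ⟨ π₁ ⨾ h , π₂ ⨾ id ⟩ ⨾ ev ≈ f → h ≈ Λ f

  _⊗_ : ∀ {A B C E} → A ⇒ B → C ⇒ E → A × C ⇒ B × E
  f ⊗ g = ⟨ π₁ ⨾ f , π₂ ⨾ g ⟩

  α : ∀ {A B C} → (A × B) × C ⇒ A × (B × C)
  α = ⟨ π₁ ⨾ π₁ , ⟨ π₁ ⨾ π₂ , π₂ ⟩ ⟩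

  Pow : Obj → ℕ → Obj
  Pow D zero    = 𝟙
  Pow D (suc k) = Pow D k × D

  -- projections π^k_i  (index zero is the last component)
  proj : ∀ {D k} → Fin k → Pow D k ⇒ D
  proj zero    = π₂
  proj (suc i) = π₁ ⨾ proj i

  tuple : ∀ {X D k} → (Fin k → X ⇒ D) → X ⇒ Pow D k
  tuple {k = zero}  f = !
  tuple {k = suc k} f = ⟨ tuple (λ i → f (suc i)) , f zero ⟩

record Model (o ℓ e : Level) (nc : ℕ) : Set (lsuc (o ⊔ ℓ ⊔ e)) where
  field
    cat : CCC o ℓ e
  open CCC cat public
  field
    D     : Obj
    app   : D ⇒ D ^ D
    lamM  : D ^ D ⇒ D
    cbar  : Fin nc → 𝟙 ⇒ D
    fail  : 𝟙 ⇒ D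
    caseM : Pow D nc × D ⇒ D

  caseHat : Pow D nc × D ^ D ⇒ D ^ D
  caseHat = Λ (α ⨾ (id ⊗ ev) ⨾ caseM)

  comp : Pow D nc × Pow D nc ⇒ Pow D nc
  comp = tuple (λ i → (id ⊗ proj {D} {nc} i) ⨾ caseM)

  field
    D1a : lamM ⨾ app ≈ id
    D1b : app ⨾ lamM ≈ id
    D2  : ∀ i → ⟨ id , ! ⟩ ⨾ (id ⊗ cbar i) ⨾ caseM ≈ proj {D} {nc} i
    D3  : (caseM ⊗ id) ⨾ (app ⊗ id) ⨾ ev ≈ α ⨾ (id ⊗ (app ⊗ id)) ⨾ (id ⊗ ev) ⨾ caseM
    D4  : caseHat ⨾ lamM ≈ (id ⊗ lamM) ⨾ caseM
    D5  : (comp ⊗ id) ⨾ caseM ≈ α ⨾ (id ⊗ caseM) ⨾ caseM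
    D6  : _≈_ {Pow D nc × 𝟙} ((id ⊗ fail) ⨾ caseM) (π₂ ⨾ fail)

  mutual
    ⟦_⟧ : ∀ {k} → Term nc k → Pow D k ⇒ D
    ⟦ var i ⟧    = proj i
    ⟦ t · u ⟧    = ⟨ ⟦ t ⟧ , ⟦ u ⟧ ⟩ ⨾ (app ⊗ id) ⨾ ev
    ⟦ lam t ⟧    = Λ ⟦ t ⟧ ⨾ lamM
    ⟦ con c ⟧    = ! ⨾ cbar c
    ⟦ case θ t ⟧ = ⟨ ⟦ θ ⟧B , ⟦ t ⟧ ⟩ ⨾ caseM

    ⟦_⟧B : ∀ {k m} → Vec (Maybe (Term nc k)) m → Pow D k ⇒ Pow D m
    ⟦ [] ⟧B          = !
    ⟦ nothing ∷ θ ⟧B = ⟨ ⟦ θ ⟧B , ! ⨾ fail ⟩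
    ⟦ just u ∷ θ ⟧B  = ⟨ ⟦ θ ⟧B , ⟦ u ⟧ ⟩

module Submission where

-- The proof builds a syntactic λC-model.  Reducing every {θ}·t as far as
-- CaseApp, CaseLam, CaseCase and CaseCons allow gives a case-normal form, and
-- on case-normal forms β (with substitution followed by case-normalisation) and
-- η form a confluent rewrite system.  Contexts and tuples of terms modulo
-- βη-conversion of their case-normal forms form a cartesian closed category in
-- which D = 1 is reflexive with app = lam = id, case is {c ↦ xᶜ}·x, and fail is
-- a term F that case-normalisation leaves alone.  In that model ⟦t⟧ is the
-- term t with every missing branch filled by F, so validity in all models makes
-- the filled terms βη-convertible, hence joinable.  With at least one constructor
-- F is the match failure {}·c₀: in a hereditarily defined term such a branch can
-- never be selected, so every βη-step of the filled term is mirrored by a step of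
-- t itself, and t and t' reduce to a common term.

open import Defs
open import Level using (Level; 0ℓ)
open import Data.Nat using (ℕ; zero; suc; _+_)
open import Data.Fin using (Fin; zero; suc; _↑ˡ_; _↑ʳ_)
open import Data.Fin.Properties using (suc-injective)
open import Data.Maybe using (Maybe; just; nothing)
open import Data.Vec using (Vec; []; _∷_; lookup; tabulate; replicate)
open import Data.Vec.Properties using (lookup∘tabulate; ∷-injectiveˡ; ∷-injectiveʳ)
open import Data.Maybe.Properties using (just-injective)
open import Data.Bool using (Bool; true; false)
open import Data.Empty using (⊥; ⊥-elim)
open import Data.Unit using (⊤; tt)
open import Data.Product using (Σ; ∃; _×_; _,_)
open import Data.Sum using (_⊎_; inj₁; inj₂)
open import Function using (_∘_; id)
open import Relation.Nullary using (¬_)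
open import Relation.Binary using (IsEquivalence)
open import Relation.Binary.PropositionalEquality renaming (subst to ≡subst)
open import Relation.Binary.Construct.Closure.ReflexiveTransitive as Star using (Star; ε; _◅_; _◅◅_)
open import Relation.Binary.Construct.Closure.Symmetric using (fwd)
open import Relation.Binary.Construct.Closure.Equivalence using (symmetric)

copair : ∀ {X : Set} (B : ℕ) {A : ℕ} → (Fin B → X) → (Fin A → X) → Fin (B + A) → X
copair zero g f x = f x
copair (suc B) g f zero = g zero
copair (suc B) g f (suc x) = copair B (g ∘ suc) f x

copair-↑ˡ : ∀ {X : Set} (B : ℕ) {A : ℕ} (g : Fin B → X) (f : Fin A → X) (i : Fin B) → copair B g f (i ↑ˡ A) ≡ g i
copair-↑ˡ (suc B) g f zero = refl
copair-↑ˡ (suc B) g f (suc i) = copair-↑ˡ B (g ∘ suc) f i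

copair-↑ʳ : ∀ {X : Set} (B : ℕ) {A : ℕ} (g : Fin B → X) (f : Fin A → X) (j : Fin A) → copair B g f (B ↑ʳ j) ≡ f j
copair-↑ʳ zero g f j = refl
copair-↑ʳ (suc B) g f j = copair-↑ʳ B (g ∘ suc) f j

data SplitView (B A : ℕ) : Fin (B + A) → Set where
  left : (i : Fin B) → SplitView B A (i ↑ˡ A)
  right : (j : Fin A) → SplitView B A (B ↑ʳ j)

splitView : ∀ B {A} (x : Fin (B + A)) → SplitView B A x
splitView zero x = right x
splitView (suc B) zero = left zero
splitView (suc B) {A} (suc x) with splitView B {A} x
... | left i = left (suc i)
... | right j = right j

_×o_ : ℕ → ℕ → ℕ
A ×o B = B + A

lookup-ext : ∀ {A : Set} {m} {v w : Vec A m} → (∀ c → lookup v c ≡ lookup w c) → v ≡ w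
lookup-ext {v = []} {[]} e = refl
lookup-ext {v = x ∷ v} {y ∷ w} e = cong₂ _∷_ (e zero) (lookup-ext (λ c → e (suc c)))

Join : ∀ {A : Set} → (A → A → Set) → (A → A → Set) → A → A → Set
Join R S b c = ∃ λ d → R b d × S c d

module DiamondCR {A : Set} (P : A → Set) (Q : A → A → Set) (pres : ∀ {a b} → P a → Q a b → P b)
           (dia : ∀ {a b c} → P a → Q a b → Q a c → Join Q Q b c) where
  strip : ∀ {a b c} → P a → Q a b → Star Q a c → Join (Star Q) Q b c
  strip p q ε = _ , ε , q
  strip p q (x ◅ xs) with dia p q x
  ... | d1 , q1 , q2 with strip (pres p x) q2 xs
  ... | d , s , q3 = d , q1 ◅ s , q3

  confluent : ∀ {a b c} → P a → Star Q a b → Star Q a c → Join (Star Q) (Star Q) b c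
  confluent p ε s = _ , s , ε
  confluent p (x ◅ xs) s with strip p x s
  ... | d1 , s1 , q1 with confluent (pres p x) xs s1
  ... | d , s2 , s3 = d , s2 , q1 ◅ s3

module _ {nc : ℕ} where
  private
    Tm = Term nc
    Branches : ℕ → ℕ → Set
    Branches k m = Vec (Maybe (Term nc k)) m

  extR-cong : ∀ {k l} {ρ ρ' : Ren k l} → ρ ≗ ρ' → extR ρ ≗ extR ρ'
  extR-cong e zero = refl
  extR-cong e (suc i) = cong suc (e i)

  mutual
    rename-cong : ∀ {k l} {ρ ρ' : Ren k l} → ρ ≗ ρ' → (t : Tm k) → rename ρ t ≡ rename ρ' t
    rename-cong e (var i) = cong var (e i)
    rename-cong e (t · u) = cong₂ _·_ (rename-cong e t) (rename-cong e u)
    rename-cong e (lam t) = cong lam (rename-cong (extR-cong e) t)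
    rename-cong e (con c) = refl
    rename-cong e (case θ t) = cong₂ case (renameB-cong e θ) (rename-cong e t)

    renameB-cong : ∀ {k l m} {ρ ρ' : Ren k l} → ρ ≗ ρ' → (θ : Branches k m) → renameB ρ θ ≡ renameB ρ' θ
    renameB-cong e [] = refl
    renameB-cong e (nothing ∷ θ) = cong (nothing ∷_) (renameB-cong e θ)
    renameB-cong e (just u ∷ θ) = cong₂ (λ a b → just a ∷ b) (rename-cong e u) (renameB-cong e θ)

  extR-comp : ∀ {k l j} (ρ : Ren l j) (ρ' : Ren k l) → (extR ρ ∘ extR ρ') ≗ extR (ρ ∘ ρ')
  extR-comp ρ ρ' zero = refl
  extR-comp ρ ρ' (suc i) = refl

  mutual
    rename-∘ : ∀ {k l j} (ρ : Ren l j) (ρ' : Ren k l) (t : Tm k) → rename ρ (rename ρ' t) ≡ rename (ρ ∘ ρ') t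
    rename-∘ ρ ρ' (var i) = refl
    rename-∘ ρ ρ' (t · u) = cong₂ _·_ (rename-∘ ρ ρ' t) (rename-∘ ρ ρ' u)
    rename-∘ ρ ρ' (lam t) = cong lam (trans (rename-∘ (extR ρ) (extR ρ') t) (rename-cong (extR-comp ρ ρ') t))
    rename-∘ ρ ρ' (con c) = refl
    rename-∘ ρ ρ' (case θ t) = cong₂ case (renameB-∘ ρ ρ' θ) (rename-∘ ρ ρ' t)

    renameB-∘ : ∀ {k l j m} (ρ : Ren l j) (ρ' : Ren k l) (θ : Branches k m) → renameB ρ (renameB ρ' θ) ≡ renameB (ρ ∘ ρ') θ
    renameB-∘ ρ ρ' [] = refl
    renameB-∘ ρ ρ' (nothing ∷ θ) = cong (nothing ∷_) (renameB-∘ ρ ρ' θ)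
    renameB-∘ ρ ρ' (just u ∷ θ) = cong₂ (λ a b → just a ∷ b) (rename-∘ ρ ρ' u) (renameB-∘ ρ ρ' θ)

  extR-id : ∀ {k} → extR {k} (λ i → i) ≗ (λ i → i)
  extR-id zero = refl
  extR-id (suc i) = refl

  mutual
    rename-id : ∀ {k} (t : Tm k) → rename (λ i → i) t ≡ t
    rename-id (var i) = refl
    rename-id (t · u) = cong₂ _·_ (rename-id t) (rename-id u)
    rename-id (lam t) = cong lam (trans (rename-cong extR-id t) (rename-id t))
    rename-id (con c) = refl
    rename-id (case θ t) = cong₂ case (renameB-id θ) (rename-id t)

    renameB-id : ∀ {k m} (θ : Branches k m) → renameB (λ i → i) θ ≡ θ
    renameB-id [] = refl
    renameB-id (nothing ∷ θ) = cong (nothing ∷_) (renameB-id θ)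
    renameB-id (just u ∷ θ) = cong₂ (λ a b → just a ∷ b) (rename-id u) (renameB-id θ)

  rename-weaken : ∀ {k l} (ρ : Ren k l) (t : Tm k) → rename (extR ρ) (weaken t) ≡ weaken (rename ρ t)
  rename-weaken ρ t = trans (rename-∘ (extR ρ) suc t) (sym (rename-∘ suc ρ t))

  renameB-weakenB : ∀ {k l m} (ρ : Ren k l) (θ : Branches k m) → renameB (extR ρ) (weakenB θ) ≡ weakenB (renameB ρ θ)
  renameB-weakenB ρ θ = trans (renameB-∘ (extR ρ) suc θ) (sym (renameB-∘ suc ρ θ))

  lookup-renameB : ∀ {k l m} (ρ : Ren k l) (θ : Branches k m) (c : Fin m) →
                lookup (renameB ρ θ) c ≡ Data.Maybe.map (rename ρ) (lookup θ c)
  lookup-renameB ρ (nothing ∷ θ) zero = refl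
  lookup-renameB ρ (just x ∷ θ) zero = refl
  lookup-renameB ρ (nothing ∷ θ) (suc c) = lookup-renameB ρ θ c
  lookup-renameB ρ (just x ∷ θ) (suc c) = lookup-renameB ρ θ c

  fromBranch : ∀ {k} → Maybe (Tm k) → Tm k → Tm k
  fromBranch (just u) d = u
  fromBranch nothing d = d

  -- Case-normalisation

  -- For case-normal M, pushCase θ M is the case-normal form of {θ}·M; a match
  -- failure {θ}·c is left in place.
  mutual
    pushCase : ∀ {k} → Binding nc (Tm k) → Tm k → Tm k
    pushCase θ (var i) = case θ (var i)
    pushCase θ (t · u) = pushCase θ t · u
    pushCase θ (lam t) = lam (pushCase (weakenB θ) t)
    pushCase θ (con c) = fromBranch (lookup θ c) (case θ (con c))
    pushCase θ (case φ t) = pushCase (pushCaseB θ φ) t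

    pushCaseB : ∀ {k m} → Binding nc (Tm k) → Branches k m → Branches k m
    pushCaseB θ [] = []
    pushCaseB θ (nothing ∷ φ) = nothing ∷ pushCaseB θ φ
    pushCaseB θ (just u ∷ φ) = just (pushCase θ u) ∷ pushCaseB θ φ

  mutual
    nsubst : ∀ {k l} → Tm k → (Fin k → Tm l) → Tm l
    nsubst (var i) σ = σ i
    nsubst (t · u) σ = nsubst t σ · nsubst u σ
    nsubst (lam t) σ = lam (nsubst t (extS σ))
    nsubst (con c) σ = con c
    nsubst (case θ t) σ = pushCase (nsubstB θ σ) (nsubst t σ)

    nsubstB : ∀ {k l m} → Branches k m → (Fin k → Tm l) → Branches l m
    nsubstB [] σ = []
    nsubstB (nothing ∷ θ) σ = nothing ∷ nsubstB θ σ
    nsubstB (just u ∷ θ) σ = just (nsubst u σ) ∷ nsubstB θ σ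

  nf : ∀ {k} → Tm k → Tm k
  nf t = nsubst t var

  nfB : ∀ {k m} → Branches k m → Branches k m
  nfB θ = nsubstB θ var

  lookup-pushCaseB : ∀ {k m} (θ : Binding nc (Tm k)) (φ : Branches k m) (c : Fin m) →
                lookup (pushCaseB θ φ) c ≡ Data.Maybe.map (pushCase θ) (lookup φ c)
  lookup-pushCaseB θ (nothing ∷ φ) zero = refl
  lookup-pushCaseB θ (just x ∷ φ) zero = refl
  lookup-pushCaseB θ (nothing ∷ φ) (suc c) = lookup-pushCaseB θ φ c
  lookup-pushCaseB θ (just x ∷ φ) (suc c) = lookup-pushCaseB θ φ c

  lookup-nsubstB : ∀ {k l m} (θ : Branches k m) (σ : Fin k → Tm l) (c : Fin m) →
                lookup (nsubstB θ σ) c ≡ Data.Maybe.map (λ u → nsubst u σ) (lookup θ c)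
  lookup-nsubstB (nothing ∷ φ) σ zero = refl
  lookup-nsubstB (just x ∷ φ) σ zero = refl
  lookup-nsubstB (nothing ∷ φ) σ (suc c) = lookup-nsubstB φ σ c
  lookup-nsubstB (just x ∷ φ) σ (suc c) = lookup-nsubstB φ σ c

  mutual
    rename-pushCase : ∀ {k l} (ρ : Ren k l) (θ : Binding nc (Tm k)) (M : Tm k) →
               rename ρ (pushCase θ M) ≡ pushCase (renameB ρ θ) (rename ρ M)
    rename-pushCase ρ θ (var i) = refl
    rename-pushCase ρ θ (t · u) = cong (_· rename ρ u) (rename-pushCase ρ θ t)
    rename-pushCase ρ θ (lam t) = cong lam (trans (rename-pushCase (extR ρ) (weakenB θ) t)
                                           (cong (λ z → pushCase z (rename (extR ρ) t)) (renameB-weakenB ρ θ)))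
    rename-pushCase ρ θ (con c) with lookup θ c | lookup-renameB ρ θ c
    ... | just u | e = sym (cong (λ z → fromBranch z (case (renameB ρ θ) (con c))) e)
    ... | nothing | e = sym (cong (λ z → fromBranch z (case (renameB ρ θ) (con c))) e)
    rename-pushCase ρ θ (case φ t) = trans (rename-pushCase ρ (pushCaseB θ φ) t) (cong (λ z → pushCase z (rename ρ t)) (renameB-pushCaseB ρ θ φ))

    renameB-pushCaseB : ∀ {k l m} (ρ : Ren k l) (θ : Binding nc (Tm k)) (φ : Branches k m) →
               renameB ρ (pushCaseB θ φ) ≡ pushCaseB (renameB ρ θ) (renameB ρ φ)
    renameB-pushCaseB ρ θ [] = refl
    renameB-pushCaseB ρ θ (nothing ∷ φ) = cong (nothing ∷_) (renameB-pushCaseB ρ θ φ)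
    renameB-pushCaseB ρ θ (just u ∷ φ) = cong₂ (λ a b → just a ∷ b) (rename-pushCase ρ θ u) (renameB-pushCaseB ρ θ φ)

  extS-cong : ∀ {k l} {σ σ' : Fin k → Tm l} → σ ≗ σ' → extS σ ≗ extS σ'
  extS-cong e zero = refl
  extS-cong e (suc i) = cong weaken (e i)

  mutual
    nsubst-cong : ∀ {k l} {σ σ' : Fin k → Tm l} → σ ≗ σ' → (t : Tm k) → nsubst t σ ≡ nsubst t σ'
    nsubst-cong e (var i) = e i
    nsubst-cong e (t · u) = cong₂ _·_ (nsubst-cong e t) (nsubst-cong e u)
    nsubst-cong e (lam t) = cong lam (nsubst-cong (extS-cong e) t)
    nsubst-cong e (con c) = refl
    nsubst-cong e (case θ t) = cong₂ pushCase (nsubstB-cong e θ) (nsubst-cong e t)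

    nsubstB-cong : ∀ {k l m} {σ σ' : Fin k → Tm l} → σ ≗ σ' → (θ : Branches k m) → nsubstB θ σ ≡ nsubstB θ σ'
    nsubstB-cong e [] = refl
    nsubstB-cong e (nothing ∷ θ) = cong (nothing ∷_) (nsubstB-cong e θ)
    nsubstB-cong e (just u ∷ θ) = cong₂ (λ a b → just a ∷ b) (nsubst-cong e u) (nsubstB-cong e θ)

  mutual
    nsubst-rename : ∀ {k l j} (ρ : Ren k l) (σ : Fin l → Tm j) (t : Tm k) → nsubst (rename ρ t) σ ≡ nsubst t (σ ∘ ρ)
    nsubst-rename ρ σ (var i) = refl
    nsubst-rename ρ σ (t · u) = cong₂ _·_ (nsubst-rename ρ σ t) (nsubst-rename ρ σ u)
    nsubst-rename ρ σ (lam t) = cong lam (trans (nsubst-rename (extR ρ) (extS σ) t) (nsubst-cong (λ { zero → refl ; (suc i) → refl }) t))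
    nsubst-rename ρ σ (con c) = refl
    nsubst-rename ρ σ (case θ t) = cong₂ pushCase (nsubstB-renameB ρ σ θ) (nsubst-rename ρ σ t)

    nsubstB-renameB : ∀ {k l j m} (ρ : Ren k l) (σ : Fin l → Tm j) (θ : Branches k m) → nsubstB (renameB ρ θ) σ ≡ nsubstB θ (σ ∘ ρ)
    nsubstB-renameB ρ σ [] = refl
    nsubstB-renameB ρ σ (nothing ∷ θ) = cong (nothing ∷_) (nsubstB-renameB ρ σ θ)
    nsubstB-renameB ρ σ (just u ∷ θ) = cong₂ (λ a b → just a ∷ b) (nsubst-rename ρ σ u) (nsubstB-renameB ρ σ θ)

  mutual
    rename-nsubst : ∀ {k l j} (ρ : Ren l j) (σ : Fin k → Tm l) (t : Tm k) → rename ρ (nsubst t σ) ≡ nsubst t (rename ρ ∘ σ)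
    rename-nsubst ρ σ (var i) = refl
    rename-nsubst ρ σ (t · u) = cong₂ _·_ (rename-nsubst ρ σ t) (rename-nsubst ρ σ u)
    rename-nsubst ρ σ (lam t) = cong lam (trans (rename-nsubst (extR ρ) (extS σ) t)
                           (nsubst-cong (λ { zero → refl ; (suc i) → rename-weaken ρ (σ i) }) t))
    rename-nsubst ρ σ (con c) = refl
    rename-nsubst ρ σ (case θ t) = trans (rename-pushCase ρ (nsubstB θ σ) (nsubst t σ)) (cong₂ pushCase (renameB-nsubstB ρ σ θ) (rename-nsubst ρ σ t))

    renameB-nsubstB : ∀ {k l j m} (ρ : Ren l j) (σ : Fin k → Tm l) (θ : Branches k m) → renameB ρ (nsubstB θ σ) ≡ nsubstB θ (rename ρ ∘ σ)
    renameB-nsubstB ρ σ [] = refl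
    renameB-nsubstB ρ σ (nothing ∷ θ) = cong (nothing ∷_) (renameB-nsubstB ρ σ θ)
    renameB-nsubstB ρ σ (just u ∷ θ) = cong₂ (λ a b → just a ∷ b) (rename-nsubst ρ σ u) (renameB-nsubstB ρ σ θ)

  nsubstB-weakenB : ∀ {k l m} (σ : Fin k → Tm l) (θ : Branches k m) → nsubstB (weakenB θ) (extS σ) ≡ weakenB (nsubstB θ σ)
  nsubstB-weakenB σ θ = trans (nsubstB-renameB suc (extS σ) θ) (sym (renameB-nsubstB suc σ θ))

  nsubst-weaken : ∀ {k l} (σ : Fin k → Tm l) (t : Tm k) → nsubst (weaken t) (extS σ) ≡ weaken (nsubst t σ)
  nsubst-weaken σ t = trans (nsubst-rename suc (extS σ) t) (sym (rename-nsubst suc σ t))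

  mutual
    pushCase-pushCase : ∀ {k} (θ φ : Binding nc (Tm k)) (M : Tm k) → pushCase θ (pushCase φ M) ≡ pushCase (pushCaseB θ φ) M
    pushCase-pushCase θ φ (var i) = refl
    pushCase-pushCase θ φ (t · u) = cong (_· u) (pushCase-pushCase θ φ t)
    pushCase-pushCase θ φ (lam t) = cong lam (trans (pushCase-pushCase (weakenB θ) (weakenB φ) t)
                                              (cong (λ z → pushCase z t) (sym (renameB-pushCaseB suc θ φ))))
    pushCase-pushCase θ φ (con c) with lookup φ c | lookup-pushCaseB θ φ c
    ... | just u | e = sym (cong (λ z → fromBranch z (case (pushCaseB θ φ) (con c))) e)
    ... | nothing | e = refl
    pushCase-pushCase θ φ (case ψ t) = trans (pushCase-pushCase θ (pushCaseB φ ψ) t) (cong (λ z → pushCase z t) (pushCaseB-pushCaseB θ φ ψ))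

    pushCaseB-pushCaseB : ∀ {k m} (θ φ : Binding nc (Tm k)) (ψ : Branches k m) → pushCaseB θ (pushCaseB φ ψ) ≡ pushCaseB (pushCaseB θ φ) ψ
    pushCaseB-pushCaseB θ φ [] = refl
    pushCaseB-pushCaseB θ φ (nothing ∷ ψ) = cong (nothing ∷_) (pushCaseB-pushCaseB θ φ ψ)
    pushCaseB-pushCaseB θ φ (just u ∷ ψ) = cong₂ (λ a b → just a ∷ b) (pushCase-pushCase θ φ u) (pushCaseB-pushCaseB θ φ ψ)

  mutual
    nsubst-pushCase : ∀ {k l} (θ : Binding nc (Tm k)) (M : Tm k) (τ : Fin k → Tm l) →
        nsubst (pushCase θ M) τ ≡ pushCase (nsubstB θ τ) (nsubst M τ)
    nsubst-pushCase θ (var i) τ = refl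
    nsubst-pushCase θ (t · u) τ = cong (_· nsubst u τ) (nsubst-pushCase θ t τ)
    nsubst-pushCase θ (lam t) τ = cong lam (trans (nsubst-pushCase (weakenB θ) t (extS τ)) (cong (λ z → pushCase z (nsubst t (extS τ))) (nsubstB-weakenB τ θ)))
    nsubst-pushCase θ (con c) τ with lookup θ c | lookup-nsubstB θ τ c
    ... | just u | e = sym (cong (λ z → fromBranch z (case (nsubstB θ τ) (con c))) e)
    ... | nothing | e = refl
    nsubst-pushCase θ (case ψ t) τ = trans (nsubst-pushCase (pushCaseB θ ψ) t τ)
                              (trans (cong (λ z → pushCase z (nsubst t τ)) (nsubstB-pushCaseB θ ψ τ))
                                     (sym (pushCase-pushCase (nsubstB θ τ) (nsubstB ψ τ) (nsubst t τ))))

    nsubstB-pushCaseB : ∀ {k l m} (θ : Binding nc (Tm k)) (ψ : Branches k m) (τ : Fin k → Tm l) →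
        nsubstB (pushCaseB θ ψ) τ ≡ pushCaseB (nsubstB θ τ) (nsubstB ψ τ)
    nsubstB-pushCaseB θ [] τ = refl
    nsubstB-pushCaseB θ (nothing ∷ ψ) τ = cong (nothing ∷_) (nsubstB-pushCaseB θ ψ τ)
    nsubstB-pushCaseB θ (just u ∷ ψ) τ = cong₂ (λ a b → just a ∷ b) (nsubst-pushCase θ u τ) (nsubstB-pushCaseB θ ψ τ)

  mutual
    nsubst-∘ : ∀ {k l j} (σ : Fin k → Tm l) (τ : Fin l → Tm j) (t : Tm k) → nsubst (nsubst t σ) τ ≡ nsubst t (λ i → nsubst (σ i) τ)
    nsubst-∘ σ τ (var i) = refl
    nsubst-∘ σ τ (t · u) = cong₂ _·_ (nsubst-∘ σ τ t) (nsubst-∘ σ τ u)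
    nsubst-∘ σ τ (lam t) = cong lam (trans (nsubst-∘ (extS σ) (extS τ) t)
                           (nsubst-cong (λ { zero → refl ; (suc i) → nsubst-weaken τ (σ i) }) t))
    nsubst-∘ σ τ (con c) = refl
    nsubst-∘ σ τ (case θ t) = trans (nsubst-pushCase (nsubstB θ σ) (nsubst t σ) τ) (cong₂ pushCase (nsubstB-∘ σ τ θ) (nsubst-∘ σ τ t))

    nsubstB-∘ : ∀ {k l j m} (σ : Fin k → Tm l) (τ : Fin l → Tm j) (θ : Branches k m) →
        nsubstB (nsubstB θ σ) τ ≡ nsubstB θ (λ i → nsubst (σ i) τ)
    nsubstB-∘ σ τ [] = refl
    nsubstB-∘ σ τ (nothing ∷ θ) = cong (nothing ∷_) (nsubstB-∘ σ τ θ)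
    nsubstB-∘ σ τ (just u ∷ θ) = cong₂ (λ a b → just a ∷ b) (nsubst-∘ σ τ u) (nsubstB-∘ σ τ θ)

  var-inj : ∀ {k} {x y : Fin k} → _≡_ {A = Tm k} (var x) (var y) → x ≡ y
  var-inj refl = refl
  app-inj₁ : ∀ {k} {a b c d : Tm k} → a · b ≡ c · d → a ≡ c
  app-inj₁ refl = refl
  app-inj₂ : ∀ {k} {a b c d : Tm k} → a · b ≡ c · d → b ≡ d
  app-inj₂ refl = refl
  lam-inj : ∀ {k} {a b : Tm (suc k)} → _≡_ {A = Tm k} (lam a) (lam b) → a ≡ b
  lam-inj refl = refl
  con-inj : ∀ {k} {x y : Fin nc} → _≡_ {A = Tm k} (con x) (con y) → x ≡ y
  con-inj refl = refl
  case-inj₁ : ∀ {k} {θ φ : Binding nc (Tm k)} {a b : Tm k} → case θ a ≡ case φ b → θ ≡ φ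
  case-inj₁ refl = refl
  case-inj₂ : ∀ {k} {θ φ : Binding nc (Tm k)} {a b : Tm k} → case θ a ≡ case φ b → a ≡ b
  case-inj₂ refl = refl

  mutual
    data Nf {k} : Tm k → Set where
      nvar : ∀ {i} → Nf (var i)
      ncon : ∀ {c} → Nf (con c)
      napp : ∀ {a b} → Nf a → Nf b → Nf (a · b)
      nlam : ∀ {a} → Nf a → Nf (lam a)
      ncase-var  : ∀ {θ i} → NfB θ → Nf (case θ (var i))
      ncase-con  : ∀ {θ c} → NfB θ → lookup θ c ≡ nothing → Nf (case θ (con c))

    data NfB {k} : ∀ {m} → Branches k m → Set where
      [] : NfB []
      cn : ∀ {m} {θ : Branches k m} → NfB θ → NfB (nothing ∷ θ)
      _∷j_ : ∀ {m u} {θ : Branches k m} → Nf u → NfB θ → NfB (just u ∷ θ)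

  lookup-NfB : ∀ {k m} {θ : Branches k m} → NfB θ → (c : Fin m) → ∀ {u} → lookup θ c ≡ just u → Nf u
  lookup-NfB (cn nb) zero ()
  lookup-NfB (nu ∷j nbs) zero refl = nu
  lookup-NfB (cn nb) (suc c) e = lookup-NfB nb c e
  lookup-NfB (nu ∷j nbs) (suc c) e = lookup-NfB nbs c e

  mutual
    Nf-ren : ∀ {k l} (ρ : Ren k l) {t : Tm k} → Nf t → Nf (rename ρ t)
    Nf-ren ρ nvar = nvar
    Nf-ren ρ ncon = ncon
    Nf-ren ρ (napp a b) = napp (Nf-ren ρ a) (Nf-ren ρ b)
    Nf-ren ρ (nlam a) = nlam (Nf-ren (extR ρ) a)
    Nf-ren ρ (ncase-var x) = ncase-var (NfB-ren ρ x)
    Nf-ren ρ {case θ (con c)} (ncase-con x e) = ncase-con (NfB-ren ρ x) (trans (lookup-renameB ρ θ c) (cong (Data.Maybe.map (rename ρ)) e))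

    NfB-ren : ∀ {k l m} (ρ : Ren k l) {θ : Branches k m} → NfB θ → NfB (renameB ρ θ)
    NfB-ren ρ [] = []
    NfB-ren ρ (cn x) = cn (NfB-ren ρ x)
    NfB-ren ρ (x ∷j xs) = Nf-ren ρ x ∷j NfB-ren ρ xs

  mutual
    Nf-pushCase : ∀ {k} {θ : Binding nc (Tm k)} {M : Tm k} → NfB θ → Nf M → Nf (pushCase θ M)
    Nf-pushCase nθ nvar = ncase-var nθ
    Nf-pushCase {θ = θ} {con c} nθ ncon with lookup θ c in e
    ... | just u = lookup-NfB nθ c e
    ... | nothing = ncase-con nθ e
    Nf-pushCase nθ (napp a b) = napp (Nf-pushCase nθ a) b
    Nf-pushCase nθ (nlam a) = nlam (Nf-pushCase (NfB-ren suc nθ) a)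
    Nf-pushCase nθ (ncase-var nψ) = ncase-var (NfB-pushCaseB nθ nψ)
    Nf-pushCase {θ = θ} {case ψ (con c)} nθ (ncase-con nψ e) with lookup (pushCaseB θ ψ) c | lookup-pushCaseB θ ψ c
    ... | just x | e' rewrite e = ⊥-elim (nj e')
      where nj : just x ≡ nothing → ⊥
            nj ()
    ... | nothing | e' = ncase-con (NfB-pushCaseB nθ nψ) (trans (lookup-pushCaseB θ ψ c) (cong (Data.Maybe.map (pushCase θ)) e))

    NfB-pushCaseB : ∀ {k m} {θ : Binding nc (Tm k)} {ψ : Branches k m} → NfB θ → NfB ψ → NfB (pushCaseB θ ψ)
    NfB-pushCaseB nθ [] = []
    NfB-pushCaseB nθ (cn x) = cn (NfB-pushCaseB nθ x)
    NfB-pushCaseB nθ (x ∷j xs) = Nf-pushCase nθ x ∷j NfB-pushCaseB nθ xs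

  NfS : ∀ {k l} → (Fin k → Tm l) → Set
  NfS σ = ∀ i → Nf (σ i)

  NfS-ext : ∀ {k l} {σ : Fin k → Tm l} → NfS σ → NfS (extS σ)
  NfS-ext n zero = nvar
  NfS-ext n (suc i) = Nf-ren suc (n i)

  NfS-var : ∀ {k} → NfS {k} var
  NfS-var i = nvar

  mutual
    Nf-nsubst : ∀ {k l} {σ : Fin k → Tm l} → NfS σ → (t : Tm k) → Nf (nsubst t σ)
    Nf-nsubst n (var i) = n i
    Nf-nsubst n (t · u) = napp (Nf-nsubst n t) (Nf-nsubst n u)
    Nf-nsubst n (lam t) = nlam (Nf-nsubst (NfS-ext n) t)
    Nf-nsubst n (con c) = ncon
    Nf-nsubst n (case θ t) = Nf-pushCase (NfB-nsubstB n θ) (Nf-nsubst n t)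

    NfB-nsubstB : ∀ {k l m} {σ : Fin k → Tm l} → NfS σ → (θ : Branches k m) → NfB (nsubstB θ σ)
    NfB-nsubstB n [] = []
    NfB-nsubstB n (nothing ∷ θ) = cn (NfB-nsubstB n θ)
    NfB-nsubstB n (just u ∷ θ) = Nf-nsubst n u ∷j NfB-nsubstB n θ

  Nf-nf : ∀ {k} (t : Tm k) → Nf (nf t)
  Nf-nf t = Nf-nsubst NfS-var t

  lookup-nsubstB-nothing : ∀ {k l m} (θ : Branches k m) (σ : Fin k → Tm l) (c : Fin m) → lookup θ c ≡ nothing →
      lookup (nsubstB θ σ) c ≡ nothing
  lookup-nsubstB-nothing θ σ c e = trans (lookup-nsubstB θ σ c) (cong (Data.Maybe.map (λ u → nsubst u σ)) e)

  mutual
    nsubst-Nf-id : ∀ {k} {σ : Fin k → Tm k} → σ ≗ var → {t : Tm k} → Nf t → nsubst t σ ≡ t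
    nsubst-Nf-id e {var i} nvar = e i
    nsubst-Nf-id e ncon = refl
    nsubst-Nf-id e (napp a b) = cong₂ _·_ (nsubst-Nf-id e a) (nsubst-Nf-id e b)
    nsubst-Nf-id {σ = σ} e (nlam a) = cong lam (nsubst-Nf-id ext a)
      where ext : extS σ ≗ var
            ext zero = refl
            ext (suc i) = cong weaken (e i)
    nsubst-Nf-id {σ = σ} e {case θ (var i)} (ncase-var x) rewrite e i = cong (λ z → case z (var i)) (nsubstB-NfB-id e x)
    nsubst-Nf-id {σ = σ} e {case θ (con c)} (ncase-con x ec) rewrite lookup-nsubstB-nothing θ σ c ec = cong (λ z → case z (con c)) (nsubstB-NfB-id e x)

    nsubstB-NfB-id : ∀ {k m} {σ : Fin k → Tm k} → σ ≗ var → {θ : Branches k m} → NfB θ → nsubstB θ σ ≡ θ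
    nsubstB-NfB-id e [] = refl
    nsubstB-NfB-id e (cn x) = cong (nothing ∷_) (nsubstB-NfB-id e x)
    nsubstB-NfB-id e (x ∷j xs) = cong₂ (λ a b → just a ∷ b) (nsubst-Nf-id e x) (nsubstB-NfB-id e xs)

  nf-Nf : ∀ {k} {t : Tm k} → Nf t → nf t ≡ t
  nf-Nf = nsubst-Nf-id (λ _ → refl)

  nfB-NfB : ∀ {k m} {θ : Branches k m} → NfB θ → nfB θ ≡ θ
  nfB-NfB = nsubstB-NfB-id (λ _ → refl)

  nsubst-β : ∀ {k l} (σ : Fin k → Tm l) → NfS σ → (a : Tm (suc k)) (b : Tm k) →
        nsubst (nsubst a (extS σ)) (sub0 (nsubst b σ)) ≡ nsubst (nsubst a (sub0 b)) σ
  nsubst-β σ nσ a b = trans (nsubst-∘ (extS σ) (sub0 (nsubst b σ)) a)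
                   (trans (nsubst-cong pw a) (sym (nsubst-∘ (sub0 b) σ a)))
    where pw : (λ i → nsubst (extS σ i) (sub0 (nsubst b σ))) ≗ (λ i → nsubst (sub0 b i) σ)
          pw zero = refl
          pw (suc i) = trans (nsubst-rename suc (sub0 (nsubst b σ)) (σ i)) (nf-Nf (nσ i))

  rename-sub0 : ∀ {k l} (ρ : Ren k l) (a : Tm (suc k)) (b : Tm k) →
             rename ρ (nsubst a (sub0 b)) ≡ nsubst (rename (extR ρ) a) (sub0 (rename ρ b))
  rename-sub0 ρ a b = trans (rename-nsubst ρ (sub0 b) a) (trans (nsubst-cong pw a) (sym (nsubst-rename (extR ρ) (sub0 (rename ρ b)) a)))
    where pw : (λ i → rename ρ (sub0 b i)) ≗ (λ i → sub0 (rename ρ b) (extR ρ i))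
          pw zero = refl
          pw (suc i) = refl

  nsubst-weaken-sub0 : ∀ {k} (M : Tm k) (b : Tm k) → nsubst (weaken M) (sub0 b) ≡ nf M
  nsubst-weaken-sub0 M b = nsubst-rename suc (sub0 b) M

  TmRel : Set₁
  TmRel = ∀ {k} → Tm k → Tm k → Set

  -- No congruence for the scrutinee of a case: in a case-normal form it is a
  -- variable or a constructor.
  mutual
    data Compat (R : TmRel) : ∀ {k} → Tm k → Tm k → Set where
      top   : ∀ {k} {a b : Tm k} → R a b → Compat R a b
      appL  : ∀ {k} {a a' b : Tm k} → Compat R a a' → Compat R (a · b) (a' · b)
      appR  : ∀ {k} {a b b' : Tm k} → Compat R b b' → Compat R (a · b) (a · b')
      lamC  : ∀ {k} {a a' : Tm (suc k)} → Compat R a a' → Compat R (lam a) (lam a')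
      caseB : ∀ {k} {θ θ' : Binding nc (Tm k)} {t} → CompatB R θ θ' → Compat R (case θ t) (case θ' t)

    data CompatB (R : TmRel) : ∀ {k m} → Branches k m → Branches k m → Set where
      here  : ∀ {k m} {u u' : Tm k} {θ : Branches k m} → Compat R u u' → CompatB R (just u ∷ θ) (just u' ∷ θ)
      there : ∀ {k m} {x} {θ θ' : Branches k m} → CompatB R θ θ' → CompatB R (x ∷ θ) (x ∷ θ')

  data Beta {k} : Tm k → Tm k → Set where
    beta : ∀ {a b} → Beta (lam a · b) (nsubst a (sub0 b))

  -- The equation a ≡ weaken M is the side condition x ∉ FV(M).
  data Eta {k} : Tm k → Tm k → Set where
    eta : ∀ {a M} → a ≡ weaken M → Eta (lam (a · var zero)) M

  data BetaEta {k} (a b : Tm k) : Set where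
    β-step : Beta a b → BetaEta a b
    η-step : Eta a b → BetaEta a b

  BetaEta± : TmRel
  BetaEta± a b = BetaEta a b ⊎ BetaEta b a

  _⟶βη_ : TmRel
  _⟶βη_ = Compat BetaEta
  _⟶β_ : TmRel
  _⟶β_ = Compat Beta
  _⟶η_ : TmRel
  _⟶η_ = Compat Eta

  _≡βη_ : TmRel
  a ≡βη b = Star (Compat BetaEta±) a b

  Beta-ren : ∀ {k l} (ρ : Ren k l) {a b : Tm k} → Beta a b → Beta (rename ρ a) (rename ρ b)
  Beta-ren ρ (beta {a} {b}) = ≡subst (Beta _) (sym (rename-sub0 ρ a b)) beta

  Eta-ren : ∀ {k l} (ρ : Ren k l) {a b : Tm k} → Eta a b → Eta (rename ρ a) (rename ρ b)
  Eta-ren ρ (eta {a} {M} e) = eta (trans (cong (rename (extR ρ)) e) (rename-weaken ρ M))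

  BetaEta-ren : ∀ {k l} (ρ : Ren k l) {a b : Tm k} → BetaEta a b → BetaEta (rename ρ a) (rename ρ b)
  BetaEta-ren ρ (β-step x) = β-step (Beta-ren ρ x)
  BetaEta-ren ρ (η-step x) = η-step (Eta-ren ρ x)

  BetaEta±-ren : ∀ {k l} (ρ : Ren k l) {a b : Tm k} → BetaEta± a b → BetaEta± (rename ρ a) (rename ρ b)
  BetaEta±-ren ρ (inj₁ x) = inj₁ (BetaEta-ren ρ x)
  BetaEta±-ren ρ (inj₂ x) = inj₂ (BetaEta-ren ρ x)

  module Closure (R : TmRel) (renR : ∀ {k l} (ρ : Ren k l) {a b : Tm k} → R a b → R (rename ρ a) (rename ρ b)) where

    mutual
      Compat-ren : ∀ {k l} (ρ : Ren k l) {a b : Tm k} → Compat R a b → Compat R (rename ρ a) (rename ρ b)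
      Compat-ren ρ (top x) = top (renR ρ x)
      Compat-ren ρ (appL d) = appL (Compat-ren ρ d)
      Compat-ren ρ (appR d) = appR (Compat-ren ρ d)
      Compat-ren ρ (lamC d) = lamC (Compat-ren (extR ρ) d)
      Compat-ren ρ (caseB d) = caseB (CompatB-ren ρ d)

      CompatB-ren : ∀ {k l m} (ρ : Ren k l) {θ θ' : Branches k m} → CompatB R θ θ' → CompatB R (renameB ρ θ) (renameB ρ θ')
      CompatB-ren ρ (here {u = u} {u'} {θ} d) = here (Compat-ren ρ d)
      CompatB-ren ρ (there {x = nothing} d) = there (CompatB-ren ρ d)
      CompatB-ren ρ (there {x = just x} d) = there (CompatB-ren ρ d)

    Star-ren : ∀ {k l} (ρ : Ren k l) {a b : Tm k} → Star (Compat R) a b → Star (Compat R) (rename ρ a) (rename ρ b)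
    Star-ren ρ = Star.gmap (rename ρ) (Compat-ren ρ)

    *appL : ∀ {k} {a a' b : Tm k} → Star (Compat R) a a' → Star (Compat R) (a · b) (a' · b)
    *appL {b = b} = Star.gmap (_· b) appL
    *appR : ∀ {k} {a b b' : Tm k} → Star (Compat R) b b' → Star (Compat R) (a · b) (a · b')
    *appR {a = a} = Star.gmap (a ·_) appR
    *app : ∀ {k} {a a' b b' : Tm k} → Star (Compat R) a a' → Star (Compat R) b b' → Star (Compat R) (a · b) (a' · b')
    *app p q = *appL p ◅◅ *appR q
    *lam : ∀ {k} {a a' : Tm (suc k)} → Star (Compat R) a a' → Star (Compat R) (lam a) (lam a')
    *lam = Star.gmap lam lamC

    data Branches* : ∀ {k m} → Branches k m → Branches k m → Set where
      []  : ∀ {k} → Branches* {k} [] []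
      nn  : ∀ {k m} {θ θ' : Branches k m} → Branches* θ θ' → Branches* (nothing ∷ θ) (nothing ∷ θ')
      jj  : ∀ {k m} {u u'} {θ θ' : Branches k m} → Star (Compat R) u u' → Branches* θ θ' → Branches* (just u ∷ θ) (just u' ∷ θ')

    Branches*-refl : ∀ {k m} (θ : Branches k m) → Branches* θ θ
    Branches*-refl [] = []
    Branches*-refl (nothing ∷ θ) = nn (Branches*-refl θ)
    Branches*-refl (just x ∷ θ) = jj ε (Branches*-refl θ)

    Branches*-ren : ∀ {k l m} (ρ : Ren k l) {θ θ' : Branches k m} → Branches* θ θ' → Branches* (renameB ρ θ) (renameB ρ θ')
    Branches*-ren ρ [] = []
    Branches*-ren ρ (nn b) = nn (Branches*-ren ρ b)
    Branches*-ren ρ (jj x b) = jj (Star-ren ρ x) (Branches*-ren ρ b)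

    *hd : ∀ {k m} {u u' : Tm k} {θ : Branches k m} → Star (Compat R) u u' → Star (CompatB R) (just u ∷ θ) (just u' ∷ θ)
    *hd {θ = θ} = Star.gmap (λ u → just u ∷ θ) here
    *tl : ∀ {k m} {x} {θ θ' : Branches k m} → Star (CompatB R) θ θ' → Star (CompatB R) (x ∷ θ) (x ∷ θ')
    *tl {x = x} = Star.gmap (x ∷_) there

    Branches*⇒Star : ∀ {k m} {θ θ' : Branches k m} → Branches* θ θ' → Star (CompatB R) θ θ'
    Branches*⇒Star [] = ε
    Branches*⇒Star (nn b) = *tl (Branches*⇒Star b)
    Branches*⇒Star (jj x b) = *hd x ◅◅ *tl (Branches*⇒Star b)

    *caseB : ∀ {k} {θ θ' : Binding nc (Tm k)} {t} → Star (CompatB R) θ θ' → Star (Compat R) (case θ t) (case θ' t)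
    *caseB {t = t} = Star.gmap (λ θ → case θ t) caseB

    lookup-Branches* : ∀ {k m} {θ θ' : Branches k m} → Branches* θ θ' → (c : Fin m) →
       (lookup θ c ≡ nothing × lookup θ' c ≡ nothing) ⊎ Σ (Tm k) (λ u → Σ (Tm k) (λ u' → lookup θ c ≡ just u × lookup θ' c ≡ just u' × Star (Compat R) u u'))
    lookup-Branches* (nn b) zero = inj₁ (refl , refl)
    lookup-Branches* (jj x b) zero = inj₂ (_ , _ , refl , refl , x)
    lookup-Branches* (nn b) (suc c) = lookup-Branches* b c
    lookup-Branches* (jj x b) (suc c) = lookup-Branches* b c

    mutual
      pushCase-cong* : ∀ {k} {θ θ' : Binding nc (Tm k)} → Branches* θ θ' → (M : Tm k) → Star (Compat R) (pushCase θ M) (pushCase θ' M)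
      pushCase-cong* b (var i) = *caseB (Branches*⇒Star b)
      pushCase-cong* b (t · u) = *appL (pushCase-cong* b t)
      pushCase-cong* b (lam t) = *lam (pushCase-cong* (Branches*-ren suc b) t)
      pushCase-cong* {θ = θ} {θ'} b (con c) with lookup-Branches* b c
      ... | inj₁ (e , e') rewrite e | e' = *caseB (Branches*⇒Star b)
      ... | inj₂ (u , u' , e , e' , s) rewrite e | e' = s
      pushCase-cong* b (case φ t) = pushCase-cong* (pushCaseB-cong* b φ) t

      pushCaseB-cong* : ∀ {k m} {θ θ' : Binding nc (Tm k)} → Branches* θ θ' → (φ : Branches k m) →
          Branches* (pushCaseB θ φ) (pushCaseB θ' φ)
      pushCaseB-cong* b [] = []
      pushCaseB-cong* b (nothing ∷ φ) = nn (pushCaseB-cong* b φ)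
      pushCaseB-cong* b (just u ∷ φ) = jj (pushCase-cong* b u) (pushCaseB-cong* b φ)

  module ⟶βηCl = Closure BetaEta BetaEta-ren
  module ≡βηCl = Closure BetaEta± BetaEta±-ren
  module ⟶ηCl = Closure Eta Eta-ren
  module ⟶βCl = Closure Beta Beta-ren

  mutual
    Compat-map : ∀ {R R' : TmRel} → (∀ {k} {a b : Tm k} → R a b → R' a b) → ∀ {k} {a b : Tm k} → Compat R a b → Compat R' a b
    Compat-map f (top x) = top (f x)
    Compat-map f (appL d) = appL (Compat-map f d)
    Compat-map f (appR d) = appR (Compat-map f d)
    Compat-map f (lamC d) = lamC (Compat-map f d)
    Compat-map f (caseB d) = caseB (CompatB-map f d)

    CompatB-map : ∀ {R R' : TmRel} → (∀ {k} {a b : Tm k} → R a b → R' a b) → ∀ {k m} {a b : Branches k m} → CompatB R a b → CompatB R' a b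
    CompatB-map f (here d) = here (Compat-map f d)
    CompatB-map f (there d) = there (CompatB-map f d)

  Compat*-map : ∀ {R R' : TmRel} → (∀ {k} {a b : Tm k} → R a b → R' a b) → ∀ {k} {a b : Tm k} → Star (Compat R) a b → Star (Compat R') a b
  Compat*-map f = Star.map (Compat-map f)

  mutual
    Compat-flip : ∀ {k} {a b : Tm k} → Compat BetaEta± a b → Compat BetaEta± b a
    Compat-flip (top (inj₁ x)) = top (inj₂ x)
    Compat-flip (top (inj₂ x)) = top (inj₁ x)
    Compat-flip (appL d) = appL (Compat-flip d)
    Compat-flip (appR d) = appR (Compat-flip d)
    Compat-flip (lamC d) = lamC (Compat-flip d)
    Compat-flip (caseB d) = caseB (CompatB-flip d)

    CompatB-flip : ∀ {k m} {a b : Branches k m} → CompatB BetaEta± a b → CompatB BetaEta± b a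
    CompatB-flip (here d) = here (Compat-flip d)
    CompatB-flip (there d) = there (CompatB-flip d)

  ≡βη-sym : ∀ {k} {a b : Tm k} → a ≡βη b → b ≡βη a
  ≡βη-sym ε = ε
  ≡βη-sym (x ◅ xs) = ≡βη-sym xs ◅◅ (Compat-flip x ◅ ε)

  ⟶βη*⇒≡βη : ∀ {k} {a b : Tm k} → Star _⟶βη_ a b → a ≡βη b
  ⟶βη*⇒≡βη = Compat*-map inj₁

  mutual
    pushCase-⟶βη : ∀ {k} {θ : Binding nc (Tm k)} → NfB θ → {M M' : Tm k} → M ⟶βη M' → Star _⟶βη_ (pushCase θ M) (pushCase θ M')
    pushCase-⟶βη {θ = θ} nθ (top (β-step (beta {a} {b}))) =
       ≡subst (λ z → Star _⟶βη_ (pushCase θ (lam a · b)) z) eq (top (β-step beta) ◅ ε)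
      where eq : nsubst (pushCase (weakenB θ) a) (sub0 b) ≡ pushCase θ (nsubst a (sub0 b))
            eq = trans (nsubst-pushCase (weakenB θ) a (sub0 b))
                   (cong (λ z → pushCase z (nsubst a (sub0 b))) (trans (nsubstB-renameB suc (sub0 b) θ) (nfB-NfB nθ)))
    pushCase-⟶βη {θ = θ} nθ (top (η-step (eta {a} {M} e))) = top (η-step (eta (trans (cong (pushCase (weakenB θ)) e) (sym (rename-pushCase suc θ M))))) ◅ ε
    pushCase-⟶βη nθ (appL d) = ⟶βηCl.*appL (pushCase-⟶βη nθ d)
    pushCase-⟶βη nθ (appR d) = appR d ◅ ε
    pushCase-⟶βη nθ (lamC d) = ⟶βηCl.*lam (pushCase-⟶βη (NfB-ren suc nθ) d)
    pushCase-⟶βη {θ = θ} nθ (caseB {t = t} d) = ⟶βηCl.pushCase-cong* (pushCaseB-⟶βη nθ d) t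

    pushCaseB-⟶βη : ∀ {k m} {θ : Binding nc (Tm k)} → NfB θ → {ψ ψ' : Branches k m} → CompatB BetaEta ψ ψ' →
        ⟶βηCl.Branches* (pushCaseB θ ψ) (pushCaseB θ ψ')
    pushCaseB-⟶βη {θ = θ} nθ (here {θ = ψ} d) = ⟶βηCl.jj (pushCase-⟶βη nθ d) (⟶βηCl.Branches*-refl (pushCaseB θ ψ))
    pushCaseB-⟶βη nθ (there {x = nothing} d) = ⟶βηCl.nn (pushCaseB-⟶βη nθ d)
    pushCaseB-⟶βη nθ (there {x = just x} d) = ⟶βηCl.jj ε (pushCaseB-⟶βη nθ d)

  mutual
    nsubst-⟶βη : ∀ {k l} {σ : Fin k → Tm l} → NfS σ → {a a' : Tm k} → a ⟶βη a' → Star _⟶βη_ (nsubst a σ) (nsubst a' σ)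
    nsubst-⟶βη {σ = σ} nσ (top (β-step (beta {a} {b}))) = ≡subst (λ z → Star _⟶βη_ (nsubst (lam a · b) σ) z) (nsubst-β σ nσ a b) (top (β-step beta) ◅ ε)
    nsubst-⟶βη {σ = σ} nσ (top (η-step (eta {a} {M} e))) = top (η-step (eta (trans (cong (λ z → nsubst z (extS σ)) e) (nsubst-weaken σ M)))) ◅ ε
    nsubst-⟶βη nσ (appL d) = ⟶βηCl.*appL (nsubst-⟶βη nσ d)
    nsubst-⟶βη nσ (appR d) = ⟶βηCl.*appR (nsubst-⟶βη nσ d)
    nsubst-⟶βη nσ (lamC d) = ⟶βηCl.*lam (nsubst-⟶βη (NfS-ext nσ) d)
    nsubst-⟶βη {σ = σ} nσ (caseB {t = t} d) = ⟶βηCl.pushCase-cong* (nsubstB-⟶βη nσ d) (nsubst t σ)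

    nsubstB-⟶βη : ∀ {k l m} {σ : Fin k → Tm l} → NfS σ → {ψ ψ' : Branches k m} → CompatB BetaEta ψ ψ' →
        ⟶βηCl.Branches* (nsubstB ψ σ) (nsubstB ψ' σ)
    nsubstB-⟶βη {σ = σ} nσ (here {θ = ψ} d) = ⟶βηCl.jj (nsubst-⟶βη nσ d) (⟶βηCl.Branches*-refl (nsubstB ψ σ))
    nsubstB-⟶βη nσ (there {x = nothing} d) = ⟶βηCl.nn (nsubstB-⟶βη nσ d)
    nsubstB-⟶βη nσ (there {x = just x} d) = ⟶βηCl.jj ε (nsubstB-⟶βη nσ d)

  mutual
    Compat±-split : ∀ {k} {a b : Tm k} → Compat BetaEta± a b → (a ⟶βη b) ⊎ (b ⟶βη a)
    Compat±-split (top (inj₁ x)) = inj₁ (top x)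
    Compat±-split (top (inj₂ x)) = inj₂ (top x)
    Compat±-split (appL d) with Compat±-split d
    ... | inj₁ e = inj₁ (appL e)
    ... | inj₂ e = inj₂ (appL e)
    Compat±-split (appR d) with Compat±-split d
    ... | inj₁ e = inj₁ (appR e)
    ... | inj₂ e = inj₂ (appR e)
    Compat±-split (lamC d) with Compat±-split d
    ... | inj₁ e = inj₁ (lamC e)
    ... | inj₂ e = inj₂ (lamC e)
    Compat±-split (caseB d) with CompatB±-split d
    ... | inj₁ e = inj₁ (caseB e)
    ... | inj₂ e = inj₂ (caseB e)

    CompatB±-split : ∀ {k m} {a b : Branches k m} → CompatB BetaEta± a b → (CompatB BetaEta a b) ⊎ (CompatB BetaEta b a)
    CompatB±-split (here d) with Compat±-split d
    ... | inj₁ e = inj₁ (here e)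
    ... | inj₂ e = inj₂ (here e)
    CompatB±-split (there d) with CompatB±-split d
    ... | inj₁ e = inj₁ (there e)
    ... | inj₂ e = inj₂ (there e)

  ≡βη-map : ∀ {k l} {f : Tm k → Tm l} →
             (∀ {a b} → a ⟶βη b → Star _⟶βη_ (f a) (f b)) → ∀ {a b} → a ≡βη b → f a ≡βη f b
  ≡βη-map h ε = ε
  ≡βη-map h (x ◅ xs) with Compat±-split x
  ... | inj₁ e = ⟶βη*⇒≡βη (h e) ◅◅ ≡βη-map h xs
  ... | inj₂ e = ≡βη-sym (⟶βη*⇒≡βη (h e)) ◅◅ ≡βη-map h xs

  nsubst-≡βηˡ : ∀ {k l} {σ : Fin k → Tm l} → NfS σ → {a a' : Tm k} → a ≡βη a' → nsubst a σ ≡βη nsubst a' σ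
  nsubst-≡βηˡ nσ = ≡βη-map (nsubst-⟶βη nσ)

  pushCase-≡βη : ∀ {k} {θ : Binding nc (Tm k)} → NfB θ → {M M' : Tm k} → M ≡βη M' → pushCase θ M ≡βη pushCase θ M'
  pushCase-≡βη nθ = ≡βη-map (pushCase-⟶βη nθ)

  mutual
    nsubst-≡βηʳ : ∀ {k l} {σ σ' : Fin k → Tm l} → NfS σ → NfS σ' → (∀ i → σ i ≡βη σ' i) → (a : Tm k) → nsubst a σ ≡βη nsubst a σ'
    nsubst-≡βηʳ nσ nσ' e (var i) = e i
    nsubst-≡βηʳ nσ nσ' e (t · u) = ≡βηCl.*app (nsubst-≡βηʳ nσ nσ' e t) (nsubst-≡βηʳ nσ nσ' e u)
    nsubst-≡βηʳ nσ nσ' e (lam t) = ≡βηCl.*lam (nsubst-≡βηʳ (NfS-ext nσ) (NfS-ext nσ') e' t)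
      where e' : ∀ i → extS _ i ≡βη extS _ i
            e' zero = ε
            e' (suc i) = ≡βηCl.Star-ren suc (e i)
    nsubst-≡βηʳ nσ nσ' e (con c) = ε
    nsubst-≡βηʳ {σ = σ} {σ'} nσ nσ' e (case θ t) =
      pushCase-≡βη (NfB-nsubstB nσ θ) (nsubst-≡βηʳ nσ nσ' e t) ◅◅ ≡βηCl.pushCase-cong* (nsubstB-≡βηʳ nσ nσ' e θ) (nsubst t σ')

    nsubstB-≡βηʳ : ∀ {k l m} {σ σ' : Fin k → Tm l} → NfS σ → NfS σ' → (∀ i → σ i ≡βη σ' i) → (θ : Branches k m) →
        ≡βηCl.Branches* (nsubstB θ σ) (nsubstB θ σ')
    nsubstB-≡βηʳ nσ nσ' e [] = ≡βηCl.[]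
    nsubstB-≡βηʳ nσ nσ' e (nothing ∷ θ) = ≡βηCl.nn (nsubstB-≡βηʳ nσ nσ' e θ)
    nsubstB-≡βηʳ nσ nσ' e (just u ∷ θ) = ≡βηCl.jj (nsubst-≡βηʳ nσ nσ' e u) (nsubstB-≡βηʳ nσ nσ' e θ)

  mutual
    Nf-ren⁻ : ∀ {k l} (ρ : Ren k l) (t : Tm k) → Nf (rename ρ t) → Nf t
    Nf-ren⁻ ρ (var i) n = nvar
    Nf-ren⁻ ρ (t · u) (napp a b) = napp (Nf-ren⁻ ρ t a) (Nf-ren⁻ ρ u b)
    Nf-ren⁻ ρ (lam t) (nlam a) = nlam (Nf-ren⁻ (extR ρ) t a)
    Nf-ren⁻ ρ (con c) n = ncon
    Nf-ren⁻ ρ (case θ (var i)) (ncase-var x) = ncase-var (NfB-ren⁻ ρ θ x)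
    Nf-ren⁻ ρ (case θ (con c)) (ncase-con x e) = ncase-con (NfB-ren⁻ ρ θ x) (lem (lookup θ c) (trans (sym (lookup-renameB ρ θ c)) e))
      where lem : (m : Maybe (Tm _)) → Data.Maybe.map (rename ρ) m ≡ nothing → m ≡ nothing
            lem nothing e = refl

    NfB-ren⁻ : ∀ {k l m} (ρ : Ren k l) (θ : Branches k m) → NfB (renameB ρ θ) → NfB θ
    NfB-ren⁻ ρ [] n = []
    NfB-ren⁻ ρ (nothing ∷ θ) (cn n) = cn (NfB-ren⁻ ρ θ n)
    NfB-ren⁻ ρ (just u ∷ θ) (x ∷j n) = Nf-ren⁻ ρ u x ∷j NfB-ren⁻ ρ θ n

  -- Parallel β-reduction and complete development

  NfB-case : ∀ {k} {θ : Binding nc (Tm k)} {t} → Nf (case θ t) → NfB θ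
  NfB-case (ncase-var x) = x
  NfB-case (ncase-con x e) = x

  infix 4 _⇛_ _⇛B_
  mutual
    data _⇛_ : ∀ {k} → Tm k → Tm k → Set where
      pvar  : ∀ {k} {i : Fin k} → var i ⇛ var i
      pcon  : ∀ {k} {c} → con {k = k} c ⇛ con c
      papp  : ∀ {k} {a a' b b' : Tm k} → a ⇛ a' → b ⇛ b' → a · b ⇛ a' · b'
      plam  : ∀ {k} {a a' : Tm (suc k)} → a ⇛ a' → lam a ⇛ lam a'
      pcase : ∀ {k} {θ θ' : Binding nc (Tm k)} {t} → θ ⇛B θ' → case θ t ⇛ case θ' t
      pbeta : ∀ {k} {a a' : Tm (suc k)} {b b' : Tm k} → a ⇛ a' → b ⇛ b' → lam a · b ⇛ nsubst a' (sub0 b')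

    data _⇛B_ : ∀ {k m} → Branches k m → Branches k m → Set where
      []  : ∀ {k} → _⇛B_ {k} [] []
      pn  : ∀ {k m} {θ θ' : Branches k m} → θ ⇛B θ' → (nothing ∷ θ) ⇛B (nothing ∷ θ')
      pj  : ∀ {k m} {u u' : Tm k} {θ θ' : Branches k m} → u ⇛ u' → θ ⇛B θ' → (just u ∷ θ) ⇛B (just u' ∷ θ')

  mutual
    ⇛-refl : ∀ {k} (t : Tm k) → t ⇛ t
    ⇛-refl (var i) = pvar
    ⇛-refl (t · u) = papp (⇛-refl t) (⇛-refl u)
    ⇛-refl (lam t) = plam (⇛-refl t)
    ⇛-refl (con c) = pcon
    ⇛-refl (case θ t) = pcase (⇛B-refl θ)

    ⇛B-refl : ∀ {k m} (θ : Branches k m) → θ ⇛B θ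
    ⇛B-refl [] = []
    ⇛B-refl (nothing ∷ θ) = pn (⇛B-refl θ)
    ⇛B-refl (just u ∷ θ) = pj (⇛-refl u) (⇛B-refl θ)

  mutual
    β→⇛ : ∀ {k} {a b : Tm k} → a ⟶β b → a ⇛ b
    β→⇛ (top (beta {a} {b})) = pbeta (⇛-refl a) (⇛-refl b)
    β→⇛ (appL {b = b} d) = papp (β→⇛ d) (⇛-refl b)
    β→⇛ (appR {a = a} d) = papp (⇛-refl a) (β→⇛ d)
    β→⇛ (lamC d) = plam (β→⇛ d)
    β→⇛ (caseB d) = pcase (β→⇛B d)

    β→⇛B : ∀ {k m} {a b : Branches k m} → CompatB Beta a b → a ⇛B b
    β→⇛B (here {θ = θ} d) = pj (β→⇛ d) (⇛B-refl θ)
    β→⇛B (there {x = nothing} {θ} d) = pn (β→⇛B d)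
    β→⇛B (there {x = just u} d) = pj (⇛-refl u) (β→⇛B d)

  mutual
    ⇛→β* : ∀ {k} {a b : Tm k} → a ⇛ b → Star _⟶β_ a b
    ⇛→β* pvar = ε
    ⇛→β* pcon = ε
    ⇛→β* (papp d e) = ⟶βCl.*app (⇛→β* d) (⇛→β* e)
    ⇛→β* (plam d) = ⟶βCl.*lam (⇛→β* d)
    ⇛→β* (pcase d) = ⟶βCl.*caseB (⟶βCl.Branches*⇒Star (⇛B→β* d))
    ⇛→β* (pbeta d e) = ⟶βCl.*app (⟶βCl.*lam (⇛→β* d)) (⇛→β* e) ◅◅ (top beta ◅ ε)

    ⇛B→β* : ∀ {k m} {a b : Branches k m} → a ⇛B b → ⟶βCl.Branches* a b
    ⇛B→β* [] = ⟶βCl.[]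
    ⇛B→β* (pn d) = ⟶βCl.nn (⇛B→β* d)
    ⇛B→β* (pj x d) = ⟶βCl.jj (⇛→β* x) (⇛B→β* d)

  mutual
    ⇛-ren : ∀ {k l} (ρ : Ren k l) {a b : Tm k} → a ⇛ b → rename ρ a ⇛ rename ρ b
    ⇛-ren ρ pvar = pvar
    ⇛-ren ρ pcon = pcon
    ⇛-ren ρ (papp d e) = papp (⇛-ren ρ d) (⇛-ren ρ e)
    ⇛-ren ρ (plam d) = plam (⇛-ren (extR ρ) d)
    ⇛-ren ρ (pcase d) = pcase (⇛B-ren ρ d)
    ⇛-ren ρ (pbeta {a' = a'} {b' = b'} d e) = ≡subst (_ ⇛_) (sym (rename-sub0 ρ a' b')) (pbeta (⇛-ren (extR ρ) d) (⇛-ren ρ e))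

    ⇛B-ren : ∀ {k l m} (ρ : Ren k l) {a b : Branches k m} → a ⇛B b → renameB ρ a ⇛B renameB ρ b
    ⇛B-ren ρ [] = []
    ⇛B-ren ρ (pn d) = pn (⇛B-ren ρ d)
    ⇛B-ren ρ (pj x d) = pj (⇛-ren ρ x) (⇛B-ren ρ d)

  lookup-⇛B-nothing : ∀ {k m} {θ θ' : Branches k m} → θ ⇛B θ' → (c : Fin m) → lookup θ c ≡ nothing → lookup θ' c ≡ nothing
  lookup-⇛B-nothing (pn d) zero e = refl
  lookup-⇛B-nothing (pj x d) zero ()
  lookup-⇛B-nothing (pn d) (suc c) e = lookup-⇛B-nothing d c e
  lookup-⇛B-nothing (pj x d) (suc c) e = lookup-⇛B-nothing d c e

  mutual
    Nf-⇛ : ∀ {k} {a b : Tm k} → Nf a → a ⇛ b → Nf b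
    Nf-⇛ n pvar = n
    Nf-⇛ n pcon = n
    Nf-⇛ (napp x y) (papp d e) = napp (Nf-⇛ x d) (Nf-⇛ y e)
    Nf-⇛ (nlam x) (plam d) = nlam (Nf-⇛ x d)
    Nf-⇛ (ncase-var x) (pcase d) = ncase-var (NfB-⇛ x d)
    Nf-⇛ (ncase-con x e) (pcase d) = ncase-con (NfB-⇛ x d) (lookup-⇛B-nothing d _ e)
    Nf-⇛ (napp (nlam x) y) (pbeta {a' = a'} d e) = Nf-nsubst nσ a'
      where nσ : NfS (sub0 _)
            nσ zero = Nf-⇛ y e
            nσ (suc i) = nvar

    NfB-⇛ : ∀ {k m} {a b : Branches k m} → NfB a → a ⇛B b → NfB b
    NfB-⇛ [] [] = []
    NfB-⇛ (cn n) (pn d) = cn (NfB-⇛ n d)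
    NfB-⇛ (x ∷j n) (pj y d) = Nf-⇛ x y ∷j NfB-⇛ n d

  lookup-⇛B : ∀ {k m} {θ θ' : Branches k m} → θ ⇛B θ' → (c : Fin m) →
       (lookup θ c ≡ nothing × lookup θ' c ≡ nothing) ⊎ Σ (Tm k) (λ u → Σ (Tm k) (λ u' → lookup θ c ≡ just u × lookup θ' c ≡ just u' × u ⇛ u'))
  lookup-⇛B (pn b) zero = inj₁ (refl , refl)
  lookup-⇛B (pj x b) zero = inj₂ (_ , _ , refl , refl , x)
  lookup-⇛B (pn b) (suc c) = lookup-⇛B b c
  lookup-⇛B (pj x b) (suc c) = lookup-⇛B b c

  lookup-map-nothing : ∀ {k l m} (f : Tm k → Tm l) (φ : Branches k m) (c : Fin m) → lookup φ c ≡ nothing →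
      Data.Maybe.map f (lookup φ c) ≡ nothing
  lookup-map-nothing f φ c e rewrite e = refl

  mutual
    pushCase-⇛ : ∀ {k} {θ θ' : Binding nc (Tm k)} {M M' : Tm k} → NfB θ → Nf M → θ ⇛B θ' → M ⇛ M' → pushCase θ M ⇛ pushCase θ' M'
    pushCase-⇛ nθ nM dθ pvar = pcase dθ
    pushCase-⇛ {θ = θ} {θ'} {con c} nθ nM dθ pcon with lookup-⇛B dθ c
    ... | inj₁ (e , e') rewrite e | e' = pcase dθ
    ... | inj₂ (u , u' , e , e' , d) rewrite e | e' = d
    pushCase-⇛ nθ (napp x y) dθ (papp d e) = papp (pushCase-⇛ nθ x dθ d) e
    pushCase-⇛ nθ (nlam x) dθ (plam d) = plam (pushCase-⇛ (NfB-ren suc nθ) x (⇛B-ren suc dθ) d)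
    pushCase-⇛ {θ = θ} {θ'} nθ (ncase-var nψ) dθ (pcase {θ = ψ} {ψ'} {t = var i} dψ) = pcase (pushCaseB-⇛ nθ nψ dθ dψ)
    pushCase-⇛ {θ = θ} {θ'} nθ (ncase-con nψ e) dθ (pcase {θ = ψ} {ψ'} {t = con c} dψ)
      rewrite trans (lookup-pushCaseB θ ψ c) (lookup-map-nothing (pushCase θ) ψ c e)
            | trans (lookup-pushCaseB θ' ψ' c) (lookup-map-nothing (pushCase θ') ψ' c (lookup-⇛B-nothing dψ c e))
      = pcase (pushCaseB-⇛ nθ nψ dθ dψ)
    pushCase-⇛ {θ = θ} {θ'} nθ (napp (nlam x) y) dθ (pbeta {a = a} {a'} {b} {b'} d e) =
      ≡subst (_ ⇛_) eq (pbeta (pushCase-⇛ (NfB-ren suc nθ) x (⇛B-ren suc dθ) d) e)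
      where eq : nsubst (pushCase (weakenB θ') a') (sub0 b') ≡ pushCase θ' (nsubst a' (sub0 b'))
            eq = trans (nsubst-pushCase (weakenB θ') a' (sub0 b'))
                   (cong (λ z → pushCase z (nsubst a' (sub0 b'))) (trans (nsubstB-renameB suc (sub0 b') θ') (nfB-NfB (NfB-⇛ nθ dθ))))

    pushCaseB-⇛ : ∀ {k m} {θ θ' : Binding nc (Tm k)} {ψ ψ' : Branches k m} → NfB θ → NfB ψ → θ ⇛B θ' → ψ ⇛B ψ' →
        pushCaseB θ ψ ⇛B pushCaseB θ' ψ'
    pushCaseB-⇛ nθ [] dθ [] = []
    pushCaseB-⇛ nθ (cn n) dθ (pn d) = pn (pushCaseB-⇛ nθ n dθ d)
    pushCaseB-⇛ nθ (x ∷j n) dθ (pj y d) = pj (pushCase-⇛ nθ x dθ y) (pushCaseB-⇛ nθ n dθ d)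

  extS-⇛ : ∀ {k l} {σ σ' : Fin k → Tm l} → (∀ i → σ i ⇛ σ' i) → ∀ i → extS σ i ⇛ extS σ' i
  extS-⇛ d zero = pvar
  extS-⇛ d (suc i) = ⇛-ren suc (d i)

  mutual
    nsubst-⇛ʳ : ∀ {k l} {σ σ' : Fin k → Tm l} → NfS σ → (∀ i → σ i ⇛ σ' i) → (t : Tm k) → nsubst t σ ⇛ nsubst t σ'
    nsubst-⇛ʳ nσ d (var i) = d i
    nsubst-⇛ʳ nσ d (t · u) = papp (nsubst-⇛ʳ nσ d t) (nsubst-⇛ʳ nσ d u)
    nsubst-⇛ʳ nσ d (lam t) = plam (nsubst-⇛ʳ (NfS-ext nσ) (extS-⇛ d) t)
    nsubst-⇛ʳ nσ d (con c) = pcon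
    nsubst-⇛ʳ nσ d (case θ t) = pushCase-⇛ (NfB-nsubstB nσ θ) (Nf-nsubst nσ t) (nsubstB-⇛ʳ nσ d θ) (nsubst-⇛ʳ nσ d t)

    nsubstB-⇛ʳ : ∀ {k l m} {σ σ' : Fin k → Tm l} → NfS σ → (∀ i → σ i ⇛ σ' i) → (θ : Branches k m) → nsubstB θ σ ⇛B nsubstB θ σ'
    nsubstB-⇛ʳ nσ d [] = []
    nsubstB-⇛ʳ nσ d (nothing ∷ θ) = pn (nsubstB-⇛ʳ nσ d θ)
    nsubstB-⇛ʳ nσ d (just u ∷ θ) = pj (nsubst-⇛ʳ nσ d u) (nsubstB-⇛ʳ nσ d θ)

  mutual
    nsubst-⇛ : ∀ {k l} {σ σ' : Fin k → Tm l} → NfS σ → (∀ i → σ i ⇛ σ' i) → {a a' : Tm k} → a ⇛ a' → nsubst a σ ⇛ nsubst a' σ'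
    nsubst-⇛ nσ d {var i} pvar = d i
    nsubst-⇛ nσ d pcon = pcon
    nsubst-⇛ nσ d (papp x y) = papp (nsubst-⇛ nσ d x) (nsubst-⇛ nσ d y)
    nsubst-⇛ nσ d (plam x) = plam (nsubst-⇛ (NfS-ext nσ) (extS-⇛ d) x)
    nsubst-⇛ nσ d {case θ t} (pcase x) = pushCase-⇛ (NfB-nsubstB nσ θ) (Nf-nsubst nσ t) (nsubstB-⇛ nσ d x) (nsubst-⇛ʳ nσ d t)
    nsubst-⇛ {σ = σ} {σ'} nσ d (pbeta {a' = a'} {b' = b'} x y) =
      ≡subst (_ ⇛_) (nsubst-β σ' (λ i → Nf-⇛ (nσ i) (d i)) a' b') (pbeta (nsubst-⇛ (NfS-ext nσ) (extS-⇛ d) x) (nsubst-⇛ nσ d y))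

    nsubstB-⇛ : ∀ {k l m} {σ σ' : Fin k → Tm l} → NfS σ → (∀ i → σ i ⇛ σ' i) → {θ θ' : Branches k m} → θ ⇛B θ' →
        nsubstB θ σ ⇛B nsubstB θ' σ'
    nsubstB-⇛ nσ d [] = []
    nsubstB-⇛ nσ d (pn x) = pn (nsubstB-⇛ nσ d x)
    nsubstB-⇛ nσ d (pj x y) = pj (nsubst-⇛ nσ d x) (nsubstB-⇛ nσ d y)

  mutual
    develop : ∀ {k} → Tm k → Tm k
    develop (var i) = var i
    develop (a · b) = developApp a (develop b)
    develop (lam a) = lam (develop a)
    develop (con c) = con c
    develop (case θ t) = case (developB θ) t

    developApp : ∀ {k} → Tm k → Tm k → Tm k
    developApp (lam p) db = nsubst (develop p) (sub0 db)
    developApp (var i) db = var i · db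
    developApp (a · a') db = developApp a (develop a') · db
    developApp (con c) db = con c · db
    developApp (case θ t) db = case (developB θ) t · db

    developB : ∀ {k m} → Branches k m → Branches k m
    developB [] = []
    developB (nothing ∷ θ) = nothing ∷ developB θ
    developB (just u ∷ θ) = just (develop u) ∷ developB θ

  NfS-sub0 : ∀ {k} {q : Tm k} → Nf q → NfS (sub0 q)
  NfS-sub0 n zero = n
  NfS-sub0 n (suc i) = nvar

  mutual
    ⇛-develop : ∀ {k} {a b : Tm k} → Nf a → a ⇛ b → b ⇛ develop a
    ⇛-develop n pvar = pvar
    ⇛-develop n pcon = pcon
    ⇛-develop (napp (nlam x) y) (papp (plam d) e) = pbeta (⇛-develop x d) (⇛-develop y e)
    ⇛-develop (napp x y) (papp pvar e) = papp pvar (⇛-develop y e)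
    ⇛-develop (napp x y) (papp pcon e) = papp pcon (⇛-develop y e)
    ⇛-develop (napp x y) (papp (papp d d') e) = papp (⇛-develop x (papp d d')) (⇛-develop y e)
    ⇛-develop (napp x y) (papp (pbeta d d') e) = papp (⇛-develop x (pbeta d d')) (⇛-develop y e)
    ⇛-develop (napp x y) (papp (pcase d) e) = papp (⇛-develop x (pcase d)) (⇛-develop y e)
    ⇛-develop (nlam x) (plam d) = plam (⇛-develop x d)
    ⇛-develop n (pcase d) = pcase (⇛B-developB (NfB-case n) d)
    ⇛-develop (napp (nlam x) y) (pbeta d e) = nsubst-⇛ (NfS-sub0 (Nf-⇛ y e)) σd (⇛-develop x d)
      where σd : ∀ i → sub0 _ i ⇛ sub0 _ i
            σd zero = ⇛-develop y e
            σd (suc i) = pvar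

    ⇛B-developB : ∀ {k m} {a b : Branches k m} → NfB a → a ⇛B b → b ⇛B developB a
    ⇛B-developB [] [] = []
    ⇛B-developB (cn n) (pn d) = pn (⇛B-developB n d)
    ⇛B-developB (x ∷j n) (pj y d) = pj (⇛-develop x y) (⇛B-developB n d)

  ⇛-diamond : ∀ {k} {a b c : Tm k} → Nf a → a ⇛ b → a ⇛ c → Join _⇛_ _⇛_ b c
  ⇛-diamond {a = a} n d e = develop a , ⇛-develop n d , ⇛-develop n e

  -- Strengthening: reducts of a renamed term are renamed reducts

  IsPullback : ∀ {a b c a'} (f : Ren a c) (g : Ren b c) (u : Ren a' a) (v : Ren a' b) → Set
  IsPullback {a' = a'} f g u v = ∀ i j → f i ≡ g j → Σ (Fin a') (λ i' → i ≡ u i' × j ≡ v i')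

  IsPullback-extR : ∀ {a b c a'} {f : Ren a c} {g : Ren b c} {u : Ren a' a} {v : Ren a' b} → IsPullback f g u v →
      IsPullback (extR f) (extR g) (extR u) (extR v)
  IsPullback-extR p zero zero e = zero , refl , refl
  IsPullback-extR p zero (suc j) ()
  IsPullback-extR p (suc i) zero ()
  IsPullback-extR p (suc i) (suc j) e with p i j (suc-injective e)
  ... | i' , e1 , e2 = suc i' , cong suc e1 , cong suc e2

  mutual
    rename-pullback : ∀ {a b c a'} {f : Ren a c} {g : Ren b c} {u : Ren a' a} {v : Ren a' b} → IsPullback f g u v →
         (t : Tm a) (M : Tm b) → rename f t ≡ rename g M → Σ (Tm a') (λ t0 → t ≡ rename u t0 × M ≡ rename v t0)
    rename-pullback p (var i) (var j) e with p i j (var-inj e)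
    ... | i' , e1 , e2 = var i' , cong var e1 , cong var e2
    rename-pullback p (var i) (M · M₁) ()
    rename-pullback p (var i) (lam M) ()
    rename-pullback p (var i) (con x) ()
    rename-pullback p (var i) (case x M) ()
    rename-pullback p (t · t₁) (var x) ()
    rename-pullback p (t · t₁) (M · M₁) e with rename-pullback p t M (app-inj₁ e) | rename-pullback p t₁ M₁ (app-inj₂ e)
    ... | t0 , e1 , e2 | t1 , e3 , e4 = t0 · t1 , cong₂ _·_ e1 e3 , cong₂ _·_ e2 e4
    rename-pullback p (t · t₁) (lam M) ()
    rename-pullback p (t · t₁) (con x) ()
    rename-pullback p (t · t₁) (case x M) ()
    rename-pullback p (lam t) (var x) ()
    rename-pullback p (lam t) (M · M₁) ()
    rename-pullback p (lam t) (lam M) e with rename-pullback (IsPullback-extR p) t M (lam-inj e)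
    ... | t0 , e1 , e2 = lam t0 , cong lam e1 , cong lam e2
    rename-pullback p (lam t) (con x) ()
    rename-pullback p (lam t) (case x M) ()
    rename-pullback p (con x) (var x₁) ()
    rename-pullback p (con x) (M · M₁) ()
    rename-pullback p (con x) (lam M) ()
    rename-pullback p (con x) (con x₁) e = con x , refl , cong con (sym (con-inj e))
    rename-pullback p (con x) (case x₁ M) ()
    rename-pullback p (case x t) (var x₁) ()
    rename-pullback p (case x t) (M · M₁) ()
    rename-pullback p (case x t) (lam M) ()
    rename-pullback p (case x t) (con x₁) ()
    rename-pullback p (case θ t) (case φ M) e with renameB-pullback p θ φ (case-inj₁ e) | rename-pullback p t M (case-inj₂ e)
    ... | θ0 , e1 , e2 | t0 , e3 , e4 = case θ0 t0 , cong₂ case e1 e3 , cong₂ case e2 e4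

    renameB-pullback : ∀ {a b c a' m} {f : Ren a c} {g : Ren b c} {u : Ren a' a} {v : Ren a' b} → IsPullback f g u v →
         (θ : Branches a m) (φ : Branches b m) → renameB f θ ≡ renameB g φ → Σ (Branches a' m) (λ θ0 → θ ≡ renameB u θ0 × φ ≡ renameB v θ0)
    renameB-pullback p [] [] e = [] , refl , refl
    renameB-pullback p (nothing ∷ θ) (nothing ∷ φ) e with renameB-pullback p θ φ (∷-injectiveʳ e)
    ... | θ0 , e1 , e2 = nothing ∷ θ0 , cong (nothing ∷_) e1 , cong (nothing ∷_) e2
    renameB-pullback p (nothing ∷ θ) (just x ∷ φ) ()
    renameB-pullback p (just x ∷ θ) (nothing ∷ φ) ()
    renameB-pullback p (just x ∷ θ) (just y ∷ φ) e with rename-pullback p x y (just-injective (∷-injectiveˡ e)) | renameB-pullback p θ φ (∷-injectiveʳ e)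
    ... | t0 , e1 , e2 | θ0 , e3 , e4 = just t0 ∷ θ0 , cong₂ (λ a b → just a ∷ b) e1 e3 , cong₂ (λ a b → just a ∷ b) e2 e4

  extR-suc-pullback : ∀ {k l} (ρ : Ren k l) → IsPullback (extR ρ) suc suc ρ
  extR-suc-pullback ρ zero j ()
  extR-suc-pullback ρ (suc i) j e = i , refl , sym (suc-injective e)

  suc-pullback : ∀ {k} → IsPullback {k} {k} suc suc (λ i → i) (λ i → i)
  suc-pullback i j e = i , refl , sym (suc-injective e)

  weaken-injective : ∀ {k} {M M' : Tm k} → weaken M ≡ weaken M' → M ≡ M'
  weaken-injective {M = M} {M'} e with rename-pullback suc-pullback M M' e
  ... | t0 , e1 , e2 = trans e1 (trans (rename-id t0) (sym (trans e2 (rename-id t0))))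

  weaken-lam⁻¹ : ∀ {k} (M : Tm k) {p : Tm (suc (suc k))} → lam p ≡ weaken M → Σ (Tm (suc k)) (λ p0 → M ≡ lam p0 × p ≡ rename (extR suc) p0)
  weaken-lam⁻¹ (lam p0) refl = p0 , refl , refl

  mutual
    ⇛-strengthen : ∀ {k l} (ρ : Ren k l) {s X : Tm l} → s ⇛ X → (t : Tm k) → s ≡ rename ρ t → Σ (Tm k) (λ t' → X ≡ rename ρ t' × t ⇛ t')
    ⇛-strengthen ρ pvar (var i) refl = var i , refl , pvar
    ⇛-strengthen ρ pcon (con c) refl = con c , refl , pcon
    ⇛-strengthen ρ (papp d e) (t1 · t2) refl with ⇛-strengthen ρ d t1 refl | ⇛-strengthen ρ e t2 refl
    ... | a , e1 , d1 | b , e2 , d2 = a · b , cong₂ _·_ e1 e2 , papp d1 d2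
    ⇛-strengthen ρ (plam d) (lam t1) refl with ⇛-strengthen (extR ρ) d t1 refl
    ... | a , e1 , d1 = lam a , cong lam e1 , plam d1
    ⇛-strengthen ρ (pcase d) (case θ0 t0) refl with ⇛B-strengthen ρ d θ0 refl
    ... | θ1 , e1 , d1 = case θ1 t0 , cong (λ z → case z (rename ρ t0)) e1 , pcase d1
    ⇛-strengthen ρ (pbeta d e) (lam p0 · q0) refl with ⇛-strengthen (extR ρ) d p0 refl | ⇛-strengthen ρ e q0 refl
    ... | p' , e1 , d1 | q' , e2 , d2 = nsubst p' (sub0 q') , trans (cong₂ (λ x y → nsubst x (sub0 y)) e1 e2) (sym (rename-sub0 ρ p' q')) , pbeta d1 d2
    ⇛-strengthen ρ pvar (_ · _) ()
    ⇛-strengthen ρ pvar (lam _) ()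
    ⇛-strengthen ρ pvar (con _) ()
    ⇛-strengthen ρ pvar (case _ _) ()
    ⇛-strengthen ρ pcon (var _) ()
    ⇛-strengthen ρ pcon (_ · _) ()
    ⇛-strengthen ρ pcon (lam _) ()
    ⇛-strengthen ρ pcon (case _ _) ()
    ⇛-strengthen ρ (papp d e) (var _) ()
    ⇛-strengthen ρ (papp d e) (lam _) ()
    ⇛-strengthen ρ (papp d e) (con _) ()
    ⇛-strengthen ρ (papp d e) (case _ _) ()
    ⇛-strengthen ρ (plam d) (var _) ()
    ⇛-strengthen ρ (plam d) (_ · _) ()
    ⇛-strengthen ρ (plam d) (con _) ()
    ⇛-strengthen ρ (plam d) (case _ _) ()
    ⇛-strengthen ρ (pcase d) (var _) ()
    ⇛-strengthen ρ (pcase d) (_ · _) ()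
    ⇛-strengthen ρ (pcase d) (lam _) ()
    ⇛-strengthen ρ (pcase d) (con _) ()
    ⇛-strengthen ρ (pbeta d e) (var _) ()
    ⇛-strengthen ρ (pbeta d e) (lam _) ()
    ⇛-strengthen ρ (pbeta d e) (con _) ()
    ⇛-strengthen ρ (pbeta d e) (case _ _) ()
    ⇛-strengthen ρ (pbeta d e) ((var _) · _) ()
    ⇛-strengthen ρ (pbeta d e) ((_ · _) · _) ()
    ⇛-strengthen ρ (pbeta d e) ((con _) · _) ()
    ⇛-strengthen ρ (pbeta d e) ((case _ _) · _) ()

    ⇛B-strengthen : ∀ {k l m} (ρ : Ren k l) {θ θ' : Branches l m} → θ ⇛B θ' → (θ0 : Branches k m) → θ ≡ renameB ρ θ0 →
        Σ (Branches k m) (λ θ1 → θ' ≡ renameB ρ θ1 × θ0 ⇛B θ1)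
    ⇛B-strengthen ρ [] [] refl = [] , refl , []
    ⇛B-strengthen ρ (pn d) (nothing ∷ θ0) refl with ⇛B-strengthen ρ d θ0 refl
    ... | θ1 , e1 , d1 = nothing ∷ θ1 , cong (nothing ∷_) e1 , pn d1
    ⇛B-strengthen ρ (pj x d) (just u ∷ θ0) refl with ⇛-strengthen ρ x u refl | ⇛B-strengthen ρ d θ0 refl
    ... | u' , e0 , d0 | θ1 , e1 , d1 = just u' ∷ θ1 , cong₂ (λ a b → just a ∷ b) e0 e1 , pj d0 d1
    ⇛B-strengthen ρ (pn d) (just u ∷ θ0) ()
    ⇛B-strengthen ρ (pj x d) (nothing ∷ θ0) ()

  mutual
    ⟶η-strengthen : ∀ {k l} (ρ : Ren k l) {s X : Tm l} → s ⟶η X → (t : Tm k) → s ≡ rename ρ t → Σ (Tm k) (λ t' → X ≡ rename ρ t' × t ⟶η t')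
    ⟶η-strengthen ρ (top (eta {M = M} e0)) (lam (t1 · var zero)) refl with rename-pullback (extR-suc-pullback ρ) t1 M e0
    ... | t0 , e1 , e2 = t0 , e2 , top (eta e1)
    ⟶η-strengthen ρ (appL d) (t1 · t2) refl with ⟶η-strengthen ρ d t1 refl
    ... | a , e1 , d1 = a · t2 , cong (_· rename ρ t2) e1 , appL d1
    ⟶η-strengthen ρ (appR d) (t1 · t2) refl with ⟶η-strengthen ρ d t2 refl
    ... | a , e1 , d1 = t1 · a , cong (rename ρ t1 ·_) e1 , appR d1
    ⟶η-strengthen ρ (lamC d) (lam t1) refl with ⟶η-strengthen (extR ρ) d t1 refl
    ... | a , e1 , d1 = lam a , cong lam e1 , lamC d1
    ⟶η-strengthen ρ (caseB d) (case θ0 t0) refl with ⟶ηB-strengthen ρ d θ0 refl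
    ... | θ1 , e1 , d1 = case θ1 t0 , cong (λ z → case z (rename ρ t0)) e1 , caseB d1
    ⟶η-strengthen ρ (top (eta e0)) (var _) ()
    ⟶η-strengthen ρ (top (eta e0)) (_ · _) ()
    ⟶η-strengthen ρ (top (eta e0)) (con _) ()
    ⟶η-strengthen ρ (top (eta e0)) (case _ _) ()
    ⟶η-strengthen ρ (top (eta e0)) (lam (var _)) ()
    ⟶η-strengthen ρ (top (eta e0)) (lam (lam _)) ()
    ⟶η-strengthen ρ (top (eta e0)) (lam (con _)) ()
    ⟶η-strengthen ρ (top (eta e0)) (lam (case _ _)) ()
    ⟶η-strengthen ρ (top (eta e0)) (lam (_ · (_ · _))) ()
    ⟶η-strengthen ρ (top (eta e0)) (lam (_ · (lam _))) ()
    ⟶η-strengthen ρ (top (eta e0)) (lam (_ · (con _))) ()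
    ⟶η-strengthen ρ (top (eta e0)) (lam (_ · (case _ _))) ()
    ⟶η-strengthen ρ (top (eta e0)) (lam (_ · var (suc _))) ()
    ⟶η-strengthen ρ (appL d) (var _) ()
    ⟶η-strengthen ρ (appL d) (lam _) ()
    ⟶η-strengthen ρ (appL d) (con _) ()
    ⟶η-strengthen ρ (appL d) (case _ _) ()
    ⟶η-strengthen ρ (appR d) (var _) ()
    ⟶η-strengthen ρ (appR d) (lam _) ()
    ⟶η-strengthen ρ (appR d) (con _) ()
    ⟶η-strengthen ρ (appR d) (case _ _) ()
    ⟶η-strengthen ρ (lamC d) (var _) ()
    ⟶η-strengthen ρ (lamC d) (_ · _) ()
    ⟶η-strengthen ρ (lamC d) (con _) ()
    ⟶η-strengthen ρ (lamC d) (case _ _) ()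
    ⟶η-strengthen ρ (caseB d) (var _) ()
    ⟶η-strengthen ρ (caseB d) (_ · _) ()
    ⟶η-strengthen ρ (caseB d) (lam _) ()
    ⟶η-strengthen ρ (caseB d) (con _) ()

    ⟶ηB-strengthen : ∀ {k l m} (ρ : Ren k l) {θ θ' : Branches l m} → CompatB Eta θ θ' → (θ0 : Branches k m) →
        θ ≡ renameB ρ θ0 → Σ (Branches k m) (λ θ1 → θ' ≡ renameB ρ θ1 × CompatB Eta θ0 θ1)
    ⟶ηB-strengthen ρ (here d) (just u ∷ θ0) refl with ⟶η-strengthen ρ d u refl
    ... | u' , e0 , d0 = just u' ∷ θ0 , cong (λ z → just z ∷ renameB ρ θ0) e0 , here d0
    ⟶ηB-strengthen ρ (here d) (nothing ∷ θ0) ()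
    ⟶ηB-strengthen ρ (there d) (nothing ∷ θ0) refl with ⟶ηB-strengthen ρ d θ0 refl
    ... | θ1 , e1 , d1 = nothing ∷ θ1 , cong (nothing ∷_) e1 , there d1
    ⟶ηB-strengthen ρ (there d) (just u ∷ θ0) refl with ⟶ηB-strengthen ρ d θ0 refl
    ... | θ1 , e1 , d1 = just u ∷ θ1 , cong (just (rename ρ u) ∷_) e1 , there d1

  -- Confluence

  _⟶η⁼_ : ∀ {k} → Tm k → Tm k → Set
  a ⟶η⁼ b = (a ≡ b) ⊎ (a ⟶η b)

  ⟶η⁼-map : ∀ {k l} (f : Tm k → Tm l) → (∀ {a b} → a ⟶η b → f a ⟶η f b) → ∀ {a b} → a ⟶η⁼ b → f a ⟶η⁼ f b
  ⟶η⁼-map f g (inj₁ refl) = inj₁ refl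
  ⟶η⁼-map f g (inj₂ d) = inj₂ (g d)

  mutual
    ⟶η-diamond : ∀ {k} {a b c : Tm k} → a ⟶η b → a ⟶η c → Join _⟶η⁼_ _⟶η⁼_ b c
    ⟶η-diamond (top (eta {M = M} e1)) (top (eta e2)) = M , inj₁ refl , inj₁ (sym (weaken-injective (trans (sym e1) e2)))
    ⟶η-diamond (top (eta {M = M} e)) (lamC (appL d)) with ⟶η-strengthen suc d M e
    ... | M' , e' , dM = M' , inj₂ dM , inj₂ (top (eta e'))
    ⟶η-diamond (top (eta e)) (lamC (appR (top ())))
    ⟶η-diamond (top (eta e)) (lamC (top ()))
    ⟶η-diamond (lamC (appL d)) (top (eta {M = M} e)) with ⟶η-strengthen suc d M e
    ... | M' , e' , dM = M' , inj₂ (top (eta e')) , inj₂ dM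
    ⟶η-diamond (lamC (appR (top ()))) (top (eta e))
    ⟶η-diamond (lamC (top ())) (top (eta e))
    ⟶η-diamond (appL d1) (appL d2) with ⟶η-diamond d1 d2
    ... | x , p , q = x · _ , ⟶η⁼-map (_· _) appL p , ⟶η⁼-map (_· _) appL q
    ⟶η-diamond (appL d1) (appR d2) = _ , inj₂ (appR d2) , inj₂ (appL d1)
    ⟶η-diamond (appR d1) (appL d2) = _ , inj₂ (appL d2) , inj₂ (appR d1)
    ⟶η-diamond (appR d1) (appR d2) with ⟶η-diamond d1 d2
    ... | x , p , q = _ · x , ⟶η⁼-map (_ ·_) appR p , ⟶η⁼-map (_ ·_) appR q
    ⟶η-diamond (lamC d1) (lamC d2) with ⟶η-diamond d1 d2
    ... | x , p , q = lam x , ⟶η⁼-map lam lamC p , ⟶η⁼-map lam lamC q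
    ⟶η-diamond (caseB d1) (caseB d2) with ⟶ηB-diamond d1 d2
    ... | x , p , q = case x _ , lift p , lift q
      where lift : ∀ {θ1 θ2 t} → (θ1 ≡ θ2) ⊎ CompatB Eta θ1 θ2 → case θ1 t ⟶η⁼ case θ2 t
            lift (inj₁ refl) = inj₁ refl
            lift (inj₂ d) = inj₂ (caseB d)

    ⟶ηB-diamond : ∀ {k m} {a b c : Branches k m} → CompatB Eta a b → CompatB Eta a c →
        Σ (Branches k m) (λ d → ((b ≡ d) ⊎ CompatB Eta b d) × ((c ≡ d) ⊎ CompatB Eta c d))
    ⟶ηB-diamond (here d1) (here d2) with ⟶η-diamond d1 d2
    ... | x , p , q = just x ∷ _ , lift p , lift q
      where lift : ∀ {u v θ} → u ⟶η⁼ v → ((just u ∷ θ) ≡ (just v ∷ θ)) ⊎ CompatB Eta (just u ∷ θ) (just v ∷ θ)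
            lift (inj₁ refl) = inj₁ refl
            lift (inj₂ d) = inj₂ (here d)
    ⟶ηB-diamond (here d1) (there d2) = _ , inj₂ (there d2) , inj₂ (here d1)
    ⟶ηB-diamond (there d1) (here d2) = _ , inj₂ (here d2) , inj₂ (there d1)
    ⟶ηB-diamond (there d1) (there d2) with ⟶ηB-diamond d1 d2
    ... | x , p , q = _ ∷ x , lift p , lift q
      where lift : ∀ {y θ1 θ2} → (θ1 ≡ θ2) ⊎ CompatB Eta θ1 θ2 → ((y ∷ θ1) ≡ (y ∷ θ2)) ⊎ CompatB Eta (y ∷ θ1) (y ∷ θ2)
            lift (inj₁ refl) = inj₁ refl
            lift (inj₂ d) = inj₂ (there d)

  mutual
    pushCase-⟶η : ∀ {k} (θ : Binding nc (Tm k)) {M M' : Tm k} → M ⟶η M' → Star _⟶η_ (pushCase θ M) (pushCase θ M')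
    pushCase-⟶η θ (top (eta {a} {M} e)) = top (eta (trans (cong (pushCase (weakenB θ)) e) (sym (rename-pushCase suc θ M)))) ◅ ε
    pushCase-⟶η θ (appL d) = ⟶ηCl.*appL (pushCase-⟶η θ d)
    pushCase-⟶η θ (appR d) = appR d ◅ ε
    pushCase-⟶η θ (lamC d) = ⟶ηCl.*lam (pushCase-⟶η (weakenB θ) d)
    pushCase-⟶η θ (caseB {t = t} d) = ⟶ηCl.pushCase-cong* (pushCaseB-⟶η θ d) t

    pushCaseB-⟶η : ∀ {k m} (θ : Binding nc (Tm k)) {ψ ψ' : Branches k m} → CompatB Eta ψ ψ' →
        ⟶ηCl.Branches* (pushCaseB θ ψ) (pushCaseB θ ψ')
    pushCaseB-⟶η θ (here {θ = ψ} d) = ⟶ηCl.jj (pushCase-⟶η θ d) (⟶ηCl.Branches*-refl (pushCaseB θ ψ))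
    pushCaseB-⟶η θ (there {x = nothing} d) = ⟶ηCl.nn (pushCaseB-⟶η θ d)
    pushCaseB-⟶η θ (there {x = just x} d) = ⟶ηCl.jj ε (pushCaseB-⟶η θ d)

  pushCase-⟶η* : ∀ {k} (θ : Binding nc (Tm k)) {M M' : Tm k} → Star _⟶η_ M M' → Star _⟶η_ (pushCase θ M) (pushCase θ M')
  pushCase-⟶η* θ ε = ε
  pushCase-⟶η* θ (x ◅ xs) = pushCase-⟶η θ x ◅◅ pushCase-⟶η* θ xs

  mutual
    nsubst-⟶ηˡ : ∀ {k l} (σ : Fin k → Tm l) {a a' : Tm k} → a ⟶η a' → Star _⟶η_ (nsubst a σ) (nsubst a' σ)
    nsubst-⟶ηˡ σ (top (eta {a} {M} e)) = top (eta (trans (cong (λ z → nsubst z (extS σ)) e) (nsubst-weaken σ M))) ◅ ε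
    nsubst-⟶ηˡ σ (appL d) = ⟶ηCl.*appL (nsubst-⟶ηˡ σ d)
    nsubst-⟶ηˡ σ (appR d) = ⟶ηCl.*appR (nsubst-⟶ηˡ σ d)
    nsubst-⟶ηˡ σ (lamC d) = ⟶ηCl.*lam (nsubst-⟶ηˡ (extS σ) d)
    nsubst-⟶ηˡ σ (caseB {t = t} d) = ⟶ηCl.pushCase-cong* (nsubstB-⟶ηˡ σ d) (nsubst t σ)

    nsubstB-⟶ηˡ : ∀ {k l m} (σ : Fin k → Tm l) {ψ ψ' : Branches k m} → CompatB Eta ψ ψ' → ⟶ηCl.Branches* (nsubstB ψ σ) (nsubstB ψ' σ)
    nsubstB-⟶ηˡ σ (here {θ = ψ} d) = ⟶ηCl.jj (nsubst-⟶ηˡ σ d) (⟶ηCl.Branches*-refl (nsubstB ψ σ))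
    nsubstB-⟶ηˡ σ (there {x = nothing} d) = ⟶ηCl.nn (nsubstB-⟶ηˡ σ d)
    nsubstB-⟶ηˡ σ (there {x = just x} d) = ⟶ηCl.jj ε (nsubstB-⟶ηˡ σ d)

  nsubst-⟶η*ˡ : ∀ {k l} (σ : Fin k → Tm l) {a a' : Tm k} → Star _⟶η_ a a' → Star _⟶η_ (nsubst a σ) (nsubst a' σ)
  nsubst-⟶η*ˡ σ ε = ε
  nsubst-⟶η*ˡ σ (x ◅ xs) = nsubst-⟶ηˡ σ x ◅◅ nsubst-⟶η*ˡ σ xs

  mutual
    nsubst-⟶η*ʳ : ∀ {k l} {σ σ' : Fin k → Tm l} → (∀ i → Star _⟶η_ (σ i) (σ' i)) → (a : Tm k) → Star _⟶η_ (nsubst a σ) (nsubst a σ')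
    nsubst-⟶η*ʳ e (var i) = e i
    nsubst-⟶η*ʳ e (t · u) = ⟶ηCl.*app (nsubst-⟶η*ʳ e t) (nsubst-⟶η*ʳ e u)
    nsubst-⟶η*ʳ e (lam t) = ⟶ηCl.*lam (nsubst-⟶η*ʳ e' t)
      where e' : ∀ i → Star _⟶η_ (extS _ i) (extS _ i)
            e' zero = ε
            e' (suc i) = ⟶ηCl.Star-ren suc (e i)
    nsubst-⟶η*ʳ e (con c) = ε
    nsubst-⟶η*ʳ {σ = σ} {σ'} e (case θ t) = pushCase-⟶η* (nsubstB θ σ) (nsubst-⟶η*ʳ e t) ◅◅ ⟶ηCl.pushCase-cong* (nsubstB-⟶η*ʳ e θ) (nsubst t σ')

    nsubstB-⟶η*ʳ : ∀ {k l m} {σ σ' : Fin k → Tm l} → (∀ i → Star _⟶η_ (σ i) (σ' i)) → (θ : Branches k m) →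
        ⟶ηCl.Branches* (nsubstB θ σ) (nsubstB θ σ')
    nsubstB-⟶η*ʳ e [] = ⟶ηCl.[]
    nsubstB-⟶η*ʳ e (nothing ∷ θ) = ⟶ηCl.nn (nsubstB-⟶η*ʳ e θ)
    nsubstB-⟶η*ʳ e (just u ∷ θ) = ⟶ηCl.jj (nsubst-⟶η*ʳ e u) (nsubstB-⟶η*ʳ e θ)

  mutual
    Nf-η : ∀ {k} {a b : Tm k} → Nf a → a ⟶η b → Nf b
    Nf-η (nlam (napp x y)) (top (eta {M = M} e)) = Nf-ren⁻ suc M (≡subst Nf e x)
    Nf-η (napp x y) (appL d) = napp (Nf-η x d) y
    Nf-η (napp x y) (appR d) = napp x (Nf-η y d)
    Nf-η (nlam x) (lamC d) = nlam (Nf-η x d)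
    Nf-η (ncase-var x) (caseB d) = ncase-var (NfB-η x d)
    Nf-η (ncase-con x e) (caseB d) = ncase-con (NfB-η x d) (lkη d _ e)
      where lkη : ∀ {k m} {θ θ' : Branches k m} → CompatB Eta θ θ' → (c : Fin m) → lookup θ c ≡ nothing → lookup θ' c ≡ nothing
            lkη (here d) zero ()
            lkη (there d) zero e = e
            lkη (here d) (suc c) e = e
            lkη (there d) (suc c) e = lkη d c e

    NfB-η : ∀ {k m} {a b : Branches k m} → NfB a → CompatB Eta a b → NfB b
    NfB-η (x ∷j n) (here d) = Nf-η x d ∷j n
    NfB-η (cn n) (there d) = cn (NfB-η n d)
    NfB-η (x ∷j n) (there d) = x ∷j NfB-η n d

  nsubst-sub0-var : ∀ {k} (p : Tm (suc k)) → Nf p → nsubst (rename (extR suc) p) (sub0 (var zero)) ≡ p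
  nsubst-sub0-var p n = trans (nsubst-rename (extR suc) (sub0 (var zero)) p) (trans (nsubst-cong pw p) (nf-Nf n))
    where pw : (λ i → sub0 (var zero) (extR suc i)) ≗ var
          pw zero = refl
          pw (suc i) = refl

  mutual
    ⟶η-⇛-commute : ∀ {k} {a b c : Tm k} → Nf a → a ⟶η b → a ⇛ c → Join _⇛_ (Star _⟶η_) b c
    ⟶η-⇛-commute n (top (eta {M = M} e)) (plam (papp dx pvar)) with ⇛-strengthen suc dx M e
    ... | M' , e' , dM = M' , dM , (top (eta e') ◅ ε)
    ⟶η-⇛-commute (nlam (napp (nlam np) nv)) (top (eta {M = M} e)) (plam (pbeta {a' = p'} dp pvar)) with weaken-lam⁻¹ M e
    ... | p0 , refl , ep with ⇛-strengthen (extR suc) dp p0 ep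
    ... | p0' , refl , dp0 = lam p0' , plam dp0 ,
            ≡subst (λ z → Star _⟶η_ (lam z) (lam p0')) (sym (nsubst-sub0-var p0' (Nf-⇛ (Nf-ren⁻ (extR suc) p0 (≡subst Nf ep np)) dp0))) ε
    ⟶η-⇛-commute (napp n1 n2) (appL d1) (papp dc1 dc2) with ⟶η-⇛-commute n1 d1 dc1
    ... | d' , e , s = d' · _ , papp e dc2 , ⟶ηCl.*appL s
    ⟶η-⇛-commute (napp (nlam (napp nx nv)) n2) (appL (top (eta {M = M} e))) (pbeta (papp dx pvar) dq) with ⇛-strengthen suc dx M e
    ... | M' , refl , dM = M' · _ , papp dM dq ,
            ≡subst (λ z → Star _⟶η_ (z · _) (M' · _)) (sym (trans (nsubst-weaken-sub0 M' _) (nf-Nf (Nf-⇛ (Nf-ren⁻ suc M (≡subst Nf e nx)) dM)))) ε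
    ⟶η-⇛-commute (napp (nlam (napp (nlam nq) nv)) n2) (appL (top (eta {M = M} e))) (pbeta (pbeta {a' = q'} dq0 pvar) dq) with weaken-lam⁻¹ M e
    ... | q0 , refl , eq with ⇛-strengthen (extR suc) dq0 q0 eq
    ... | q0' , refl , dq0' = nsubst q0' (sub0 _) , pbeta dq0' dq ,
            ≡subst (λ z → Star _⟶η_ (nsubst z (sub0 _)) (nsubst q0' (sub0 _))) (sym (nsubst-sub0-var q0' (Nf-⇛ (Nf-ren⁻ (extR suc) q0 (≡subst Nf eq nq)) dq0'))) ε
    ⟶η-⇛-commute (napp (nlam np) n2) (appL (lamC dp1)) (pbeta dp dq) with ⟶η-⇛-commute np dp1 dp
    ... | d1 , e1 , s = nsubst d1 (sub0 _) , pbeta e1 dq , nsubst-⟶η*ˡ (sub0 _) s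
    ⟶η-⇛-commute (napp n1 n2) (appR d2) (papp dc1 dc2) with ⟶η-⇛-commute n2 d2 dc2
    ... | d' , e , s = _ · d' , papp dc1 e , ⟶ηCl.*appR s
    ⟶η-⇛-commute (napp n1 n2) (appR d2) (pbeta {a' = p'} dp dq) with ⟶η-⇛-commute n2 d2 dq
    ... | d2' , e2 , s2 = nsubst p' (sub0 d2') , pbeta dp e2 , nsubst-⟶η*ʳ pw p'
      where pw : ∀ i → Star _⟶η_ (sub0 _ i) (sub0 d2' i)
            pw zero = s2
            pw (suc i) = ε
    ⟶η-⇛-commute (nlam n) (lamC d) (plam dc) with ⟶η-⇛-commute n d dc
    ... | d' , e , s = lam d' , plam e , ⟶ηCl.*lam s
    ⟶η-⇛-commute n (caseB dθ) (pcase dθ') with ⟶ηB-⇛B-commute (NfB-case n) dθ dθ'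
    ... | θd , e , s = case θd _ , pcase e , ⟶ηCl.*caseB s

    ⟶ηB-⇛B-commute : ∀ {k m} {a b c : Branches k m} → NfB a → CompatB Eta a b → a ⇛B c →
        Join _⇛B_ (Star (CompatB Eta)) b c
    ⟶ηB-⇛B-commute (nu ∷j n) (here d) (pj du dθ) with ⟶η-⇛-commute nu d du
    ... | ud , e , s = just ud ∷ _ , pj e dθ , ⟶ηCl.*hd s
    ⟶ηB-⇛B-commute (cn n) (there d) (pn dθ) with ⟶ηB-⇛B-commute n d dθ
    ... | θd , e , s = nothing ∷ θd , pn e , ⟶ηCl.*tl s
    ⟶ηB-⇛B-commute (nu ∷j n) (there d) (pj du dθ) with ⟶ηB-⇛B-commute n d dθ
    ... | θd , e , s = just _ ∷ θd , pj du e , ⟶ηCl.*tl s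

  Nf-η* : ∀ {k} {a b : Tm k} → Nf a → Star _⟶η_ a b → Nf b
  Nf-η* n ε = n
  Nf-η* n (x ◅ xs) = Nf-η* (Nf-η n x) xs

  Nf-⇛* : ∀ {k} {a b : Tm k} → Nf a → Star _⇛_ a b → Nf b
  Nf-⇛* n ε = n
  Nf-⇛* n (x ◅ xs) = Nf-⇛* (Nf-⇛ n x) xs

  ⟶η*-⇛-commute : ∀ {k} {a b c : Tm k} → Nf a → Star _⟶η_ a b → a ⇛ c → Join _⇛_ (Star _⟶η_) b c
  ⟶η*-⇛-commute n ε d = _ , d , ε
  ⟶η*-⇛-commute n (x ◅ xs) d with ⟶η-⇛-commute n x d
  ... | d1 , e1 , s1 with ⟶η*-⇛-commute (Nf-η n x) xs e1
  ... | d2 , e2 , s2 = d2 , e2 , s1 ◅◅ s2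

  ⟶η*-⇛*-commute : ∀ {k} {a b c : Tm k} → Nf a → Star _⟶η_ a b → Star _⇛_ a c → Join (Star _⇛_) (Star _⟶η_) b c
  ⟶η*-⇛*-commute n s ε = _ , ε , s
  ⟶η*-⇛*-commute n s (x ◅ xs) with ⟶η*-⇛-commute n s x
  ... | d1 , e1 , s1 with ⟶η*-⇛*-commute (Nf-⇛ n x) s1 xs
  ... | d2 , e2 , s2 = d2 , e1 ◅ e2 , s2

  ⇛*-confluent : ∀ {k} {a b c : Tm k} → Nf a → Star _⇛_ a b → Star _⇛_ a c → Join (Star _⇛_) (Star _⇛_) b c
  ⇛*-confluent {k} = D.confluent
    where module D = DiamondCR {Tm k} Nf _⇛_ Nf-⇛ ⇛-diamond

  ⟶η⁼-diamond : ∀ {k} {a b c : Tm k} → ⊤ → a ⟶η⁼ b → a ⟶η⁼ c → Join _⟶η⁼_ _⟶η⁼_ b c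
  ⟶η⁼-diamond _ (inj₁ refl) q = _ , q , inj₁ refl
  ⟶η⁼-diamond _ (inj₂ p) (inj₁ refl) = _ , inj₁ refl , inj₂ p
  ⟶η⁼-diamond _ (inj₂ p) (inj₂ q) = ⟶η-diamond p q

  ⟶η*⇒⟶η⁼* : ∀ {k} {a b : Tm k} → Star _⟶η_ a b → Star _⟶η⁼_ a b
  ⟶η*⇒⟶η⁼* = Star.map inj₂

  ⟶η⁼*⇒⟶η* : ∀ {k} {a b : Tm k} → Star _⟶η⁼_ a b → Star _⟶η_ a b
  ⟶η⁼*⇒⟶η* ε = ε
  ⟶η⁼*⇒⟶η* (inj₁ refl ◅ xs) = ⟶η⁼*⇒⟶η* xs
  ⟶η⁼*⇒⟶η* (inj₂ x ◅ xs) = x ◅ ⟶η⁼*⇒⟶η* xs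

  ⟶η*-confluent : ∀ {k} {a b c : Tm k} → Star _⟶η_ a b → Star _⟶η_ a c → Join (Star _⟶η_) (Star _⟶η_) b c
  ⟶η*-confluent {k} s1 s2 with D.confluent tt (⟶η*⇒⟶η⁼* s1) (⟶η*⇒⟶η⁼* s2)
    where module D = DiamondCR {Tm k} (λ _ → ⊤) _⟶η⁼_ (λ _ _ → tt) ⟶η⁼-diamond
  ... | d , p , q = d , ⟶η⁼*⇒⟶η* p , ⟶η⁼*⇒⟶η* q

  _⇛*⊎⟶η*_ : ∀ {k} → Tm k → Tm k → Set
  _⇛*⊎⟶η*_ a b = Star _⇛_ a b ⊎ Star _⟶η_ a b

  Nf-⇛*⊎⟶η* : ∀ {k} {a b : Tm k} → Nf a → _⇛*⊎⟶η*_ a b → Nf b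
  Nf-⇛*⊎⟶η* n (inj₁ x) = Nf-⇛* n x
  Nf-⇛*⊎⟶η* n (inj₂ x) = Nf-η* n x

  ⇛*⊎⟶η*-diamond : ∀ {k} {a b c : Tm k} → Nf a → _⇛*⊎⟶η*_ a b → _⇛*⊎⟶η*_ a c → Join _⇛*⊎⟶η*_ _⇛*⊎⟶η*_ b c
  ⇛*⊎⟶η*-diamond n (inj₁ p) (inj₁ q) with ⇛*-confluent n p q
  ... | d , x , y = d , inj₁ x , inj₁ y
  ⇛*⊎⟶η*-diamond n (inj₂ p) (inj₂ q) with ⟶η*-confluent p q
  ... | d , x , y = d , inj₂ x , inj₂ y
  ⇛*⊎⟶η*-diamond n (inj₁ p) (inj₂ q) with ⟶η*-⇛*-commute n q p
  ... | d , x , y = d , inj₂ y , inj₁ x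
  ⇛*⊎⟶η*-diamond n (inj₂ p) (inj₁ q) with ⟶η*-⇛*-commute n p q
  ... | d , x , y = d , inj₁ x , inj₂ y

  mutual
    ⟶βη-split : ∀ {k} {a b : Tm k} → a ⟶βη b → (a ⟶β b) ⊎ (a ⟶η b)
    ⟶βη-split (top (β-step x)) = inj₁ (top x)
    ⟶βη-split (top (η-step x)) = inj₂ (top x)
    ⟶βη-split (appL d) with ⟶βη-split d
    ... | inj₁ e = inj₁ (appL e)
    ... | inj₂ e = inj₂ (appL e)
    ⟶βη-split (appR d) with ⟶βη-split d
    ... | inj₁ e = inj₁ (appR e)
    ... | inj₂ e = inj₂ (appR e)
    ⟶βη-split (lamC d) with ⟶βη-split d
    ... | inj₁ e = inj₁ (lamC e)
    ... | inj₂ e = inj₂ (lamC e)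
    ⟶βη-split (caseB d) with ⟶βηB-split d
    ... | inj₁ e = inj₁ (caseB e)
    ... | inj₂ e = inj₂ (caseB e)

    ⟶βηB-split : ∀ {k m} {a b : Branches k m} → CompatB BetaEta a b → (CompatB Beta a b) ⊎ (CompatB Eta a b)
    ⟶βηB-split (here d) with ⟶βη-split d
    ... | inj₁ e = inj₁ (here e)
    ... | inj₂ e = inj₂ (here e)
    ⟶βηB-split (there d) with ⟶βηB-split d
    ... | inj₁ e = inj₁ (there e)
    ... | inj₂ e = inj₂ (there e)

  ⟶βη*⇒⇛*⊎⟶η** : ∀ {k} {a b : Tm k} → Star _⟶βη_ a b → Star _⇛*⊎⟶η*_ a b
  ⟶βη*⇒⇛*⊎⟶η** ε = ε
  ⟶βη*⇒⇛*⊎⟶η** (x ◅ xs) with ⟶βη-split x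
  ... | inj₁ e = inj₁ (β→⇛ e ◅ ε) ◅ ⟶βη*⇒⇛*⊎⟶η** xs
  ... | inj₂ e = inj₂ (e ◅ ε) ◅ ⟶βη*⇒⇛*⊎⟶η** xs

  ⇛*⊎⟶η**⇒⟶βη* : ∀ {k} {a b : Tm k} → Star _⇛*⊎⟶η*_ a b → Star _⟶βη_ a b
  ⇛*⊎⟶η**⇒⟶βη* ε = ε
  ⇛*⊎⟶η**⇒⟶βη* (inj₁ x ◅ xs) = Compat*-map β-step (⇛*→β* x) ◅◅ ⇛*⊎⟶η**⇒⟶βη* xs
    where ⇛*→β* : ∀ {k} {a b : Tm k} → Star _⇛_ a b → Star _⟶β_ a b
          ⇛*→β* ε = ε
          ⇛*→β* (y ◅ ys) = ⇛→β* y ◅◅ ⇛*→β* ys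
  ⇛*⊎⟶η**⇒⟶βη* (inj₂ x ◅ xs) = Compat*-map η-step x ◅◅ ⇛*⊎⟶η**⇒⟶βη* xs

  ⟶βη*-confluent : ∀ {k} {a b c : Tm k} → Nf a → Star _⟶βη_ a b → Star _⟶βη_ a c → Join (Star _⟶βη_) (Star _⟶βη_) b c
  ⟶βη*-confluent {k} n s1 s2 with D.confluent n (⟶βη*⇒⇛*⊎⟶η** s1) (⟶βη*⇒⇛*⊎⟶η** s2)
    where module D = DiamondCR {Tm k} Nf _⇛*⊎⟶η*_ Nf-⇛*⊎⟶η* ⇛*⊎⟶η*-diamond
  ... | d , p , q = d , ⇛*⊎⟶η**⇒⟶βη* p , ⇛*⊎⟶η**⇒⟶βη* q

  ≡βη-join : ∀ {k} {a b : Tm k} → a ≡βη b → Join (Star _⟶βη_) (Star _⟶βη_) (nf a) (nf b)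
  ≡βη-join ε = _ , ε , ε
  ≡βη-join (_◅_ {j = j} x xs) with Compat±-split x | ≡βη-join xs
  ... | inj₁ e | d1 , s1 , s2 = d1 , nsubst-⟶βη NfS-var e ◅◅ s1 , s2
  ... | inj₂ e | d1 , s1 , s2 with ⟶βη*-confluent (Nf-nf j) (nsubst-⟶βη NfS-var e) s1
  ... | d , p , q = d , p , s2 ◅◅ q

  -- The syntactic cartesian closed category

  -- A morphism A ⇒ B is a B-tuple of terms in a context of length A; the
  -- product A × B is the context B + A, and every exponential B ^ A is B since
  -- a morphism into it is currified by λ-abstraction.
  Hom : ℕ → ℕ → Set
  Hom A B = Fin B → Tm A

  _≈h_ : ∀ {A B} → Hom A B → Hom A B → Set
  f ≈h g = ∀ j → nf (f j) ≡βη nf (g j)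

  idh : ∀ {A} → Hom A A
  idh = var

  _⨾h_ : ∀ {A B C} → Hom A B → Hom B C → Hom A C
  (f ⨾h g) j = nsubst (g j) f

  ≡→≈ : ∀ {A B} {f g : Hom A B} → (∀ j → f j ≡ g j) → f ≈h g
  ≡→≈ e j rewrite e j = ε

  π₁h : ∀ {A B} → Hom (A ×o B) A
  π₁h {A} {B} j = var (B ↑ʳ j)

  π₂h : ∀ {A B} → Hom (A ×o B) B
  π₂h {A} {B} i = var (i ↑ˡ A)

  ⟨_,_⟩h : ∀ {C A B} → Hom C A → Hom C B → Hom C (A ×o B)
  ⟨_,_⟩h {C} {A} {B} f g = copair B g f

  lams : ∀ A {C} → Tm (A + C) → Tm C
  lams zero t = t
  lams (suc A) t = lams A (lam t)

  apps : ∀ {X} (n : ℕ) → (Fin n → Tm X) → Tm X → Tm X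
  apps zero a h = h
  apps (suc n) a h = apps n (a ∘ suc) h · a zero

  evh : ∀ {A B} → Hom ((B) ×o A) B
  evh {A} {B} j = apps A (λ i → var (i ↑ˡ B)) (var (A ↑ʳ j))

  Λh : ∀ {C A B} → Hom (C ×o A) B → Hom C B
  Λh {C} {A} {B} f j = lams A (f j)

  liftN : ∀ A {C D} → (Fin C → Tm D) → Fin (A + C) → Tm (A + D)
  liftN zero σ = σ
  liftN (suc A) σ = extS (liftN A σ)

  nsubst-lams : ∀ A {C D} (t : Tm (A + C)) (σ : Fin C → Tm D) → nsubst (lams A t) σ ≡ lams A (nsubst t (liftN A σ))
  nsubst-lams zero t σ = refl
  nsubst-lams (suc A) t σ = nsubst-lams A (lam t) σ

  nsubst-apps : ∀ {X Y} (n : ℕ) (a : Fin n → Tm X) (h : Tm X) (σ : Fin X → Tm Y) →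
      nsubst (apps n a h) σ ≡ apps n (λ i → nsubst (a i) σ) (nsubst h σ)
  nsubst-apps zero a h σ = refl
  nsubst-apps (suc n) a h σ = cong (_· nsubst (a zero) σ) (nsubst-apps n (a ∘ suc) h σ)

  rename-apps : ∀ {X Y} (n : ℕ) (a : Fin n → Tm X) (h : Tm X) (ρ : Ren X Y) →
      rename ρ (apps n a h) ≡ apps n (λ i → rename ρ (a i)) (rename ρ h)
  rename-apps zero a h ρ = refl
  rename-apps (suc n) a h ρ = cong (_· rename ρ (a zero)) (rename-apps n (a ∘ suc) h ρ)

  apps-cong : ∀ {X} (n : ℕ) {a a' : Fin n → Tm X} (h : Tm X) → (∀ i → a i ≡ a' i) → apps n a h ≡ apps n a' h
  apps-cong zero h e = refl
  apps-cong (suc n) h e = cong₂ _·_ (apps-cong n h (λ i → e (suc i))) (e zero)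

  liftN-↑ˡ : ∀ A {C D} (σ : Fin C → Tm D) (i : Fin A) → liftN A σ (i ↑ˡ C) ≡ var (i ↑ˡ D)
  liftN-↑ˡ (suc A) σ zero = refl
  liftN-↑ˡ (suc A) σ (suc i) = cong weaken (liftN-↑ˡ A σ i)

  liftN-↑ʳ : ∀ A {C D} (σ : Fin C → Tm D) (c : Fin C) → liftN A σ (A ↑ʳ c) ≡ rename (A ↑ʳ_) (σ c)
  liftN-↑ʳ zero σ c = sym (rename-id (σ c))
  liftN-↑ʳ (suc A) σ c = trans (cong weaken (liftN-↑ʳ A σ c)) (rename-∘ suc (A ↑ʳ_) (σ c))

  liftN-var : ∀ A {C} → liftN A {C} var ≗ var
  liftN-var zero x = refl
  liftN-var (suc A) zero = refl
  liftN-var (suc A) (suc x) = cong weaken (liftN-var A x)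

  nf-lams : ∀ A {C} (t : Tm (A + C)) → nf (lams A t) ≡ lams A (nf t)
  nf-lams A t = trans (nsubst-lams A t var) (cong (lams A) (nsubst-cong (liftN-var A) t))

  nf-apps : ∀ {X} (n : ℕ) (a : Fin n → Tm X) (h : Tm X) → nf (apps n a h) ≡ apps n (λ i → nf (a i)) (nf h)
  nf-apps n a h = nsubst-apps n a h var

  *lams : ∀ {R : TmRel} A {C} {a b : Tm (A + C)} → Star (Compat R) a b → Star (Compat R) (lams A a) (lams A b)
  *lams zero s = s
  *lams {R} (suc A) s = *lams {R} A (Star.gmap lam lamC s)

  NfS-copair : ∀ A {X} (a : Fin A → Tm X) → NfS a → NfS (copair A {X} a var)
  NfS-copair zero a n x = nvar
  NfS-copair (suc A) a n zero = n zero
  NfS-copair (suc A) a n (suc x) = NfS-copair A (a ∘ suc) (λ i → n (suc i)) x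

  nf-lam : ∀ {k} (t : Tm (suc k)) → nf (lam t) ≡ lam (nf t)
  nf-lam t = cong lam (nsubst-cong (λ { zero → refl ; (suc i) → refl }) t)

  apps-lams-⟶βη* : ∀ A {X} (a : Fin A → Tm X) → NfS a → (t : Tm (A + X)) → Star _⟶βη_ (apps A a (lams A (nf t))) (nsubst t (copair A a var))
  apps-lams-⟶βη* zero a n t = ε
  apps-lams-⟶βη* (suc A) a n t =
    ≡subst (λ z → Star _⟶βη_ (apps A (a ∘ suc) (lams A z) · a zero) (nsubst t (copair (suc A) a var))) (nf-lam t)
      (⟶βηCl.*appL (apps-lams-⟶βη* A (a ∘ suc) (λ i → n (suc i)) (lam t)) ◅◅
       ≡subst (λ z → Star _⟶βη_ (lam (nsubst t (extS τ)) · a zero) z) eq (top (β-step beta) ◅ ε))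
    where τ = copair A (a ∘ suc) var
          pw : (λ x → nsubst (extS τ x) (sub0 (a zero))) ≗ copair (suc A) a var
          pw zero = refl
          pw (suc y) = trans (nsubst-weaken-sub0 (τ y) (a zero)) (nf-Nf (NfS-copair A (a ∘ suc) (λ i → n (suc i)) y))
          eq : nsubst (nsubst t (extS τ)) (sub0 (a zero)) ≡ nsubst t (copair (suc A) a var)
          eq = trans (nsubst-∘ (extS τ) (sub0 (a zero)) t) (nsubst-cong pw t)

  leadingVars : ∀ A C → Fin A → Tm (A + C)
  leadingVars A C i = var (i ↑ˡ C)

  lams-apps-⟶βη* : ∀ A {C} (h : Tm C) → Star _⟶βη_ (lams A (apps A (leadingVars A C) (rename (A ↑ʳ_) h))) h
  lams-apps-⟶βη* zero h = ≡subst (λ z → Star _⟶βη_ z h) (sym (rename-id h)) ε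
  lams-apps-⟶βη* (suc A) {C} h = *lams {BetaEta} A (top (η-step (eta eq)) ◅ ε) ◅◅ lams-apps-⟶βη* A h
    where eq : apps A (λ i → var (suc (i ↑ˡ C))) (rename (suc A ↑ʳ_) h) ≡ weaken (apps A (leadingVars A C) (rename (A ↑ʳ_) h))
          eq = sym (trans (rename-apps A (leadingVars A C) (rename (A ↑ʳ_) h) suc) (cong (apps A (λ i → var (suc (i ↑ˡ C)))) (rename-∘ suc (A ↑ʳ_) h)))

  Nf-apps : ∀ {X} (n : ℕ) (a : Fin n → Tm X) (h : Tm X) → NfS a → Nf h → Nf (apps n a h)
  Nf-apps zero a h na nh = nh
  Nf-apps (suc n) a h na nh = napp (Nf-apps n (a ∘ suc) h (λ i → na (suc i)) nh) (na zero)

  nf-nsubst : ∀ {k l} (t : Tm k) (σ : Fin k → Tm l) → nf (nsubst t σ) ≡ nsubst (nf t) (λ i → nf (σ i))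
  nf-nsubst t σ = trans (nsubst-∘ σ var t) (sym (nsubst-∘ var (λ i → nf (σ i)) t))

  nf-idem : ∀ {k} (t : Tm k) → nf (nf t) ≡ nf t
  nf-idem t = nsubst-∘ var var t

  nsubst-var∘ : ∀ {k l} (ρ : Ren k l) (t : Tm k) → nsubst t (λ i → var (ρ i)) ≡ rename ρ (nf t)
  nsubst-var∘ ρ t = sym (rename-nsubst ρ var t)

  ≡⇒≡βη : ∀ {k} {a b : Tm k} → a ≡ b → a ≡βη b
  ≡⇒≡βη refl = ε

  ≈h-equiv : ∀ {A B} → IsEquivalence (_≈h_ {A} {B})
  ≈h-equiv = record { refl = λ j → ε ; sym = λ e j → ≡βη-sym (e j) ; trans = λ e e' j → e j ◅◅ e' j }

  NfS-nf : ∀ {k l} (σ : Fin k → Tm l) → NfS (λ i → nf (σ i))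
  NfS-nf σ i = Nf-nf (σ i)

  ⨾h-cong : ∀ {A B C} {f f' : Hom A B} {g g' : Hom B C} → f ≈h f' → g ≈h g' → (f ⨾h g) ≈h (f' ⨾h g')
  ⨾h-cong {f = f} {f'} {g} {g'} ef eg j =
    ≡⇒≡βη (nf-nsubst (g j) f) ◅◅ nsubst-≡βηˡ (NfS-nf f) (eg j) ◅◅ nsubst-≡βηʳ (NfS-nf f) (NfS-nf f') ef (nf (g' j)) ◅◅ ≡⇒≡βη (sym (nf-nsubst (g' j) f'))

  !h : ∀ {A} → Hom A 0
  !h ()

  Λh-β : ∀ {C A B} {f : Hom (C ×o A) B} →
         (⟨_,_⟩h {C = C ×o A} {A = B} {B = A} (π₁h {A = C} {B = A} ⨾h Λh {C = C} {A = A} {B = B} f) (π₂h {A = C} {B = A} ⨾h idh) ⨾h evh {A = A} {B = B}) ≈h f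
  Λh-β {C} {A} {B} {f} j =
    ≡⇒≡βη (trans (cong nf eqL) eqnf) ◅◅ ⟶βη*⇒≡βη (apps-lams-⟶βη* A (leadingVars A C) (λ _ → nvar) X) ◅◅ ≡⇒≡βη eqfin
    where
      σ : Hom (C ×o A) (B ×o A)
      σ = ⟨ π₁h {A = C} {B = A} ⨾h Λh {C = C} {A = A} {B = B} f , π₂h {A = C} {B = A} ⨾h idh ⟩h
      X = nsubst (f j) (liftN A (π₁h {A = C} {B = A}))
      eqL : nsubst (evh j) σ ≡ apps A (leadingVars A C) (lams A X)
      eqL = trans (nsubst-apps A _ _ σ) (trans (apps-cong A _ (λ i → copair-↑ˡ A _ _ i))
                   (cong (apps A (leadingVars A C)) (trans (copair-↑ʳ A _ _ j) (nsubst-lams A (f j) (π₁h {A = C} {B = A})))))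
      eqnf : nf (apps A (leadingVars A C) (lams A X)) ≡ apps A (leadingVars A C) (lams A (nf X))
      eqnf = trans (nf-apps A _ _) (cong (apps A (leadingVars A C)) (nf-lams A X))
      τ : Fin (A + (A + C)) → Tm (A + C)
      τ = copair A (leadingVars A C) var
      π1 : Fin C → Tm (A + C)
      π1 = π₁h {A = C} {B = A}
      pw : (λ (x : Fin (A + C)) → nsubst (liftN A π1 x) τ) ≗ var
      pw x with splitView A x
      ... | left i = trans (cong (λ z → nsubst z τ) (liftN-↑ˡ A π1 i)) (copair-↑ˡ A (leadingVars A C) var i)
      ... | right c = trans (cong (λ z → nsubst z τ) (liftN-↑ʳ A π1 c)) (copair-↑ʳ A (leadingVars A C) var (A ↑ʳ c))
      eqfin : nsubst X (copair A (leadingVars A C) var) ≡ nf (f j)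
      eqfin = trans (nsubst-∘ (liftN A (π₁h {A = C} {B = A})) _ (f j)) (nsubst-cong pw (f j))

  Λh-unique : ∀ {C A B} {f : Hom (C ×o A) B} {h : Hom C B} →
         (⟨_,_⟩h {C = C ×o A} {A = B} {B = A} (π₁h {A = C} {B = A} ⨾h h) (π₂h {A = C} {B = A} ⨾h idh) ⨾h evh {A = A} {B = B}) ≈h f → h ≈h Λh {C = C} {A = A} {B = B} f
  Λh-unique {C} {A} {B} {f} {h} e j =
    ≡βη-sym (⟶βη*⇒≡βη (lams-apps-⟶βη* A (nf (h j)))) ◅◅ ≡⇒≡βη (cong (lams A) (trans (sym (nf-Nf nX)) (cong nf (sym eqX))))
      ◅◅ *lams {R = BetaEta±} A (e j) ◅◅ ≡⇒≡βη (sym (nf-lams A (f j)))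
    where
      σ : Hom (C ×o A) (B ×o A)
      σ = ⟨ π₁h {A = C} {B = A} ⨾h h , π₂h {A = C} {B = A} ⨾h idh ⟩h
      X = apps A (leadingVars A C) (rename (A ↑ʳ_) (nf (h j)))
      eqX : nsubst (evh j) σ ≡ X
      eqX = trans (nsubst-apps A _ _ σ) (trans (apps-cong A _ (λ i → copair-↑ˡ A _ _ i))
                   (cong (apps A (leadingVars A C)) (trans (copair-↑ʳ A _ _ j) (nsubst-var∘ (A ↑ʳ_) (h j)))))
      nX : Nf X
      nX = Nf-apps A _ _ (λ _ → nvar) (Nf-ren (A ↑ʳ_) (Nf-nf (h j)))

  ⟨⟩h-unique : ∀ {C A B} {f : Hom C A} {g : Hom C B} {h : Hom C (A ×o B)} →
               (h ⨾h π₁h {A = A} {B = B}) ≈h f → (h ⨾h π₂h {A = A} {B = B}) ≈h g → h ≈h ⟨_,_⟩h {C = C} {A = A} {B = B} f g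
  ⟨⟩h-unique {C} {A} {B} {f} {g} {h} e1 e2 x with splitView B x
  ... | left i = e2 i ◅◅ ≡⇒≡βη (cong nf (sym (copair-↑ˡ B g f i)))
  ... | right j = e1 j ◅◅ ≡⇒≡βη (cong nf (sym (copair-↑ʳ B g f j)))

  termCCC : CCC 0ℓ 0ℓ 0ℓ
  termCCC = record
    { Obj = ℕ
    ; _⇒_ = Hom
    ; _≈_ = _≈h_
    ; ≈-equiv = ≈h-equiv
    ; id = idh
    ; _⨾_ = _⨾h_
    ; ⨾-cong = λ {A} {B} {C} {f} {f'} {g} {g'} → ⨾h-cong {f = f} {f'} {g} {g'}
    ; assoc = λ {A} {B} {C} {E} {f} {g} {h} → ≡→≈ (λ j → sym (nsubst-∘ g f (h j)))
    ; idˡ = λ {A} {B} {f} j → ≡⇒≡βη (nf-idem (f j))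
    ; idʳ = λ j → ε
    ; 𝟙 = 0
    ; ! = !h
    ; !-unique = λ f ()
    ; _×_ = _×o_
    ; π₁ = π₁h
    ; π₂ = π₂h
    ; ⟨_,_⟩ = ⟨_,_⟩h
    ; π₁-β = λ {C} {A} {B} {f} {g} → ≡→≈ (λ j → copair-↑ʳ B g f j)
    ; π₂-β = λ {C} {A} {B} {f} {g} → ≡→≈ (λ j → copair-↑ˡ B g f j)
    ; ⟨⟩-unique = λ {C} {A} {B} {f} {g} {h} → ⟨⟩h-unique {f = f} {g} {h}
    ; _^_ = λ B A → B
    ; ev = evh
    ; Λ = Λh
    ; Λ-β = λ {C} {A} {B} {f} → Λh-β {C} {A} {B} {f}
    ; Λ-unique = λ {C} {A} {B} {f} {h} → Λh-unique {C} {A} {B} {f} {h}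
    }

  module C = CCC termCCC

  Pn : ℕ
  Pn = C.Pow 1 nc

  toPow : ∀ {k} → Fin k → Fin (C.Pow 1 k)
  toPow zero = zero
  toPow (suc i) = suc (toPow i)

  fromPow : ∀ {k} → Fin (C.Pow 1 k) → Fin k
  fromPow {suc k} zero = zero
  fromPow {suc k} (suc i) = suc (fromPow i)

  fromPow-toPow : ∀ {k} (i : Fin k) → fromPow (toPow i) ≡ i
  fromPow-toPow zero = refl
  fromPow-toPow (suc i) = cong suc (fromPow-toPow i)

  θvars : Binding nc (Tm (suc Pn))
  θvars = tabulate (λ c → just (var (suc (toPow c))))

  lookup-nsubstB-θvars : ∀ {l} (σ : Fin (suc Pn) → Tm l) (c : Fin nc) → lookup (nsubstB θvars σ) c ≡ just (σ (suc (toPow c)))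
  lookup-nsubstB-θvars σ c = trans (lookup-nsubstB θvars σ c) (cong (Data.Maybe.map (λ u → nsubst u σ)) (lookup∘tabulate _ c))

  nsubstB-θvars : ∀ {l} (σ : Fin (suc Pn) → Tm l) → nsubstB θvars σ ≡ tabulate (λ c → just (σ (suc (toPow c))))
  nsubstB-θvars σ = lookup-ext (λ c → trans (lookup-nsubstB-θvars σ c) (sym (lookup∘tabulate _ c)))

  -- case is {c ↦ xᶜ}·x, the xᶜ being the components of Dⁿ.
  caseTm : Hom (Pn ×o 1) 1
  caseTm _ = case θvars (var zero)

  proj-toPow : ∀ {k} (i : Fin k) → C.proj {1} {k} i zero ≡ var (toPow i)
  proj-toPow zero = refl
  proj-toPow {suc k} (suc i) = cong (λ z → nsubst z (π₁h {A = C.Pow 1 k} {B = 1})) (proj-toPow i)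

  pushCase-con : ∀ {k} (θ : Binding nc (Tm k)) c {u} → lookup θ c ≡ just u → pushCase θ (con c) ≡ u
  pushCase-con θ c e rewrite e = refl

  pointwise⇒≈h : ∀ {A B} (f g : Hom A B) → (∀ j → f j ≡ g j) → _≈h_ f g
  pointwise⇒≈h f g e j rewrite e j = ε

  module TermModel (F : ∀ {k} → Tm k) (F-S : ∀ {k l} (σ : Fin k → Tm l) → nsubst F σ ≡ F)
                (F-push : ∀ {k} (θ : Binding nc (Tm k)) → pushCase θ F ≡ F) where

    D2 : ∀ i → C._≈_ (C.⟨ C.id , C.! ⟩ C.⨾ (C.id C.⊗ (λ (_ : Fin 1) → con {k = 0} i)) C.⨾ caseTm) (C.proj {1} {nc} i)
    D2 i = pointwise⇒≈h (C.⟨ C.id , C.! ⟩ C.⨾ σ C.⨾ caseTm) (C.proj {1} {nc} i) λ { zero →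
             trans (cong (λ z → nsubst z C.⟨ C.id , C.! ⟩) (pushCase-con (nsubstB θvars σ) i (lookup-nsubstB-θvars σ i)))
                   (sym (proj-toPow i)) }
      where σ = C.id C.⊗ (λ (_ : Fin 1) → con {k = 0} i)

    D6 : C._≈_ {Pn C.× C.𝟙} ((C.id C.⊗ (λ (_ : Fin 1) → F {0})) C.⨾ caseTm) (C.π₂ C.⨾ (λ (_ : Fin 1) → F {0}))
    D6 = pointwise⇒≈h ((C.id C.⊗ Fₕ) C.⨾ caseTm) (C.π₂ C.⨾ Fₕ) λ { zero →
           trans (cong (pushCase _) (F-S _)) (trans (F-push _) (sym (F-S _))) }
      where Fₕ = λ (_ : Fin 1) → F {0}

    PP1 : ℕ
    PP1 = (Pn C.× 1) C.× 1

    X3 : Tm PP1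
    X3 = case (tabulate (λ c → just (var (suc (suc (toPow c)))))) (var (suc zero)) · var zero

    D3L : Hom PP1 1
    D3L = (caseTm C.⊗ C.id {1}) C.⨾ (C.id {1} C.⊗ C.id {1}) C.⨾ C.ev {1} {1}

    D3R : Hom PP1 1
    D3R = C.α {Pn} {1} {1} C.⨾ (C.id {Pn} C.⊗ (C.id {1} C.⊗ C.id {1})) C.⨾ (C.id {Pn} C.⊗ C.ev {1} {1}) C.⨾ caseTm

    eq3L : D3L zero ≡ X3
    eq3L = cong (λ z → case z (var (suc zero)) · var zero) (nsubstB-θvars _)

    eq3R : D3R zero ≡ X3
    eq3R = cong (λ z → case z (var (suc zero)) · var zero) (trans (nsubstB-∘ _ _ _) (trans (nsubstB-∘ _ _ θvars) (nsubstB-θvars _)))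

    D4L : Hom (Pn C.× 1) 1
    D4L = C.Λ {Pn C.× 1} {1} {1} (C.α {Pn} {1} {1} C.⨾ (C.id {Pn} C.⊗ C.ev {1} {1}) C.⨾ caseTm) C.⨾ C.id {1}

    D4R : Hom (Pn C.× 1) 1
    D4R = (C.id {Pn} C.⊗ C.id {1}) C.⨾ caseTm

    Y4 : Tm (Pn C.× 1)
    Y4 = case (tabulate (λ c → just (var (suc (toPow c))))) (var zero)

    eq4L : D4L zero ≡ lam X3
    eq4L = cong (λ z → lam (case z (var (suc zero)) · var zero)) (trans (nsubstB-∘ _ _ θvars) (nsubstB-θvars _))

    eq4R : D4R zero ≡ Y4
    eq4R = cong (λ z → case z (var zero)) (nsubstB-θvars _)

    tab1 : Binding nc (Tm (Pn C.× 1))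
    tab1 = tabulate (λ c → just (var (suc (toPow c))))

    tab2 : Binding nc (Tm (suc (Pn C.× 1)))
    tab2 = tabulate (λ c → just (var (suc (suc (toPow c)))))

    wk-tab : weakenB tab1 ≡ tab2
    wk-tab = lookup-ext (λ c → trans (lookup-renameB suc tab1 c) (trans (cong (Data.Maybe.map weaken) (lookup∘tabulate (λ c → just (var {nc = nc} {k = Pn C.× 1} (suc (toPow c))))  c))
                 (sym (lookup∘tabulate (λ c → just (var {nc = nc} {k = suc (Pn C.× 1)} (suc (suc (toPow c))))) c))))

    step4 : lam X3 ⟶βη Y4
    step4 = top (η-step (eta (cong (λ z → case z (var (suc zero))) (sym wk-tab))))

    D4 : _≈h_ D4L D4R
    D4 zero = ≡⇒≡βη (cong nf eq4L) ◅◅ ⟶βη*⇒≡βη (nsubst-⟶βη NfS-var step4) ◅◅ ≡⇒≡βη (cong nf (sym eq4R))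

    PP5 : ℕ
    PP5 = (Pn C.× Pn) C.× 1

    fcomp : Fin nc → Hom (Pn C.× Pn) 1
    fcomp i = (C.id {Pn} C.⊗ C.proj {1} {nc} i) C.⨾ caseTm

    compM : Hom (Pn C.× Pn) Pn
    compM = C.tuple {Pn C.× Pn} {1} {nc} fcomp

    D5L : Hom PP5 1
    D5L = (compM C.⊗ C.id {1}) C.⨾ caseTm

    D5R : Hom PP5 1
    D5R = C.α {Pn} {Pn} {1} C.⨾ (C.id {Pn} C.⊗ caseTm) C.⨾ caseTm

    tabB : Binding nc (Tm PP5)
    tabB = tabulate (λ d → just (var (suc (Pn ↑ʳ toPow {nc} d))))

    inner : Fin nc → Tm PP5
    inner c = case tabB (var (suc (toPow {nc} c ↑ˡ Pn)))

    X5 : Tm PP5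
    X5 = case (tabulate (λ c → just (inner c))) (var zero)

    nsubstB-tabulate : ∀ {k l m} (f : Fin m → Maybe (Tm k)) (σ : Fin k → Tm l) →
        nsubstB (tabulate f) σ ≡ tabulate (λ c → Data.Maybe.map (λ u → nsubst u σ) (f c))
    nsubstB-tabulate f σ = lookup-ext (λ c → trans (lookup-nsubstB (tabulate f) σ c) (trans (cong (Data.Maybe.map (λ u → nsubst u σ)) (lookup∘tabulate f c)) (sym (lookup∘tabulate _ c))))

    tuple-toPow : ∀ {X k} (f : Fin k → Hom X 1) (c : Fin k) → C.tuple {X} {1} {k} f (toPow c) ≡ f c zero
    tuple-toPow f zero = refl
    tuple-toPow f (suc c) = tuple-toPow (λ i → f (suc i)) c

    tabA : Binding nc (Tm (Pn C.× Pn))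
    tabA = tabulate (λ d → just (var (Pn ↑ʳ toPow {nc} d)))

    compM-toPow : ∀ c → compM (toPow {nc} c) ≡ case tabA (var (toPow {nc} c ↑ˡ Pn))
    compM-toPow c = trans (tuple-toPow _ c) (cong₂ pushCase (nsubstB-θvars _) (cong (λ z → nsubst z (π₂h {A = Pn} {B = Pn})) (proj-toPow c)))

    compM-toPow-π₁ : ∀ c → nsubst (compM (toPow {nc} c)) (π₁h {A = Pn C.× Pn} {B = 1}) ≡ inner c
    compM-toPow-π₁ c = trans (cong (λ z → nsubst z (π₁h {A = Pn C.× Pn} {B = 1})) (compM-toPow c)) (cong (λ z → case z (var (suc (toPow {nc} c ↑ˡ Pn)))) (nsubstB-tabulate _ _))

    eq5L : D5L zero ≡ X5
    eq5L = cong (λ z → case z (var zero)) (trans (nsubstB-θvars _) (lookup-ext (λ c → trans (lookup∘tabulate _ c)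
              (trans (cong just (compM-toPow-π₁ c)) (sym (lookup∘tabulate _ c))))))

    αL : ∀ c → C.α {Pn} {Pn} {1} (suc (toPow {nc} c ↑ˡ Pn)) ≡ var (suc (toPow {nc} c ↑ˡ Pn))
    αL c = copair-↑ˡ Pn _ _ (toPow {nc} c)

    αR : ∀ d → C.α {Pn} {Pn} {1} (suc (Pn ↑ʳ toPow {nc} d)) ≡ var (suc (Pn ↑ʳ toPow {nc} d))
    αR d = copair-↑ʳ Pn _ _ (toPow {nc} d)

    θ1 : Binding nc (Tm (Pn C.× (Pn C.× 1)))
    θ1 = nsubstB θvars ((C.id {Pn} C.⊗ caseTm))

    θ1α : nsubstB θ1 (C.α {Pn} {Pn} {1}) ≡ tabB
    θ1α = trans (nsubstB-∘ _ _ θvars) (trans (nsubstB-θvars _) (lookup-ext (λ d → trans (lookup∘tabulate _ d)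
            (trans (cong just (αR d)) (sym (lookup∘tabulate _ d))))))

    ψ5 : Binding nc (Tm (Pn C.× (Pn C.× 1)))
    ψ5 = nsubstB θvars (π₂h {A = Pn} {B = Pn C.× 1})

    eq5R : D5R zero ≡ X5
    eq5R = cong (λ z → case z (var zero)) (lookup-ext pw)
      where α = C.α {Pn} {Pn} {1}
            pw : ∀ c → lookup (nsubstB (pushCaseB θ1 ψ5) α) c ≡ lookup (tabulate (λ c → just (inner c))) c
            pw c = trans (lookup-nsubstB (pushCaseB θ1 ψ5) α c)
                  (trans (cong (Data.Maybe.map (λ u → nsubst u α))
                               (trans (lookup-pushCaseB θ1 ψ5 c)
                                      (cong (Data.Maybe.map (pushCase θ1)) (lookup-nsubstB-θvars (π₂h {A = Pn} {B = Pn C.× 1}) c))))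
                  (trans (cong (λ z → just (pushCase (nsubstB θ1 α) z)) (αL c))
                  (trans (cong (λ z → just (case z (var (suc (toPow {nc} c ↑ˡ Pn))))) θ1α)
                         (sym (lookup∘tabulate (λ c → just (inner c)) c)))))

    model : Model 0ℓ 0ℓ 0ℓ nc
    model = record
      { cat = termCCC
      ; D = 1
      ; app = C.id
      ; lamM = C.id
      ; cbar = λ c _ → con c
      ; fail = λ _ → F {0}
      ; caseM = caseTm
      ; D1a = λ j → ε
      ; D1b = λ j → ε
      ; D2 = D2
      ; D3 = pointwise⇒≈h D3L D3R (λ { zero → trans eq3L (sym eq3R) })
      ; D4 = D4
      ; D5 = pointwise⇒≈h D5L D5R (λ { zero → trans eq5L (sym eq5R) })
      ; D6 = D6
      }

  module Fill (F : ∀ {k} → Tm k) where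
    mutual
      fill : ∀ {k} → Tm k → Tm k
      fill (var i) = var i
      fill (t · u) = fill t · fill u
      fill (lam t) = lam (fill t)
      fill (con c) = con c
      fill (case θ t) = case (fillB θ) (fill t)

      fillB : ∀ {k m} → Branches k m → Branches k m
      fillB [] = []
      fillB (nothing ∷ θ) = just F ∷ fillB θ
      fillB (just u ∷ θ) = just (fill u) ∷ fillB θ

    fillE : ∀ {k} → Maybe (Tm k) → Tm k
    fillE (just u) = fill u
    fillE nothing = F

    lookup-fillB : ∀ {k m} (θ : Branches k m) (c : Fin m) → lookup (fillB θ) c ≡ just (fillE (lookup θ c))
    lookup-fillB (nothing ∷ θ) zero = refl
    lookup-fillB (just u ∷ θ) zero = refl
    lookup-fillB (nothing ∷ θ) (suc c) = lookup-fillB θ c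
    lookup-fillB (just u ∷ θ) (suc c) = lookup-fillB θ c

  pointwise⇒Branches* : ∀ {k m} (θ1 θ2 : Branches k m) →
      (∀ c → Σ (Tm k) (λ u → Σ (Tm k) (λ u' → lookup θ1 c ≡ just u × lookup θ2 c ≡ just u' × u ≡βη u'))) → ≡βηCl.Branches* θ1 θ2
  pointwise⇒Branches* [] [] e = ≡βηCl.[]
  pointwise⇒Branches* (x ∷ θ1) (y ∷ θ2) e with e zero
  ... | u , u' , refl , refl , s = ≡βηCl.jj s (pointwise⇒Branches* θ1 θ2 (λ c → e (suc c)))

  module Interpretation (F : ∀ {k} → Tm k) (F-S : ∀ {k l} (σ : Fin k → Tm l) → nsubst F σ ≡ F)
                (F-push : ∀ {k} (θ : Binding nc (Tm k)) → pushCase θ F ≡ F) where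
    open TermModel F F-S F-push
    open Model model using (⟦_⟧; ⟦_⟧B)
    open Fill F

    PowVars : ℕ → ℕ
    PowVars k = CCC.Pow termCCC 1 k

    varPow : ∀ {k} → Fin k → Tm (PowVars k)
    varPow i = var (toPow i)

    mutual
      ⟦⟧-fill : ∀ {k} (t : Tm k) → nf (⟦ t ⟧ zero) ≡βη nsubst (fill t) varPow
      ⟦⟧-fill (var i) = ≡⇒≡βη (cong nf (proj-toPow i))
      ⟦⟧-fill (t · u) = ≡βηCl.*app (⟦⟧-fill t) (⟦⟧-fill u)
      ⟦⟧-fill {k} (lam t) = ≡⇒≡βη (nf-lam (⟦ t ⟧ zero)) ◅◅ ≡βηCl.*lam (⟦⟧-fill t ◅◅ ≡⇒≡βη (nsubst-cong pw (fill t)))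
        where pw : varPow {suc k} ≗ extS (varPow {k})
              pw zero = refl
              pw (suc i) = refl
      ⟦⟧-fill (con c) = ε
      ⟦⟧-fill {k} (case θ t) = ≡⇒≡βη eq1 ◅◅ pushCase-≡βη (NfB-nsubstB NfS-var _) (⟦⟧-fill t) ◅◅ ≡βηCl.pushCase-cong* bs (nsubst (fill t) varPow)
        where
          σ : Fin (suc (PowVars nc)) → Tm (PowVars k)
          σ = C.⟨ ⟦ θ ⟧B , ⟦ t ⟧ ⟩
          eq1 : nf (pushCase (nsubstB θvars σ) (⟦ t ⟧ zero)) ≡ pushCase (nfB (nsubstB θvars σ)) (nf (⟦ t ⟧ zero))
          eq1 = nsubst-pushCase (nsubstB θvars σ) (⟦ t ⟧ zero) var
          bs : ≡βηCl.Branches* (nfB (nsubstB θvars σ)) (nsubstB (fillB θ) varPow)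
          bs = pointwise⇒Branches* _ _ (λ c → _ , _ , trans (lookup-nsubstB (nsubstB θvars σ) var c) (cong (Data.Maybe.map nf) (lookup-nsubstB-θvars σ c)) ,
                                    trans (lookup-nsubstB (fillB θ) varPow c) (cong (Data.Maybe.map (λ u → nsubst u varPow)) (lookup-fillB θ c)) , ⟦⟧B-fill θ c)

      ⟦⟧B-fill : ∀ {k m} (θ : Branches k m) (c : Fin m) → nf (⟦ θ ⟧B (toPow c)) ≡βη nsubst (fillE (lookup θ c)) varPow
      ⟦⟧B-fill (nothing ∷ θ) zero = ≡⇒≡βη (trans (cong nf (F-S _)) (trans (F-S _) (sym (F-S _))))
      ⟦⟧B-fill (just u ∷ θ) zero = ⟦⟧-fill u
      ⟦⟧B-fill (nothing ∷ θ) (suc c) = ⟦⟧B-fill θ c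
      ⟦⟧B-fill (just u ∷ θ) (suc c) = ⟦⟧B-fill θ c

    fill-≡βη : ∀ {k} (t t' : Tm k) → _≈h_ (⟦ t ⟧) (⟦ t' ⟧) → nf (fill t) ≡βη nf (fill t')
    fill-≡βη t t' h = ≡⇒≡βη (sym (back (nf (fill t)))) ◅◅ ≡βηCl.Star-ren fromPow st ◅◅ ≡⇒≡βη (back (nf (fill t')))
      where
        back : ∀ {k} (x : Tm k) → rename fromPow (rename toPow x) ≡ x
        back x = trans (rename-∘ fromPow toPow x) (trans (rename-cong fromPow-toPow x) (rename-id x))
        st : rename toPow (nf (fill t)) ≡βη rename toPow (nf (fill t'))
        st = ≡⇒≡βη (sym (nsubst-var∘ toPow (fill t))) ◅◅ ≡βη-sym (⟦⟧-fill t) ◅◅ h zero ◅◅ ⟦⟧-fill t' ◅◅ ≡⇒≡βη (nsubst-var∘ toPow (fill t'))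

  -- Case-normalisation and βη are λC-reductions

  λ*appL : ∀ {k} {a a' b : Tm k} → Star _⟶_ a a' → Star _⟶_ (a · b) (a' · b)
  λ*appL {b = b} = Star.gmap (_· b) appL
  λ*appR : ∀ {k} {a b b' : Tm k} → Star _⟶_ b b' → Star _⟶_ (a · b) (a · b')
  λ*appR {a = a} = Star.gmap (a ·_) appR
  λ*lam : ∀ {k} {a a' : Tm (suc k)} → Star _⟶_ a a' → Star _⟶_ (lam a) (lam a')
  λ*lam = Star.gmap lam lamC
  λ*caseT : ∀ {k} {θ} {a a' : Tm k} → Star _⟶_ a a' → Star _⟶_ (case θ a) (case θ a')
  λ*caseT {θ = θ} = Star.gmap (case θ) caseT

  data Branches⟶* {k} : ∀ {m} → Branches k m → Branches k m → Set where
    []  : Branches⟶* [] []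
    nn  : ∀ {m} {θ θ' : Branches k m} → Branches⟶* θ θ' → Branches⟶* (nothing ∷ θ) (nothing ∷ θ')
    jj  : ∀ {m} {u u'} {θ θ' : Branches k m} → Star _⟶_ u u' → Branches⟶* θ θ' → Branches⟶* (just u ∷ θ) (just u' ∷ θ')

  Branches⟶*-refl : ∀ {k m} (θ : Branches k m) → Branches⟶* θ θ
  Branches⟶*-refl [] = []
  Branches⟶*-refl (nothing ∷ θ) = nn (Branches⟶*-refl θ)
  Branches⟶*-refl (just x ∷ θ) = jj ε (Branches⟶*-refl θ)

  λ*hd : ∀ {k m} {u u' : Tm k} {θ : Branches k m} → Star _⟶_ u u' → Star _⟶B_ (just u ∷ θ) (just u' ∷ θ)
  λ*hd {θ = θ} = Star.gmap (λ u → just u ∷ θ) here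
  λ*tl : ∀ {k m} {x} {θ θ' : Branches k m} → Star _⟶B_ θ θ' → Star _⟶B_ (x ∷ θ) (x ∷ θ')
  λ*tl {x = x} = Star.gmap (x ∷_) there

  Branches⟶*⇒Star : ∀ {k m} {θ θ' : Branches k m} → Branches⟶* θ θ' → Star _⟶B_ θ θ'
  Branches⟶*⇒Star [] = ε
  Branches⟶*⇒Star (nn b) = λ*tl (Branches⟶*⇒Star b)
  Branches⟶*⇒Star (jj x b) = λ*hd x ◅◅ λ*tl (Branches⟶*⇒Star b)

  λ*caseB : ∀ {k} {θ θ' : Binding nc (Tm k)} {t} → Star _⟶B_ θ θ' → Star _⟶_ (case θ t) (case θ' t)
  λ*caseB {t = t} = Star.gmap (λ θ → case θ t) caseB

  mutual
    case⟶*pushCase : ∀ {k} (θ : Binding nc (Tm k)) (M : Tm k) → Star _⟶_ (case θ M) (pushCase θ M)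
    case⟶*pushCase θ (var i) = ε
    case⟶*pushCase θ (a · b) = CaseApp ◅ λ*appL (case⟶*pushCase θ a)
    case⟶*pushCase θ (lam a) = CaseLam ◅ λ*lam (case⟶*pushCase (weakenB θ) a)
    case⟶*pushCase θ (con c) with lookup θ c in e
    ... | just u = CaseCons e ◅ ε
    ... | nothing = ε
    case⟶*pushCase θ (case φ t) = CaseCase ◅ (λ*caseB (Branches⟶*⇒Star (case∘B⟶*pushCaseB θ φ)) ◅◅ case⟶*pushCase (pushCaseB θ φ) t)

    case∘B⟶*pushCaseB : ∀ {k m} (θ : Binding nc (Tm k)) (φ : Branches k m) → Branches⟶* (θ ∘B φ) (pushCaseB θ φ)
    case∘B⟶*pushCaseB θ [] = []
    case∘B⟶*pushCaseB θ (nothing ∷ φ) = nn (case∘B⟶*pushCaseB θ φ)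
    case∘B⟶*pushCaseB θ (just u ∷ φ) = jj (case⟶*pushCase θ u) (case∘B⟶*pushCaseB θ φ)

  mutual
    subst⟶*nsubst : ∀ {k l} (σ : Fin k → Tm l) (t : Tm k) → Star _⟶_ (subst σ t) (nsubst t σ)
    subst⟶*nsubst σ (var i) = ε
    subst⟶*nsubst σ (t · u) = λ*appL (subst⟶*nsubst σ t) ◅◅ λ*appR (subst⟶*nsubst σ u)
    subst⟶*nsubst σ (lam t) = λ*lam (subst⟶*nsubst (extS σ) t)
    subst⟶*nsubst σ (con c) = ε
    subst⟶*nsubst σ (case θ t) = λ*caseB (Branches⟶*⇒Star (substB⟶*nsubstB σ θ)) ◅◅ λ*caseT (subst⟶*nsubst σ t) ◅◅ case⟶*pushCase (nsubstB θ σ) (nsubst t σ)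

    substB⟶*nsubstB : ∀ {k l m} (σ : Fin k → Tm l) (θ : Branches k m) → Branches⟶* (substB σ θ) (nsubstB θ σ)
    substB⟶*nsubstB σ [] = []
    substB⟶*nsubstB σ (nothing ∷ θ) = nn (substB⟶*nsubstB σ θ)
    substB⟶*nsubstB σ (just u ∷ θ) = jj (subst⟶*nsubst σ u) (substB⟶*nsubstB σ θ)

  mutual
    subst-cong : ∀ {k l} {σ σ' : Fin k → Tm l} → σ ≗ σ' → (t : Tm k) → subst σ t ≡ subst σ' t
    subst-cong e (var i) = e i
    subst-cong e (t · u) = cong₂ _·_ (subst-cong e t) (subst-cong e u)
    subst-cong e (lam t) = cong lam (subst-cong (extS-cong e) t)
    subst-cong e (con c) = refl
    subst-cong e (case θ t) = cong₂ case (substB-cong e θ) (subst-cong e t)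

    substB-cong : ∀ {k l m} {σ σ' : Fin k → Tm l} → σ ≗ σ' → (θ : Branches k m) → substB σ θ ≡ substB σ' θ
    substB-cong e [] = refl
    substB-cong e (nothing ∷ θ) = cong (nothing ∷_) (substB-cong e θ)
    substB-cong e (just u ∷ θ) = cong₂ (λ a b → just a ∷ b) (subst-cong e u) (substB-cong e θ)

  mutual
    subst-id : ∀ {k} (t : Tm k) → subst var t ≡ t
    subst-id (var i) = refl
    subst-id (t · u) = cong₂ _·_ (subst-id t) (subst-id u)
    subst-id (lam t) = cong lam (trans (subst-cong (λ { zero → refl ; (suc i) → refl }) t) (subst-id t))
    subst-id (con c) = refl
    subst-id (case θ t) = cong₂ case (substB-id θ) (subst-id t)

    substB-id : ∀ {k m} (θ : Branches k m) → substB var θ ≡ θ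
    substB-id [] = refl
    substB-id (nothing ∷ θ) = cong (nothing ∷_) (substB-id θ)
    substB-id (just u ∷ θ) = cong₂ (λ a b → just a ∷ b) (subst-id u) (substB-id θ)

  ⟶*nf : ∀ {k} (t : Tm k) → Star _⟶_ t (nf t)
  ⟶*nf t = ≡subst (λ z → Star _⟶_ z (nf t)) (subst-id t) (subst⟶*nsubst var t)

  mutual
    ⟶βη⇒⟶* : ∀ {k} {a b : Tm k} → a ⟶βη b → Star _⟶_ a b
    ⟶βη⇒⟶* (top (β-step (beta {a} {b}))) = AppLam ◅ subst⟶*nsubst (sub0 b) a
    ⟶βη⇒⟶* (top (η-step (eta {M = M} refl))) = LamApp ◅ ε
    ⟶βη⇒⟶* (appL d) = λ*appL (⟶βη⇒⟶* d)
    ⟶βη⇒⟶* (appR d) = λ*appR (⟶βη⇒⟶* d)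
    ⟶βη⇒⟶* (lamC d) = λ*lam (⟶βη⇒⟶* d)
    ⟶βη⇒⟶* (caseB d) = λ*caseB (Branches⟶*⇒Star (⟶βηB⇒Branches⟶* d))

    ⟶βηB⇒Branches⟶* : ∀ {k m} {a b : Branches k m} → CompatB BetaEta a b → Branches⟶* a b
    ⟶βηB⇒Branches⟶* (here {θ = θ} d) = jj (⟶βη⇒⟶* d) (Branches⟶*-refl θ)
    ⟶βηB⇒Branches⟶* (there {x = nothing} d) = nn (⟶βηB⇒Branches⟶* d)
    ⟶βηB⇒Branches⟶* (there {x = just x} d) = jj ε (⟶βηB⇒Branches⟶* d)

  ⟶βη*⇒⟶* : ∀ {k} {a b : Tm k} → Star _⟶βη_ a b → Star _⟶_ a b
  ⟶βη*⇒⟶* = Star.kleisliStar id ⟶βη⇒⟶*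

  ⟶*⇒≡λC : ∀ {k} {a b : Tm k} → Star _⟶_ a b → a ≡λC b
  ⟶*⇒≡λC = Star.map fwd

  join⇒≡λC : ∀ {k} {a b d : Tm k} → Star _⟶_ a d → Star _⟶_ b d → a ≡λC b
  join⇒≡λC s s' = ⟶*⇒≡λC s ◅◅ symmetric _⟶_ (⟶*⇒≡λC s')

  -- F interprets fail in the term model, and reflect turns the βη-reductions
  -- of the filled term into λC-reductions of the original one.
  record FailureWitness : Set where
    field
      F       : ∀ {k} → Tm k
      F-S     : ∀ {k l} (σ : Fin k → Tm l) → nsubst F σ ≡ F
      F-push  : ∀ {k} (θ : Binding nc (Tm k)) → pushCase θ F ≡ F
      unfill  : ∀ {k} → Tm k → Tm k
      reflect : ∀ {k} (t : Tm k) → HereditarilyDefined t →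
                ∀ {d} → Star _⟶βη_ (nf (Fill.fill F t)) d → Star _⟶_ t (unfill d)

  module _ (w : FailureWitness) where
    open FailureWitness w
    open Fill F
    open Interpretation F F-S F-push
    termModel : Model 0ℓ 0ℓ 0ℓ nc
    termModel = TermModel.model F F-S F-push

    complete : ∀ {k} (t t' : Tm k) → HereditarilyDefined t → HereditarilyDefined t' →
               Model._≈_ termModel (Model.⟦_⟧ termModel t) (Model.⟦_⟧ termModel t') → t ≡λC t'
    complete t t' hd hd' eq with ≡βη-join (fill-≡βη t t' eq)
    ... | d , s , s' rewrite nf-idem (fill t) | nf-idem (fill t') = join⇒≡λC (reflect t hd s) (reflect t' hd' s')

module _ {n : ℕ} where
  private
    nc = suc n
    Tm = Term nc
    Branches : ℕ → ℕ → Set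
    Branches k m = Vec (Maybe (Term nc k)) m

  nothings : ∀ {k} m → Branches k m
  nothings m = replicate m nothing

  stuck : ∀ {k} → Tm k
  stuck = case (nothings nc) (con zero)

  nsubstB-nothings : ∀ {k l m} (σ : Fin k → Tm l) → nsubstB (nothings m) σ ≡ nothings m
  nsubstB-nothings {m = zero} σ = refl
  nsubstB-nothings {m = suc m} σ = cong (nothing ∷_) (nsubstB-nothings σ)

  pushCaseB-nothings : ∀ {k m} (θ : Binding nc (Tm k)) → pushCaseB θ (nothings m) ≡ nothings m
  pushCaseB-nothings {m = zero} θ = refl
  pushCaseB-nothings {m = suc m} θ = cong (nothing ∷_) (pushCaseB-nothings θ)

  renameB-nothings : ∀ {k l m} (ρ : Ren k l) → renameB {nc = nc} ρ (nothings m) ≡ nothings m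
  renameB-nothings {m = zero} ρ = refl
  renameB-nothings {m = suc m} ρ = cong (nothing ∷_) (renameB-nothings ρ)

  nsubst-stuck : ∀ {k l} (σ : Fin k → Tm l) → nsubst stuck σ ≡ stuck
  nsubst-stuck σ rewrite nsubstB-nothings {m = n} σ = refl

  pushCase-stuck : ∀ {k} (θ : Binding nc (Tm k)) → pushCase θ stuck ≡ stuck
  pushCase-stuck θ rewrite pushCaseB-nothings {m = n} θ = refl

  rename-stuck : ∀ {k l} (ρ : Ren k l) → rename ρ stuck ≡ stuck
  rename-stuck ρ rewrite renameB-nothings {m = n} ρ = refl

  allNothing : ∀ {k m} → Branches k m → Bool
  allNothing [] = true
  allNothing (nothing ∷ θ) = allNothing θ
  allNothing (just _ ∷ θ) = false

  allNothing-nothings : ∀ {k m} → allNothing {k} (nothings m) ≡ true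
  allNothing-nothings {m = zero} = refl
  allNothing-nothings {m = suc m} = allNothing-nothings {m = m}

  allNothing-rename : ∀ {k l m} (ρ : Ren k l) (θ : Branches k m) → allNothing (renameB ρ θ) ≡ allNothing θ
  allNothing-rename ρ [] = refl
  allNothing-rename ρ (nothing ∷ θ) = allNothing-rename ρ θ
  allNothing-rename ρ (just x ∷ θ) = refl

  isStuck : ∀ {k} → Tm k → Bool
  isStuck (case θ (con zero)) = allNothing θ
  isStuck _ = false

  isStuck-stuck : ∀ {k} → isStuck (stuck {k}) ≡ true
  isStuck-stuck = allNothing-nothings {m = n}

  isStuck-rename : ∀ {k l} (ρ : Ren k l) (t : Tm k) → isStuck (rename ρ t) ≡ isStuck t
  isStuck-rename ρ (var x) = refl
  isStuck-rename ρ (t · t₁) = refl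
  isStuck-rename ρ (lam t) = refl
  isStuck-rename ρ (con x) = refl
  isStuck-rename ρ (case x (var x₁)) = refl
  isStuck-rename ρ (case x (t · t₁)) = refl
  isStuck-rename ρ (case x (lam t)) = refl
  isStuck-rename ρ (case x (con zero)) = allNothing-rename ρ x
  isStuck-rename ρ (case x (con (suc x₁))) = refl
  isStuck-rename ρ (case x (case x₁ t)) = refl

  mutual
    unfill : ∀ {k} → Tm k → Tm k
    unfill (var i) = var i
    unfill (a · b) = unfill a · unfill b
    unfill (lam a) = lam (unfill a)
    unfill (con c) = con c
    unfill (case θ t) = case (unfillB θ) (unfill t)

    unfillB : ∀ {k m} → Branches k m → Branches k m
    unfillB [] = []
    unfillB (nothing ∷ θ) = nothing ∷ unfillB θ
    unfillB (just u ∷ θ) = unfillBranch (isStuck u) u ∷ unfillB θ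

    unfillBranch : ∀ {k} → Bool → Tm k → Maybe (Tm k)
    unfillBranch true u = nothing
    unfillBranch false u = just (unfill u)

  mutual
    unfill-rename : ∀ {k l} (ρ : Ren k l) (t : Tm k) → unfill (rename ρ t) ≡ rename ρ (unfill t)
    unfill-rename ρ (var i) = refl
    unfill-rename ρ (a · b) = cong₂ _·_ (unfill-rename ρ a) (unfill-rename ρ b)
    unfill-rename ρ (lam a) = cong lam (unfill-rename (extR ρ) a)
    unfill-rename ρ (con c) = refl
    unfill-rename ρ (case θ t) = cong₂ case (unfillB-renameB ρ θ) (unfill-rename ρ t)

    unfillB-renameB : ∀ {k l m} (ρ : Ren k l) (θ : Branches k m) → unfillB (renameB ρ θ) ≡ renameB ρ (unfillB θ)
    unfillB-renameB ρ [] = refl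
    unfillB-renameB ρ (nothing ∷ θ) = cong (nothing ∷_) (unfillB-renameB ρ θ)
    unfillB-renameB ρ (just u ∷ θ) rewrite isStuck-rename ρ u with isStuck u
    ... | true = cong (nothing ∷_) (unfillB-renameB ρ θ)
    ... | false = cong₂ _∷_ (cong just (unfill-rename ρ u)) (unfillB-renameB ρ θ)

  mutual
    data FilledNf {k} : Tm k → Set where
      gvar : ∀ {i} → FilledNf (var i)
      gcon : ∀ {c} → FilledNf (con c)
      gapp : ∀ {a b} → FilledNf a → FilledNf b → FilledNf (a · b)
      glam : ∀ {a} → FilledNf a → FilledNf (lam a)
      gcase : ∀ {θ i} → FilledNfB θ → FilledNf (case θ (var i))

    data FilledNfB {k} : ∀ {m} → Branches k m → Set where
      [] : FilledNfB []
      gj : ∀ {m u} {θ : Branches k m} → (u ≡ stuck) ⊎ FilledNf u → FilledNfB θ → FilledNfB (just u ∷ θ)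

  mutual
    data Filled {k} : Tm k → Set where
      fvar : ∀ {i} → Filled (var i)
      fcon : ∀ {c} → Filled (con c)
      fapp : ∀ {a b} → Filled a → Filled b → Filled (a · b)
      flam : ∀ {a} → Filled a → Filled (lam a)
      fcase : ∀ {θ t} → FilledB θ → Filled t → Filled (case θ t)

    data FilledB {k} : ∀ {m} → Branches k m → Set where
      [] : FilledB []
      fj : ∀ {m u} {θ : Branches k m} → (u ≡ stuck) ⊎ Filled u → FilledB θ → FilledB (just u ∷ θ)

  mutual
    FilledNf⇒Filled : ∀ {k} {t : Tm k} → FilledNf t → Filled t
    FilledNf⇒Filled gvar = fvar
    FilledNf⇒Filled gcon = fcon
    FilledNf⇒Filled (gapp a b) = fapp (FilledNf⇒Filled a) (FilledNf⇒Filled b)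
    FilledNf⇒Filled (glam a) = flam (FilledNf⇒Filled a)
    FilledNf⇒Filled (gcase b) = fcase (FilledNfB⇒FilledB b) fvar

    FilledNfB⇒FilledB : ∀ {k m} {θ : Branches k m} → FilledNfB θ → FilledB θ
    FilledNfB⇒FilledB [] = []
    FilledNfB⇒FilledB (gj (inj₁ e) b) = fj (inj₁ e) (FilledNfB⇒FilledB b)
    FilledNfB⇒FilledB (gj (inj₂ g) b) = fj (inj₂ (FilledNf⇒Filled g)) (FilledNfB⇒FilledB b)

  Filled⇒¬stuck : ∀ {k} {t : Tm k} → Filled t → isStuck t ≡ false
  Filled⇒¬stuck fvar = refl
  Filled⇒¬stuck fcon = refl
  Filled⇒¬stuck (fapp a b) = refl
  Filled⇒¬stuck (flam a) = refl
  Filled⇒¬stuck (fcase {t = var x} b p) = refl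
  Filled⇒¬stuck (fcase {t = t · t₁} b p) = refl
  Filled⇒¬stuck (fcase {t = lam t} b p) = refl
  Filled⇒¬stuck (fcase {t = con zero} (fj x b) p) = refl
  Filled⇒¬stuck (fcase {t = con (suc x)} b p) = refl
  Filled⇒¬stuck (fcase {t = case x t} b p) = refl

  FilledNf⇒¬stuck : ∀ {k} {t : Tm k} → FilledNf t → isStuck t ≡ false
  FilledNf⇒¬stuck g = Filled⇒¬stuck (FilledNf⇒Filled g)

  mutual
    FilledNf-rename : ∀ {k l} (ρ : Ren k l) {t : Tm k} → FilledNf t → FilledNf (rename ρ t)
    FilledNf-rename ρ gvar = gvar
    FilledNf-rename ρ gcon = gcon
    FilledNf-rename ρ (gapp a b) = gapp (FilledNf-rename ρ a) (FilledNf-rename ρ b)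
    FilledNf-rename ρ (glam a) = glam (FilledNf-rename (extR ρ) a)
    FilledNf-rename ρ (gcase b) = gcase (FilledNfB-renameB ρ b)

    FilledNfB-renameB : ∀ {k l m} (ρ : Ren k l) {θ : Branches k m} → FilledNfB θ → FilledNfB (renameB ρ θ)
    FilledNfB-renameB ρ [] = []
    FilledNfB-renameB ρ (gj (inj₁ refl) b) = gj (inj₁ (rename-stuck ρ)) (FilledNfB-renameB ρ b)
    FilledNfB-renameB ρ (gj (inj₂ g) b) = gj (inj₂ (FilledNf-rename ρ g)) (FilledNfB-renameB ρ b)

  renameB-nothings⁻¹ : ∀ {k l m} (ρ : Ren k l) (θ : Branches k m) → renameB ρ θ ≡ nothings m → θ ≡ nothings m
  renameB-nothings⁻¹ ρ [] e = refl
  renameB-nothings⁻¹ ρ (nothing ∷ θ) e = cong (nothing ∷_) (renameB-nothings⁻¹ ρ θ (∷-injectiveʳ e))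
  renameB-nothings⁻¹ ρ (just x ∷ θ) ()

  rename-stuck⁻¹ : ∀ {k l} (ρ : Ren k l) (u : Tm k) → rename ρ u ≡ stuck → u ≡ stuck
  rename-stuck⁻¹ ρ (case θ (con zero)) e = cong (λ z → case z (con zero)) (renameB-nothings⁻¹ ρ θ (case-inj₁ e))
  rename-stuck⁻¹ ρ (var x) ()
  rename-stuck⁻¹ ρ (u · u₁) ()
  rename-stuck⁻¹ ρ (lam u) ()
  rename-stuck⁻¹ ρ (con x) ()
  rename-stuck⁻¹ ρ (case x (var x₁)) ()
  rename-stuck⁻¹ ρ (case x (u · u₁)) ()
  rename-stuck⁻¹ ρ (case x (lam u)) ()
  rename-stuck⁻¹ ρ (case x (con (suc x₁))) ()
  rename-stuck⁻¹ ρ (case x (case x₁ u)) ()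

  mutual
    FilledNf-rename⁻¹ : ∀ {k l} (ρ : Ren k l) (t : Tm k) → FilledNf (rename ρ t) → FilledNf t
    FilledNf-rename⁻¹ ρ (var i) g = gvar
    FilledNf-rename⁻¹ ρ (a · b) (gapp x y) = gapp (FilledNf-rename⁻¹ ρ a x) (FilledNf-rename⁻¹ ρ b y)
    FilledNf-rename⁻¹ ρ (lam a) (glam x) = glam (FilledNf-rename⁻¹ (extR ρ) a x)
    FilledNf-rename⁻¹ ρ (con c) g = gcon
    FilledNf-rename⁻¹ ρ (case θ (var i)) (gcase b) = gcase (FilledNfB-renameB⁻¹ ρ θ b)

    FilledNfB-renameB⁻¹ : ∀ {k l m} (ρ : Ren k l) (θ : Branches k m) → FilledNfB (renameB ρ θ) → FilledNfB θ
    FilledNfB-renameB⁻¹ ρ [] b = []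
    FilledNfB-renameB⁻¹ ρ (just u ∷ θ) (gj (inj₁ e) b) = gj (inj₁ (rename-stuck⁻¹ ρ u e)) (FilledNfB-renameB⁻¹ ρ θ b)
    FilledNfB-renameB⁻¹ ρ (just u ∷ θ) (gj (inj₂ g) b) = gj (inj₂ (FilledNf-rename⁻¹ ρ u g)) (FilledNfB-renameB⁻¹ ρ θ b)

  Nf-stuck : ∀ {k} → Nf (stuck {k})
  Nf-stuck = ncase-con (repNf {m = n}) refl
    where repNf : ∀ {k m} → NfB {k = k} (nothings (suc m))
          repNf {m = zero} = cn []
          repNf {m = suc m} = cn (repNf {m = m})

  mutual
    FilledNf⇒Nf : ∀ {k} {t : Tm k} → FilledNf t → Nf t
    FilledNf⇒Nf gvar = nvar
    FilledNf⇒Nf gcon = ncon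
    FilledNf⇒Nf (gapp a b) = napp (FilledNf⇒Nf a) (FilledNf⇒Nf b)
    FilledNf⇒Nf (glam a) = nlam (FilledNf⇒Nf a)
    FilledNf⇒Nf (gcase b) = ncase-var (FilledNfB⇒NfB b)

    FilledNfB⇒NfB : ∀ {k m} {θ : Branches k m} → FilledNfB θ → NfB θ
    FilledNfB⇒NfB [] = []
    FilledNfB⇒NfB (gj (inj₁ refl) b) = Nf-stuck ∷j FilledNfB⇒NfB b
    FilledNfB⇒NfB (gj (inj₂ g) b) = FilledNf⇒Nf g ∷j FilledNfB⇒NfB b

  mutual
    Nf-unfill : ∀ {k} {t : Tm k} → FilledNf t → Nf (unfill t)
    Nf-unfill gvar = nvar
    Nf-unfill gcon = ncon
    Nf-unfill (gapp a b) = napp (Nf-unfill a) (Nf-unfill b)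
    Nf-unfill (glam a) = nlam (Nf-unfill a)
    Nf-unfill (gcase b) = ncase-var (NfB-unfillB b)

    NfB-unfillB : ∀ {k m} {θ : Branches k m} → FilledNfB θ → NfB (unfillB θ)
    NfB-unfillB [] = []
    NfB-unfillB {k} (gj (inj₁ refl) b) rewrite isStuck-stuck {k} = cn (NfB-unfillB b)
    NfB-unfillB {θ = just u ∷ θ} (gj (inj₂ g) b) rewrite FilledNf⇒¬stuck g = Nf-unfill g ∷j NfB-unfillB b

  mutual
    HasFailure-rename : ∀ {k l} (ρ : Ren k l) {x : Tm k} → HasFailure x → HasFailure (rename ρ x)
    HasFailure-rename ρ {case θ (con c)} (failure e) = failure (trans (lookup-renameB ρ θ c) (cong (Data.Maybe.map (rename ρ)) e))
    HasFailure-rename ρ (inAppL h) = inAppL (HasFailure-rename ρ h)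
    HasFailure-rename ρ (inAppR h) = inAppR (HasFailure-rename ρ h)
    HasFailure-rename ρ (inLam h) = inLam (HasFailure-rename (extR ρ) h)
    HasFailure-rename ρ (inCaseB h) = inCaseB (HasFailureB-renameB ρ h)
    HasFailure-rename ρ (inCaseT h) = inCaseT (HasFailure-rename ρ h)

    HasFailureB-renameB : ∀ {k l m} (ρ : Ren k l) {θ : Branches k m} → HasFailureB θ → HasFailureB (renameB ρ θ)
    HasFailureB-renameB ρ (here h) = here (HasFailure-rename ρ h)
    HasFailureB-renameB ρ (there {x = nothing} h) = there (HasFailureB-renameB ρ h)
    HasFailureB-renameB ρ (there {x = just x} h) = there (HasFailureB-renameB ρ h)

  mutual
    HasFailure-pushCase : ∀ {k} (θ : Binding nc (Tm k)) {M : Tm k} → Nf M → HasFailure M → HasFailure (pushCase θ M)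
    HasFailure-pushCase θ (napp a b) (inAppL h) = inAppL (HasFailure-pushCase θ a h)
    HasFailure-pushCase θ (napp a b) (inAppR h) = inAppR h
    HasFailure-pushCase θ (nlam a) (inLam h) = inLam (HasFailure-pushCase (weakenB θ) a h)
    HasFailure-pushCase θ (ncase-var nψ) (inCaseB h) = inCaseB (HasFailureB-pushCaseB θ nψ h)
    HasFailure-pushCase θ (ncase-var nψ) (inCaseT ())
    HasFailure-pushCase θ {case ψ (con c)} (ncase-con nψ e) h
      rewrite trans (lookup-pushCaseB θ ψ c) (lookup-map-nothing (pushCase θ) ψ c e) = failure (trans (lookup-pushCaseB θ ψ c) (lookup-map-nothing (pushCase θ) ψ c e))

    HasFailureB-pushCaseB : ∀ {k m} (θ : Binding nc (Tm k)) {ψ : Branches k m} → NfB ψ → HasFailureB ψ → HasFailureB (pushCaseB θ ψ)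
    HasFailureB-pushCaseB θ (x ∷j n) (here h) = here (HasFailure-pushCase θ x h)
    HasFailureB-pushCaseB θ (cn n) (there h) = there (HasFailureB-pushCaseB θ n h)
    HasFailureB-pushCaseB θ (x ∷j n) (there h) = there (HasFailureB-pushCaseB θ n h)

  -- Case-normalising a filled term selects a stuck branch only where the
  -- unfilled term meets a match failure; as long as the latter is defined, the
  -- result is therefore a filled normal form that unfills to it.
  Simulates : ∀ {k} → Tm k → Tm k → Set
  Simulates x y = Defined y → FilledNf x × unfill x ≡ y

  Simulates-≡ : ∀ {k} {x y y' : Tm k} → y ≡ y' → Simulates x y → Simulates x y'
  Simulates-≡ refl s = s

  data BranchesSim {k} : ∀ {m} → Branches k m → Branches k m → Set where
    [] : BranchesSim [] []
    bz : ∀ {m} {θ θU : Branches k m} → BranchesSim θ θU → BranchesSim (just stuck ∷ θ) (nothing ∷ θU)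
    bj : ∀ {m u uU} {θ θU : Branches k m} → Simulates u uU → BranchesSim θ θU → BranchesSim (just u ∷ θ) (just uU ∷ θU)

  Simulates-weaken : ∀ {k} {u uU : Tm k} → Simulates u uU → Simulates (weaken u) (weaken uU)
  Simulates-weaken {u = u} s d with s (λ h → d (HasFailure-rename suc h))
  ... | g , e = FilledNf-rename suc g , trans (unfill-rename suc u) (cong weaken e)

  BranchesSim-weaken : ∀ {k m} {θ θU : Branches k m} → BranchesSim θ θU → BranchesSim (weakenB θ) (weakenB θU)
  BranchesSim-weaken [] = []
  BranchesSim-weaken {k} (bz {θ = θ} {θU} b) = ≡subst (λ z → BranchesSim (just z ∷ weakenB θ) (nothing ∷ weakenB θU)) (sym (rename-stuck suc)) (bz (BranchesSim-weaken b))
  BranchesSim-weaken (bj s b) = bj (Simulates-weaken s) (BranchesSim-weaken b)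

  BranchesSim-defined : ∀ {k m} {θ θU : Branches k m} → BranchesSim θ θU → ¬ HasFailureB θU → FilledNfB θ × unfillB θ ≡ θU
  BranchesSim-defined [] d = [] , refl
  BranchesSim-defined {k} (bz b) d with BranchesSim-defined b (λ h → d (there h))
  ... | g , e rewrite isStuck-stuck {k} = gj (inj₁ refl) g , cong (nothing ∷_) e
  BranchesSim-defined (bj {u = u} s b) d with s (λ h → d (here h)) | BranchesSim-defined b (λ h → d (there h))
  ... | g1 , e1 | g , e rewrite FilledNf⇒¬stuck g1 = gj (inj₂ g1) g , cong₂ (λ a b → just a ∷ b) e1 e

  lookup-BranchesSim : ∀ {k m} {θ θU : Branches k m} → BranchesSim θ θU → (c : Fin m) →
     (lookup θ c ≡ just stuck × lookup θU c ≡ nothing) ⊎ Σ (Tm k) (λ u → Σ (Tm k) (λ uU → lookup θ c ≡ just u × lookup θU c ≡ just uU × Simulates u uU))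
  lookup-BranchesSim (bz b) zero = inj₁ (refl , refl)
  lookup-BranchesSim (bj s b) zero = inj₂ (_ , _ , refl , refl , s)
  lookup-BranchesSim (bz b) (suc c) = lookup-BranchesSim b c
  lookup-BranchesSim (bj s b) (suc c) = lookup-BranchesSim b c

  mutual
    pushCase-Simulates : ∀ {k} {θ θU : Binding nc (Tm k)} {M : Tm k} → BranchesSim θ θU → FilledNf M →
        Simulates (pushCase θ M) (pushCase θU (unfill M))
    pushCase-Simulates br (gvar {i}) d with BranchesSim-defined br (λ h → d (inCaseB h))
    ... | g , e = gcase g , cong (λ z → case z (var i)) e
    pushCase-Simulates {θ = θ} {θU} br (gcon {c}) d with lookup-BranchesSim br c
    ... | inj₁ (e1 , e2) rewrite e2 = ⊥-elim (d (failure e2))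
    ... | inj₂ (u , uU , e1 , e2 , s) rewrite e1 | e2 = s d
    pushCase-Simulates {M = a · b} br (gapp ga gb) d with pushCase-Simulates br ga (λ h → d (inAppL h))
    ... | g , e = gapp g gb , cong (_· unfill b) e
    pushCase-Simulates br (glam ga) d with pushCase-Simulates (BranchesSim-weaken br) ga (λ h → d (inLam h))
    ... | g , e = glam g , cong lam e
    pushCase-Simulates br (gcase {i = i} gψ) d with pushCaseB-Simulates br gψ (λ h → d (inCaseB h))
    ... | g , e = gcase g , cong (λ z → case z (var i)) e

    pushCaseB-Simulates : ∀ {k m} {θ θU : Binding nc (Tm k)} {ψ : Branches k m} → BranchesSim θ θU → FilledNfB ψ →
        ¬ HasFailureB (pushCaseB θU (unfillB ψ)) →
               FilledNfB (pushCaseB θ ψ) × unfillB (pushCaseB θ ψ) ≡ pushCaseB θU (unfillB ψ)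
    pushCaseB-Simulates br [] d = [] , refl
    pushCaseB-Simulates {k} {θ = θ} {θU} {just u ∷ ψ} br (gj (inj₁ refl) gψ) d with pushCaseB-Simulates br gψ (λ h → d (lemZ h))
      where lemZ : HasFailureB (pushCaseB θU (unfillB ψ)) → HasFailureB (pushCaseB θU (unfillB (just stuck ∷ ψ)))
            lemZ h rewrite isStuck-stuck {k} = there h
    ... | g , e rewrite pushCaseB-nothings {k} {n} θ | allNothing-nothings {k} {n} = gj (inj₁ refl) g , cong (nothing ∷_) e
    pushCaseB-Simulates {k} {θ = θ} {θU} {just u ∷ ψ} br (gj (inj₂ gu) gψ) d with isStuck u | FilledNf⇒¬stuck gu
    ... | .false | refl with pushCase-Simulates br gu (λ h → d (here h)) | pushCaseB-Simulates br gψ (λ h → d (there h))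
    ... | g1 , e1 | g , e rewrite FilledNf⇒¬stuck g1 = gj (inj₂ g1) g , cong₂ (λ a b → just a ∷ b) e1 e

  mutual
    nsubst-Simulates : ∀ {k l} {a : Tm k} → Filled a → (σ : Fin k → Tm l) → (∀ i → FilledNf (σ i)) →
        Simulates (nsubst a σ) (nsubst (unfill a) (λ i → unfill (σ i)))
    nsubst-Simulates (fvar {i}) σ gσ d = gσ i , refl
    nsubst-Simulates fcon σ gσ d = gcon , refl
    nsubst-Simulates (fapp pa pb) σ gσ d with nsubst-Simulates pa σ gσ (λ h → d (inAppL h)) | nsubst-Simulates pb σ gσ (λ h → d (inAppR h))
    ... | g1 , e1 | g2 , e2 = gapp g1 g2 , cong₂ _·_ e1 e2
    nsubst-Simulates {a = lam a} (flam pa) σ gσ d with Simulates-≡ (nsubst-cong pw (unfill a)) (nsubst-Simulates pa (extS σ) gext) (λ h → d (inLam h))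
      where pw : (λ i → unfill (extS σ i)) ≗ extS (λ i → unfill (σ i))
            pw zero = refl
            pw (suc i) = unfill-rename suc (σ i)
            gext : ∀ i → FilledNf (extS σ i)
            gext zero = gvar
            gext (suc i) = FilledNf-rename suc (gσ i)
    ... | g , e = glam g , cong lam e
    nsubst-Simulates {a = case θ t} (fcase pθ pt) σ gσ d with nsubst-Simulates pt σ gσ (λ h → d (HasFailure-pushCase (nsubstB (unfillB θ) (λ i → unfill (σ i))) (Nf-nsubst (λ i → Nf-unfill (gσ i)) (unfill t)) h))
    ... | gM , eM = Simulates-≡ (cong (pushCase (nsubstB (unfillB θ) (λ i → unfill (σ i)))) eM) (pushCase-Simulates (nsubstB-BranchesSim pθ σ gσ) gM) d

    nsubstB-BranchesSim : ∀ {k l m} {θ : Branches k m} → FilledB θ → (σ : Fin k → Tm l) → (∀ i → FilledNf (σ i)) →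
        BranchesSim (nsubstB θ σ) (nsubstB (unfillB θ) (λ i → unfill (σ i)))
    nsubstB-BranchesSim [] σ gσ = []
    nsubstB-BranchesSim {k} {θ = just u ∷ θ} (fj (inj₁ refl) p) σ gσ rewrite nsubst-stuck σ | isStuck-stuck {k} = bz (nsubstB-BranchesSim p σ gσ)
    nsubstB-BranchesSim {θ = just u ∷ θ} (fj (inj₂ pu) p) σ gσ rewrite Filled⇒¬stuck pu = bj (nsubst-Simulates pu σ gσ) (nsubstB-BranchesSim p σ gσ)

  nothings-irreducible : ∀ {R : TmRel} {k} m {θ : Branches k m} → CompatB R (nothings m) θ → ⊥
  nothings-irreducible (suc m) (there d) = nothings-irreducible m d

  stuck-irreducible : ∀ {k} {x : Tm k} → stuck ⟶βη x → ⊥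
  stuck-irreducible (top (β-step ()))
  stuck-irreducible (top (η-step ()))
  stuck-irreducible (caseB (there d)) = nothings-irreducible n d

  -- A β-step is mirrored by the β-step of the unfilled term, whose reduct must be
  -- defined; this is where hereditary definedness is needed.
  mutual
    unfill-⟶βη : ∀ {k} {a a' : Tm k} → FilledNf a → a ⟶βη a' → HereditarilyDefined (unfill a) →
        FilledNf a' × ((unfill a ≡ unfill a') ⊎ (unfill a ⟶βη unfill a'))
    unfill-⟶βη (gapp (glam gp) gq) (top (β-step (beta {p} {q}))) hd with Simulates-≡ (nsubst-cong pw (unfill p)) (nsubst-Simulates (FilledNf⇒Filled gp) (sub0 q) gsub) (hd _ (⟶βη⇒⟶* stepU))
      where
        stepU : (lam (unfill p) · unfill q) ⟶βη nsubst (unfill p) (sub0 (unfill q))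
        stepU = top (β-step beta)
        pw : (λ i → unfill (sub0 q i)) ≗ sub0 (unfill q)
        pw zero = refl
        pw (suc i) = refl
        gsub : ∀ i → FilledNf (sub0 q i)
        gsub zero = gq
        gsub (suc i) = gvar
    ... | g , e = g , inj₂ (≡subst (λ z → (lam (unfill p) · unfill q) ⟶βη z) (sym e) (top (β-step beta)))
    unfill-⟶βη (glam (gapp gx gvar)) (top (η-step (eta {M = M} refl))) hd = FilledNf-rename⁻¹ suc M gx , inj₂ (top (η-step (eta (unfill-rename suc M))))
    unfill-⟶βη {a = a · b} (gapp ga gb) (appL d) hd with unfill-⟶βη ga d (λ y r h → hd (y · unfill b) (λ*appL r) (inAppL h))
    ... | g , inj₁ e = gapp g gb , inj₁ (cong (_· unfill b) e)
    ... | g , inj₂ s = gapp g gb , inj₂ (appL s)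
    unfill-⟶βη {a = a · b} (gapp ga gb) (appR d) hd with unfill-⟶βη gb d (λ y r h → hd (unfill a · y) (λ*appR r) (inAppR h))
    ... | g , inj₁ e = gapp ga g , inj₁ (cong (unfill a ·_) e)
    ... | g , inj₂ s = gapp ga g , inj₂ (appR s)
    unfill-⟶βη (glam ga) (lamC d) hd with unfill-⟶βη ga d (λ y r h → hd (lam y) (λ*lam r) (inLam h))
    ... | g , inj₁ e = glam g , inj₁ (cong lam e)
    ... | g , inj₂ s = glam g , inj₂ (lamC s)
    unfill-⟶βη {a = case θ (var i)} (gcase gθ) (caseB d) hd with unfillB-⟶βη gθ d (λ r h → hd _ (λ*caseB r) (inCaseB h))
    ... | g , inj₁ e = gcase g , inj₁ (cong (λ z → case z (var i)) e)
    ... | g , inj₂ s = gcase g , inj₂ (caseB s)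

    unfillB-⟶βη : ∀ {k m} {θ θ' : Branches k m} → FilledNfB θ → CompatB BetaEta θ θ' →
        (∀ {θ''} → Star _⟶B_ (unfillB θ) θ'' → ¬ HasFailureB θ'') →
               FilledNfB θ' × ((unfillB θ ≡ unfillB θ') ⊎ CompatB BetaEta (unfillB θ) (unfillB θ'))
    unfillB-⟶βη (gj (inj₁ refl) gs) (here d) hd = ⊥-elim (stuck-irreducible d)
    unfillB-⟶βη {θ = just u ∷ θ} (gj (inj₂ gu) gs) (here {u' = u'} d) hd with isStuck u | FilledNf⇒¬stuck gu
    ... | .false | refl with unfill-⟶βη gu d (λ y r h → hd (λ*hd r) (here h))
    ... | g' , r with isStuck u' | FilledNf⇒¬stuck g'
    ... | .false | refl with r
    ... | inj₁ e = gj (inj₂ g') gs , inj₁ (cong (λ z → just z ∷ unfillB θ) e)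
    ... | inj₂ s = gj (inj₂ g') gs , inj₂ (here s)
    unfillB-⟶βη {θ = just u ∷ θ} (gj b gs) (there d) hd with unfillB-⟶βη gs d (λ r h → hd (λ*tl r) (there h))
    ... | g' , inj₁ e = gj b g' , inj₁ (cong (unfillBranch (isStuck u) u ∷_) e)
    ... | g' , inj₂ s = gj b g' , inj₂ (there s)

  unfill-⟶βη* : ∀ {k} {a b : Tm k} → FilledNf a → Star _⟶βη_ a b → HereditarilyDefined (unfill a) →
      FilledNf b × Star _⟶βη_ (unfill a) (unfill b)
  unfill-⟶βη* g ε hd = g , ε
  unfill-⟶βη* g (x ◅ xs) hd with unfill-⟶βη g x hd
  ... | g1 , inj₁ e with unfill-⟶βη* g1 xs (≡subst HereditarilyDefined e hd)
  ...   | g2 , s = g2 , ≡subst (λ z → Star _⟶βη_ z _) (sym e) s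
  unfill-⟶βη* g (x ◅ xs) hd | g1 , inj₂ st with unfill-⟶βη* g1 xs (λ y r → hd y (⟶βη⇒⟶* st ◅◅ r))
  ...   | g2 , s = g2 , st ◅ s

  module Fstuck = Fill (λ {k} → stuck {k})

  mutual
    Filled-fill : ∀ {k} (t : Tm k) → Filled (Fstuck.fill t)
    Filled-fill (var i) = fvar
    Filled-fill (t · u) = fapp (Filled-fill t) (Filled-fill u)
    Filled-fill (lam t) = flam (Filled-fill t)
    Filled-fill (con c) = fcon
    Filled-fill (case θ t) = fcase (FilledB-fillB θ) (Filled-fill t)

    FilledB-fillB : ∀ {k m} (θ : Branches k m) → FilledB (Fstuck.fillB θ)
    FilledB-fillB [] = []
    FilledB-fillB (nothing ∷ θ) = fj (inj₁ refl) (FilledB-fillB θ)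
    FilledB-fillB (just u ∷ θ) = fj (inj₂ (Filled-fill u)) (FilledB-fillB θ)

  mutual
    unfill-fill : ∀ {k} (t : Tm k) → unfill (Fstuck.fill t) ≡ t
    unfill-fill (var i) = refl
    unfill-fill (t · u) = cong₂ _·_ (unfill-fill t) (unfill-fill u)
    unfill-fill (lam t) = cong lam (unfill-fill t)
    unfill-fill (con c) = refl
    unfill-fill (case θ t) = cong₂ case (unfillB-fillB θ) (unfill-fill t)

    unfillB-fillB : ∀ {k m} (θ : Branches k m) → unfillB (Fstuck.fillB θ) ≡ θ
    unfillB-fillB [] = refl
    unfillB-fillB {k} (nothing ∷ θ) rewrite isStuck-stuck {k} = cong (nothing ∷_) (unfillB-fillB θ)
    unfillB-fillB (just u ∷ θ) rewrite Filled⇒¬stuck (Filled-fill u) = cong₂ (λ a b → just a ∷ b) (unfill-fill u) (unfillB-fillB θ)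

  FilledNf-nf-fill : ∀ {k} (t : Tm k) → HereditarilyDefined t → FilledNf (nf (Fstuck.fill t)) × unfill (nf (Fstuck.fill t)) ≡ nf t
  FilledNf-nf-fill t hd = Simulates-≡ (cong nf (unfill-fill t)) (nsubst-Simulates (Filled-fill t) var (λ _ → gvar)) (hd (nf t) (⟶*nf t))

  reflect-stuck : ∀ {k} (t : Tm k) → HereditarilyDefined t → ∀ {d} → Star _⟶βη_ (nf (Fstuck.fill t)) d → Star _⟶_ t (unfill d)
  reflect-stuck t hd s with FilledNf-nf-fill t hd
  ... | g , e with unfill-⟶βη* g s (≡subst HereditarilyDefined (sym e) (λ y r → hd y (⟶*nf t ◅◅ r)))
  ... | g' , s' = ⟶*nf t ◅◅ ⟶βη*⇒⟶* (≡subst (λ z → Star _⟶βη_ z _) e s')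

  stuckWitness : FailureWitness
  stuckWitness = record { F = stuck ; F-S = nsubst-stuck ; F-push = pushCase-stuck ; unfill = unfill ; reflect = reflect-stuck }

-- Without constructors there is no match failure; Ω is closed and inert under
-- case-normalisation, and filling is the identity since every case-binding is empty.

ω : ∀ {k} → Term 0 k
ω = lam (case [] (var zero) · var zero)

Ω : ∀ {k} → Term 0 k
Ω = ω · ω

nsubst-Ω : ∀ {k l} (σ : Fin k → Term 0 l) → nsubst Ω σ ≡ Ω
nsubst-Ω σ = refl

pushCase-Ω : ∀ {k} (θ : Binding 0 (Term 0 k)) → pushCase θ Ω ≡ Ω
pushCase-Ω [] = refl

module FΩ = Fill {0} (λ {k} → Ω {k})

fill-Ω : ∀ {k} (t : Term 0 k) → FΩ.fill t ≡ t
fill-Ω (var i) = refl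
fill-Ω (t · u) = cong₂ _·_ (fill-Ω t) (fill-Ω u)
fill-Ω (lam t) = cong lam (fill-Ω t)
fill-Ω (con c) = refl
fill-Ω (case [] t) = cong (case []) (fill-Ω t)

ΩWitness : FailureWitness
ΩWitness = record { F = Ω ; F-S = nsubst-Ω ; F-push = pushCase-Ω ; unfill = id ; reflect = reflect-Ω }
  where reflect-Ω : ∀ {k} (t : Term 0 k) → HereditarilyDefined t → ∀ {d} → Star _⟶βη_ (nf (FΩ.fill t)) d → Star _⟶_ t d
        reflect-Ω t _ s rewrite fill-Ω t = ⟶*nf t ◅◅ ⟶βη*⇒⟶* s

failureWitness : ∀ nc → FailureWitness {nc}
failureWitness zero    = ΩWitness
failureWitness (suc n) = stuckWitness

theorem2 : ∀ {nc k : ℕ} (t t' : Term nc k) →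
           HereditarilyDefined t → HereditarilyDefined t' →
           (∀ {o ℓ e : Level} (M : Model o ℓ e nc) → Model._≈_ M (Model.⟦_⟧ M t) (Model.⟦_⟧ M t')) →
           t ≡λC t'
theorem2 {nc} t t' hd hd' valid =
  complete (failureWitness nc) t t' hd hd' (valid (termModel (failureWitness nc)))
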